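{- Let $k,a,b,r$ be integers with $k\geq b>a\geq 1$ and $r\geq 1$. For $m\geq 1$, let $\mathcal{BP}_{a,b,k,r}(m)$ be the set of partitions $\pi=(\pi_1,\ldots,\pi_m)$ with exactly $m$ parts such that (1) each $\pi_i$ is congruent to $a$ or $b$ modulo $k$; (2) $\pi_m=a$ or $\pi_m=b$; (3) $\pi_i-\pi_{i+1}<k$ for $1\leq i<m$; (4) for $1\leq i\leq m-r$, if $\pi_{i+1}=\cdots=\pi_{i+r}\equiv b\pmod k$ then $\pi_i\equiv a\pmod k$. Let $\mathcal{BP}_{a,b,k,r}(m,a)$ (resp. $\mathcal{BP}_{a,b,k,r}(m,b)$) be the set of partitions in $\mathcal{BP}_{a,b,k,r}(m)$ whose smallest part is $a$ (resp. $b$). Then \begin{align*} &\sum_{\pi\in\mathcal{BP}_{a,b,k,r}(m,a)}\mu^{\ell_{k,a}(\pi)}\nu^{\ell_{k,b}(\pi)}q^{|\pi|}\\ &=\mu^mq^{ma}+\sum_{s\geq 1}\sum_{h\geq 0}\mu^{m-h-s}\nu^{h+s}q^{(m-h-s)a+(h+s)b+k(s^2-s)}g_{k,r}(h,s){{m-h-s}\brack {s}}_{k}, \end{align*} and \begin{align*} &\sum_{\pi\in\mathcal{BP}_{a,b,k,r}(m,b)}\mu^{\ell_{k,a}(\pi)}\nu^{\ell_{k,b}(\pi)}q^{|\pi|}\\ &=\sum_{s\geq 1}\sum_{h\geq 0}\mu^{m-h-s}\nu^{h+s}q^{(m-h-s)a+(h+s)b+k(s^2-s)+k(m-h-2s+1)}g_{k,r}(h,s){{m-h-s}\brack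 {s-1}}_{k}, \end{align*} where $g_{k,r}(h,s)=\sum_{i\geq 0}(-1)^iq^{rk(i^2-i)/2}{{s}\brack {i}}_{rk}{{h-ri+s-1}\brack {s-1}}_{k}$.
   Context: Partitions are non-increasing finite sequences of positive integers; $|\pi|$ is the sum of parts; $\ell_{k,d}(\pi)$ is the number of parts congruent to $d$ modulo $k$. $(x;q)_0=1$, $(x;q)_n=(1-x)\cdots(1-xq^{n-1})$. For a positive integer $k$ and integers $A,B$, ${A\brack B}_k=\frac{(q^k;q^k)_A}{(q^k;q^k)_B(q^k;q^k)_{A-B}}$ if $A\geq B\geq 0$, and $0$ otherwise. -}

module Defs where

open import Data.Nat as ℕ using (ℕ; zero; suc; _+_; _*_; _∸_; _%_; _/_; _≡ᵇ_; _<ᵇ_; _≤ᵇ_)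
open import Data.Integer as ℤ using (ℤ; +_)
open import Data.Bool using (Bool; true; false; _∧_; _∨_; if_then_else_)
open import Data.List using (List; []; _∷_; length; map; concatMap; take; upTo; foldr)
open import Data.Nat.ListAction using (sum)
open import Algebra.Bundles using (CommutativeRing)

-- Arithmetic modulo k (k ≥ 1 in the theorem; k = 0 case is unused)

modN : ℕ → ℕ → ℕ
modN zero    x = x
modN (suc k) x = x % suc k

congB : ℕ → ℕ → ℕ → Bool
congB k x y = modN k x ≡ᵇ modN k y

allB : {A : Set} → (A → Bool) → List A → Bool
allB p [] = true
allB p (x ∷ xs) = p x ∧ allB p xs

filterB : {A : Set} → (A → Bool) → List A → List A
filterB p [] = []
filterB p (x ∷ xs) = if p x then x ∷ filterB p xs else filterB p xs

-- Partitions with exactly m parts are lists [π₁, …, πₘ].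
-- boxLists N m : all lists of length m with entries in {1, …, N}.

boxLists : ℕ → ℕ → List (List ℕ)
boxLists N zero    = [] ∷ []
boxLists N (suc m) = concatMap (λ x → map (x ∷_) (boxLists N m)) (map suc (upTo N))

nonIncr : List ℕ → Bool
nonIncr [] = true
nonIncr (x ∷ []) = true
nonIncr (x ∷ y ∷ t) = (y ≤ᵇ x) ∧ nonIncr (y ∷ t)

lastIs : List ℕ → ℕ → Bool
lastIs [] v = false
lastIs (x ∷ []) v = x ≡ᵇ v
lastIs (x ∷ y ∷ t) v = lastIs (y ∷ t) v

gapsLt : ℕ → List ℕ → Bool
gapsLt k [] = true
gapsLt k (x ∷ []) = true
gapsLt k (x ∷ y ∷ t) = (x <ᵇ y + k) ∧ gapsLt k (y ∷ t)

blockB : ℕ → ℕ → ℕ → List ℕ → Bool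
blockB b k r [] = true
blockB b k r (y ∷ t) = allB (λ z → (z ≡ᵇ y) ∧ congB k z b) (take r (y ∷ t))

cond4 : ℕ → ℕ → ℕ → ℕ → List ℕ → Bool
cond4 a b k r [] = true
cond4 a b k r (x ∷ t) =
  (if (r ≤ᵇ length t) ∧ blockB b k r t then congB k x a else true) ∧ cond4 a b k r t

-- membership in BP_{a,b,k,r}(m) (length m and positivity are given by boxLists)
inBP : ℕ → ℕ → ℕ → ℕ → List ℕ → Bool
inBP a b k r π =
  nonIncr π
  ∧ allB (λ x → congB k x a ∨ congB k x b) π
  ∧ (lastIs π a ∨ lastIs π b)
  ∧ gapsLt k π
  ∧ cond4 a b k r π

-- BP_{a,b,k,r}(m, d) for d ∈ {a, b}: enumerated inside the box {1..N}^m
BPset : ℕ → ℕ → ℕ → ℕ → ℕ → ℕ → ℕ → List (List ℕ)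
BPset a b k r m d N = filterB (λ π → inBP a b k r π ∧ lastIs π d) (boxLists N m)

ell : ℕ → ℕ → List ℕ → ℕ
ell k d π = length (filterB (λ x → congB k x d) π)

module _ {c ℓ} (R : CommutativeRing c ℓ) where
  open CommutativeRing R renaming (Carrier to A; _+_ to _⊕_; _*_ to _⊗_)

  pow : A → ℕ → A
  pow x zero = 1#
  pow x (suc n) = x ⊗ pow x n

  sumR : List A → A
  sumR = foldr _⊕_ 0#

  gaussN : A → ℕ → ℕ → A
  gaussN x zero zero = 1#
  gaussN x zero (suc j) = 0#
  gaussN x (suc n) zero = 1#
  gaussN x (suc n) (suc j) = gaussN x n j ⊕ (pow x (suc j) ⊗ gaussN x n (suc j))

  -- [A brack B]_k in base q, for integers A, B (zero unless A ≥ B ≥ 0)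
  qbin : A → ℕ → ℤ → ℤ → A
  qbin q k (+ n) (+ j) = gaussN (pow q k) n j
  qbin q k _ _ = 0#

  -- g_{k,r}(h,s) = Σ_{i ≥ 0} (-1)^i q^{rk(i²-i)/2} [s brack i]_{rk} [h-ri+s-1 brack s-1]_k
  -- (terms with i > s vanish)
  gfun : ℕ → ℕ → A → ℕ → ℕ → A
  gfun k r q h s = sumR (map term (upTo (suc s)))
    where
    term : ℕ → A
    term i = pow (- 1#) i
             ⊗ (pow q (r * k * ((i * (i ∸ 1)) / 2))
             ⊗ (qbin q (r * k) (+ s) (+ i)
             ⊗ qbin q k (((+ h ℤ.- + (r * i)) ℤ.+ + s) ℤ.- + 1) (+ s ℤ.- + 1)))

  weight : ℕ → ℕ → ℕ → A → A → A → List ℕ → A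
  weight a b k μ ν q π = pow μ (ell k a π) ⊗ (pow ν (ell k b π) ⊗ pow q (sum π))

  LHS : ℕ → ℕ → ℕ → ℕ → ℕ → ℕ → ℕ → A → A → A → A
  LHS a b k r m d N μ ν q = sumR (map (weight a b k μ ν q) (BPset a b k r m d N))

  -- Σ_{s ≥ 1} Σ_{h ≥ 0} restricted to h + s ≤ m (all other terms vanish)
  doubleSum : ℕ → (ℕ → ℕ → A) → A
  doubleSum m f = sumR (map (λ s → sumR (map (λ h → f h s) (upTo (suc (m ∸ s))))) (map suc (upTo m)))

  RHSa : ℕ → ℕ → ℕ → ℕ → ℕ → A → A → A → A
  RHSa a b k r m μ ν q =
    (pow μ m ⊗ pow q (m * a)) ⊕
    doubleSum m (λ h s →
      pow μ (m ∸ (h + s)) ⊗ (pow ν (h + s)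
      ⊗ (pow q ((m ∸ (h + s)) * a + (h + s) * b + k * (s * s ∸ s))
      ⊗ (gfun k r q h s ⊗ qbin q k (+ (m ∸ (h + s))) (+ s)))))

  RHSb : ℕ → ℕ → ℕ → ℕ → ℕ → A → A → A → A
  RHSb a b k r m μ ν q =
    doubleSum m (λ h s →
      pow μ (m ∸ (h + s)) ⊗ (pow ν (h + s)
      ⊗ (pow q ((m ∸ (h + s)) * a + (h + s) * b + k * (s * s ∸ s) + k * ((m + 1) ∸ (h + 2 * s)))
      ⊗ (gfun k r q h s ⊗ qbin q k (+ (m ∸ (h + s))) (+ s ℤ.- + 1)))))

-- Parts that are ≡ a or b (mod k) and at least a form the chain a < b < k + a < k + b < 2k + a < …
-- (level s holding s·k + a and s·k + b). Consecutive parts differ by less than k, so a partition in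
-- BP_{a,b,k,r}(m) runs down this chain through every value between its largest and its smallest part,
-- and condition (4) says exactly that each value ≡ b occurs at most r times. Removing the largest part
-- therefore gives linear recursions in m for the weight of the partitions with a given largest part and
-- a given number of leading copies of it. They are solved by convolving the weight of the a-parts (all
-- levels used: a q-binomial coefficient in Q = q^k) with the weight of the b-parts (all levels used, each
-- at most r times: the alternating sum g_{k,r}, recognised through a telescoping recursion in s).
-- Summing over the largest part and regrouping by the number s of distinct values ≡ b gives both
-- right-hand sides.

module Submission where

open import Defs
open import Algebra.Bundles using (CommutativeRing)
import Algebra.Properties.CommutativeSemiring.Exp as ExpProperties
import Algebra.Properties.Ring as RingProperties
import Algebra.Solver.Ring.NaturalCoefficients.Default as NatCoefficientSolver
open import Data.Bool using (Bool; true; false; _∧_; _∨_; not; T; if_then_else_)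
import Data.Bool.Properties as Boolₚ
open import Data.Bool.Solver using (module ∨-∧-Solver)
open import Data.Empty using (⊥-elim)
open import Data.Integer as ℤ using (ℤ; +_; _⊖_)
import Data.Integer.Properties as ℤₚ
import Data.Integer.Tactic.RingSolver as ℤSolver
open import Data.List using (List; []; _∷_; length; take; map; upTo; _++_; _∷ʳ_; concat; concatMap)
import Data.List.Properties as Listₚ
open import Data.List.Relation.Unary.All using (All; []; _∷_)
open import Data.Nat as ℕ using (ℕ; zero; suc; _∸_; _≤_; _<_; _%_; _/_; z≤n; s≤s; _≡ᵇ_; _≤ᵇ_; _<ᵇ_)
open import Data.Nat.DivMod using (m≡m%n+[m/n]*n; [m+kn]%n≡m%n; m%n<n; m*n/n≡m)
open import Data.Nat.ListAction using (sum)
import Data.Nat.Properties as ℕₚ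
import Data.Nat.Tactic.RingSolver as ℕSolver
open import Data.Product using (_×_; _,_; ∃; proj₁; proj₂)
open import Data.Sum using (_⊎_; inj₁; inj₂)
open import Function using (_∘_; _∘′_)
open import Function.Bundles using (Equivalence)
open import Relation.Binary using (tri<; tri≈; tri>)
open import Relation.Binary.PropositionalEquality as ≡ using (_≡_; _≢_)
import Relation.Binary.Reasoning.Setoid as SetoidReasoning
open import Relation.Nullary using (¬_)

module Sums {c ℓ} (R : CommutativeRing c ℓ) where

  open CommutativeRing R public
  open SetoidReasoning setoid public
  open NatCoefficientSolver commutativeSemiring public using (solve; _:=_; _:+_; _:*_)
  open RingProperties ring public using (-‿distribˡ-*; -0#≈0#; -1*x≈-x; x[y-z]≈xy-xz; //-rightDividesʳ)
  open ExpProperties commutativeSemiring using (_^_; ^-homo-*; ^-assocʳ; ^-distrib-*; ^-congˡ)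

  pow≡^ : ∀ x n → pow R x n ≡ x ^ n
  pow≡^ x zero    = ≡.refl
  pow≡^ x (suc n) = ≡.cong (x *_) (pow≡^ x n)

  pow-+ : ∀ x m n → pow R x (m ℕ.+ n) ≈ pow R x m * pow R x n
  pow-+ x m n rewrite pow≡^ x (m ℕ.+ n) | pow≡^ x m | pow≡^ x n = ^-homo-* x m n

  pow-* : ∀ x m n → pow R x (m ℕ.* n) ≈ pow R (pow R x m) n
  pow-* x m n rewrite pow≡^ (pow R x m) n | pow≡^ x m | pow≡^ x (m ℕ.* n) = sym (^-assocʳ x m n)

  pow-distrib-* : ∀ x y n → pow R (x * y) n ≈ pow R x n * pow R y n
  pow-distrib-* x y n rewrite pow≡^ (x * y) n | pow≡^ x n | pow≡^ y n = ^-distrib-* x y n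

  pow-congˡ : ∀ {x y} n → x ≈ y → pow R x n ≈ pow R y n
  pow-congˡ {x} {y} n x≈y rewrite pow≡^ x n | pow≡^ y n = ^-congˡ n x≈y

  pow-congʳ : ∀ x {m n} → m ≡ n → pow R x m ≈ pow R x n
  pow-congʳ x m≡n = reflexive (≡.cong (pow R x) m≡n)

  ∑ : ℕ → (ℕ → Carrier) → Carrier
  ∑ zero    f = 0#
  ∑ (suc n) f = ∑ n f + f n

  ∑-cong : ∀ n {f g : ℕ → Carrier} → (∀ i → i < n → f i ≈ g i) → ∑ n f ≈ ∑ n g
  ∑-cong zero    f≈g = refl
  ∑-cong (suc n) f≈g = +-cong (∑-cong n (λ i i<n → f≈g i (ℕₚ.m≤n⇒m≤1+n i<n))) (f≈g n ℕₚ.≤-refl)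

  ∑-cong-∀ : ∀ n {f g : ℕ → Carrier} → (∀ i → f i ≈ g i) → ∑ n f ≈ ∑ n g
  ∑-cong-∀ n f≈g = ∑-cong n (λ i _ → f≈g i)

  ∑-zero : ∀ n (f : ℕ → Carrier) → (∀ i → i < n → f i ≈ 0#) → ∑ n f ≈ 0#
  ∑-zero zero    f f≈0 = refl
  ∑-zero (suc n) f f≈0 =
    trans (+-cong (∑-zero n f (λ i i<n → f≈0 i (ℕₚ.m≤n⇒m≤1+n i<n))) (f≈0 n ℕₚ.≤-refl)) (+-identityʳ 0#)

  ∑-distrib-+ : ∀ n (f g : ℕ → Carrier) → ∑ n (λ i → f i + g i) ≈ ∑ n f + ∑ n g
  ∑-distrib-+ zero    f g = sym (+-identityˡ 0#)
  ∑-distrib-+ (suc n) f g = trans (+-congʳ (∑-distrib-+ n f g)) (interchange _ _ _ _)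
    where
    interchange : ∀ w x y z → w + x + (y + z) ≈ w + y + (x + z)
    interchange = solve 4 (λ w x y z → w :+ x :+ (y :+ z) := w :+ y :+ (x :+ z)) refl

  *-distribˡ-∑ : ∀ n x (f : ℕ → Carrier) → x * ∑ n f ≈ ∑ n (λ i → x * f i)
  *-distribˡ-∑ zero    x f = zeroʳ x
  *-distribˡ-∑ (suc n) x f = trans (distribˡ x _ _) (+-congʳ (*-distribˡ-∑ n x f))

  ∑-suc : ∀ n (f : ℕ → Carrier) → ∑ (suc n) f ≈ f 0 + ∑ n (f ∘ suc)
  ∑-suc zero    f = trans (+-identityˡ _) (sym (+-identityʳ _))
  ∑-suc (suc n) f = trans (+-congʳ (∑-suc n f)) (+-assoc _ _ _)

  ∑-split : ∀ m n (f : ℕ → Carrier) → ∑ (m ℕ.+ n) f ≈ ∑ m f + ∑ n (λ i → f (m ℕ.+ i))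
  ∑-split m zero    f = trans (reflexive (≡.cong (λ l → ∑ l f) (ℕₚ.+-identityʳ m))) (sym (+-identityʳ _))
  ∑-split m (suc n) f = begin
    ∑ (m ℕ.+ suc n) f                               ≡⟨ ≡.cong (λ l → ∑ l f) (ℕₚ.+-suc m n) ⟩
    ∑ (m ℕ.+ n) f + f (m ℕ.+ n)                     ≈⟨ +-congʳ (∑-split m n f) ⟩
    ∑ m f + ∑ n (λ i → f (m ℕ.+ i)) + f (m ℕ.+ n)   ≈⟨ +-assoc _ _ _ ⟩
    ∑ m f + ∑ (suc n) (λ i → f (m ℕ.+ i))           ∎

  ∑-truncate : ∀ n d (f : ℕ → Carrier) → (∀ i → n ≤ i → f i ≈ 0#) → ∑ (n ℕ.+ d) f ≈ ∑ n f
  ∑-truncate n d f f≈0 = begin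
    ∑ (n ℕ.+ d) f                      ≈⟨ ∑-split n d f ⟩
    ∑ n f + ∑ d (λ i → f (n ℕ.+ i))    ≈⟨ +-congˡ (∑-zero d _ (λ i _ → f≈0 (n ℕ.+ i) (ℕₚ.m≤m+n n i))) ⟩
    ∑ n f + 0#                         ≈⟨ +-identityʳ _ ⟩
    ∑ n f                              ∎

  ∑-comm : ∀ m n (f : ℕ → ℕ → Carrier) → ∑ m (λ i → ∑ n (f i)) ≈ ∑ n (λ j → ∑ m (λ i → f i j))
  ∑-comm zero    n f = sym (∑-zero n _ (λ _ _ → refl))
  ∑-comm (suc m) n f = trans (+-congʳ (∑-comm m n f)) (sym (∑-distrib-+ n _ _))

  ∑-single : ∀ n (f : ℕ → Carrier) i₀ → i₀ < n → (∀ i → i < n → i ≢ i₀ → f i ≈ 0#) → ∑ n f ≈ f i₀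
  ∑-single (suc n) f i₀ i₀<1+n f≈0 with ℕₚ.<-cmp i₀ n
  ... | tri< i₀<n _ _ =
    trans (+-cong (∑-single n f i₀ i₀<n (λ i i<n → f≈0 i (ℕₚ.m≤n⇒m≤1+n i<n)))
                  (f≈0 n ℕₚ.≤-refl (ℕₚ.>⇒≢ i₀<n)))
          (+-identityʳ _)
  ... | tri≈ _ ≡.refl _ = trans (+-congʳ (∑-zero n f (λ i i<n → f≈0 i (ℕₚ.m≤n⇒m≤1+n i<n) (ℕₚ.<⇒≢ i<n))))
                              (+-identityˡ _)
  ... | tri> _ _ n<i₀ = ⊥-elim (ℕₚ.<⇒≱ i₀<1+n n<i₀)

  ∑-telescope : ∀ n (u : ℕ → Carrier) → ∑ n (λ i → u i - u (suc i)) ≈ u 0 - u n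
  ∑-telescope zero    u = sym (-‿inverseʳ (u 0))
  ∑-telescope (suc n) u = begin
    ∑ n (λ i → u i - u (suc i)) + (u n - u (suc n))    ≈⟨ +-congʳ (∑-telescope n u) ⟩
    u 0 - u n + (u n - u (suc n))                      ≈⟨ regroup (u 0) (u n) (- u n) (- u (suc n)) ⟩
    u 0 + - u (suc n) + (- u n + u n)                  ≈⟨ +-congˡ (-‿inverseˡ (u n)) ⟩
    u 0 - u (suc n) + 0#                               ≈⟨ +-identityʳ _ ⟩
    u 0 - u (suc n)                                    ∎
    where
    regroup : ∀ w x y z → w + y + (x + z) ≈ w + z + (y + x)
    regroup = solve 4 (λ w x y z → w :+ y :+ (x :+ z) := w :+ z :+ (y :+ x)) refl

  ∑-interleave : ∀ M (f g : ℕ → Carrier) → ∑ (suc M) (λ s → f s + g s) ≈ f 0 + (∑ M (λ s → g s + f (suc s)) + g M)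
  ∑-interleave zero    f g = trans (+-identityˡ _) (+-congˡ (sym (+-identityˡ _)))
  ∑-interleave (suc M) f g = trans (+-congʳ (∑-interleave M f g)) (regroup _ _ _ _ _)
    where
    regroup : ∀ f₀ S gM f₁ g₁ → f₀ + (S + gM) + (f₁ + g₁) ≈ f₀ + ((S + (gM + f₁)) + g₁)
    regroup = solve 5 (λ f₀ S gM f₁ g₁ → f₀ :+ (S :+ gM) :+ (f₁ :+ g₁) := f₀ :+ ((S :+ (gM :+ f₁)) :+ g₁)) refl

  sumR-upTo : ∀ n (f : ℕ → Carrier) → sumR R (map f (upTo n)) ≈ ∑ n f
  sumR-upTo zero    f = refl
  sumR-upTo (suc n) f = begin
    sumR R (map f (upTo (suc n)))             ≡⟨ ≡.cong (sumR R ∘ map f) (Listₚ.upTo-∷ʳ n) ⟨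
    sumR R (map f (upTo n ∷ʳ n))              ≡⟨ ≡.cong (sumR R) (Listₚ.map-++ f (upTo n) (n ∷ [])) ⟩
    sumR R (map f (upTo n) ++ (f n ∷ []))     ≈⟨ sumR-++ (map f (upTo n)) (f n ∷ []) ⟩
    sumR R (map f (upTo n)) + (f n + 0#)      ≈⟨ +-cong (sumR-upTo n f) (+-identityʳ _) ⟩
    ∑ (suc n) f                               ∎
    where
    sumR-++ : ∀ xs ys → sumR R (xs ++ ys) ≈ sumR R xs + sumR R ys
    sumR-++ []       ys = sym (+-identityˡ _)
    sumR-++ (x ∷ xs) ys = trans (+-congˡ (sumR-++ xs ys)) (sym (+-assoc _ _ _))

  when : Bool → Carrier → Carrier
  when true  x = x
  when false x = 0#

  when-true : ∀ {b} x → b ≡ true → when b x ≈ x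
  when-true x ≡.refl = refl

  when-false : ∀ {b} x → b ≡ false → when b x ≈ 0#
  when-false x ≡.refl = refl

  when-0# : ∀ b → when b 0# ≈ 0#
  when-0# true  = refl
  when-0# false = refl

  when-cong : ∀ b {x y} → x ≈ y → when b x ≈ when b y
  when-cong true  x≈y = x≈y
  when-cong false x≈y = refl

  when-∧ : ∀ b₁ b₂ x → when (b₁ ∧ b₂) x ≈ when b₁ (when b₂ x)
  when-∧ true  b₂ x = refl
  when-∧ false b₂ x = refl

  when-∨ : ∀ b₁ b₂ x → b₁ ∧ b₂ ≡ false → when (b₁ ∨ b₂) x ≈ when b₁ x + when b₂ x
  when-∨ true  false x _ = sym (+-identityʳ x)
  when-∨ false b₂    x _ = sym (+-identityˡ _)

  *-when : ∀ b x y → x * when b y ≈ when b (x * y)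
  *-when true  x y = refl
  *-when false x y = zeroʳ x

  sumOver : {X : Set} → List X → (X → Carrier) → Carrier
  sumOver L f = sumR R (map f L)

  module _ {X : Set} where

    sumOver-cong : ∀ (L : List X) {f g} → (∀ t → f t ≈ g t) → sumOver L f ≈ sumOver L g
    sumOver-cong []      f≈g = refl
    sumOver-cong (t ∷ L) f≈g = +-cong (f≈g t) (sumOver-cong L f≈g)

    sumOver-zero : ∀ (L : List X) → sumOver L (λ _ → 0#) ≈ 0#
    sumOver-zero []      = refl
    sumOver-zero (t ∷ L) = trans (+-identityˡ _) (sumOver-zero L)

    sumOver-distrib-+ : ∀ (L : List X) f g → sumOver L (λ t → f t + g t) ≈ sumOver L f + sumOver L g
    sumOver-distrib-+ []      f g = sym (+-identityˡ 0#)
    sumOver-distrib-+ (t ∷ L) f g = trans (+-congˡ (sumOver-distrib-+ L f g)) (interchange _ _ _ _)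
      where
      interchange : ∀ w x y z → w + x + (y + z) ≈ w + y + (x + z)
      interchange = solve 4 (λ w x y z → w :+ x :+ (y :+ z) := w :+ y :+ (x :+ z)) refl

    *-distribˡ-sumOver : ∀ (L : List X) x f → x * sumOver L f ≈ sumOver L (λ t → x * f t)
    *-distribˡ-sumOver []      x f = zeroʳ x
    *-distribˡ-sumOver (t ∷ L) x f = trans (distribˡ x _ _) (+-congˡ (*-distribˡ-sumOver L x f))

    sumOver-∑ : ∀ (L : List X) n (f : ℕ → X → Carrier) → sumOver L (λ t → ∑ n (λ i → f i t)) ≈ ∑ n (λ i → sumOver L (f i))
    sumOver-∑ L zero    f = sumOver-zero L
    sumOver-∑ L (suc n) f = trans (sumOver-distrib-+ L _ _) (+-congʳ (sumOver-∑ L n f))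

    sumOver-when : ∀ (L : List X) b f → sumOver L (λ t → when b (f t)) ≈ when b (sumOver L f)
    sumOver-when L true  f = refl
    sumOver-when L false f = sumOver-zero L

    sumOver-++ : ∀ (L₁ L₂ : List X) f → sumOver (L₁ ++ L₂) f ≈ sumOver L₁ f + sumOver L₂ f
    sumOver-++ []       L₂ f = sym (+-identityˡ _)
    sumOver-++ (t ∷ L₁) L₂ f = trans (+-congˡ (sumOver-++ L₁ L₂ f)) (sym (+-assoc _ _ _))

    sumOver-concat : ∀ (Ls : List (List X)) f → sumOver (concat Ls) f ≈ sumOver Ls (λ L → sumOver L f)
    sumOver-concat []       f = refl
    sumOver-concat (L ∷ Ls) f = trans (sumOver-++ L (concat Ls) f) (+-congˡ (sumOver-concat Ls f))

    sumOver-filterB : ∀ (p : X → Bool) f (L : List X) → sumR R (map f (filterB p L)) ≈ sumOver L (λ t → when (p t) (f t))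
    sumOver-filterB p f []      = refl
    sumOver-filterB p f (t ∷ L) with p t
    ... | true  = +-congˡ (sumOver-filterB p f L)
    ... | false = trans (sumOver-filterB p f L) (sym (+-identityˡ _))

  InBox : ℕ → ℕ → List ℕ → Set
  InBox N m t = (length t ≡ m) × All (λ x → 1 ≤ x × x ≤ N) t

  sumOver-boxLists-suc : ∀ N m f →
    sumOver (boxLists N (suc m)) f ≈ ∑ N (λ i → sumOver (boxLists N m) (λ t → f (suc i ∷ t)))
  sumOver-boxLists-suc N m f = begin
    sumOver (concatMap (λ x → map (x ∷_) (boxLists N m)) (map suc (upTo N))) f
      ≈⟨ sumOver-concat (map (λ x → map (x ∷_) (boxLists N m)) (map suc (upTo N))) f ⟩
    sumR R (map (λ L → sumOver L f) (map (λ x → map (x ∷_) (boxLists N m)) (map suc (upTo N))))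
      ≡⟨ ≡.cong (sumR R) (≡.sym (Listₚ.map-∘ (map suc (upTo N)))) ⟩
    sumR R (map (λ x → sumOver (map (x ∷_) (boxLists N m)) f) (map suc (upTo N)))
      ≡⟨ ≡.cong (sumR R) (≡.sym (Listₚ.map-∘ (upTo N))) ⟩
    sumR R (map (λ i → sumOver (map (suc i ∷_) (boxLists N m)) f) (upTo N))
      ≈⟨ sumR-upTo N _ ⟩
    ∑ N (λ i → sumOver (map (suc i ∷_) (boxLists N m)) f)
      ≈⟨ ∑-cong-∀ N (λ i → reflexive (≡.cong (sumR R) (≡.sym (Listₚ.map-∘ (boxLists N m))))) ⟩
    ∑ N (λ i → sumOver (boxLists N m) (λ t → f (suc i ∷ t))) ∎

  sumOver-boxLists-cong : ∀ N m {f g : List ℕ → Carrier} →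
    (∀ t → InBox N m t → f t ≈ g t) → sumOver (boxLists N m) f ≈ sumOver (boxLists N m) g
  sumOver-boxLists-cong N zero    f≈g = +-cong (f≈g [] (≡.refl , [])) refl
  sumOver-boxLists-cong N (suc m) {f} {g} f≈g = begin
    sumOver (boxLists N (suc m)) f                             ≈⟨ sumOver-boxLists-suc N m f ⟩
    ∑ N (λ i → sumOver (boxLists N m) (λ t → f (suc i ∷ t)))
      ≈⟨ ∑-cong N (λ i i<N → sumOver-boxLists-cong N m (λ t (len , bounds) →
                               f≈g (suc i ∷ t) (≡.cong suc len , (s≤s z≤n , i<N) ∷ bounds))) ⟩
    ∑ N (λ i → sumOver (boxLists N m) (λ t → g (suc i ∷ t)))  ≈⟨ sumOver-boxLists-suc N m g ⟨
    sumOver (boxLists N (suc m)) g                             ∎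

module Levels (k′ a b : ℕ) (1≤a : 1 ≤ a) (a<b : a < b) (b≤k : b ≤ suc k′) where

  open import Data.Nat using (_+_; _*_)
  open ≡.≡-Reasoning

  -- k is taken as suc k′ so that modN k of Defs reduces to _% k.
  k : ℕ
  k = suc k′

  n<n+k : ∀ n → n < n + k
  n<n+k n = ℕₚ.m<m+n n (s≤s z≤n)

  ≤-window-mod⇒≡ : ∀ {x y} → x % k ≡ y % k → x ≤ y → y < x + k → x ≡ y
  ≤-window-mod⇒≡ {x} {y} x≡y x≤y y<x+k =
    ℕₚ.≤-antisym x≤y (ℕₚ.m∸n≡0⇒m≤n (≡.trans y∸x≡ (≡.cong (_* k) quotients-equal)))
    where
    y∸x≡ : y ∸ x ≡ (y / k ∸ x / k) * k
    y∸x≡ = begin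
      y ∸ x                                      ≡⟨ ≡.cong₂ _∸_ (m≡m%n+[m/n]*n y k) (m≡m%n+[m/n]*n x k) ⟩
      (y % k + y / k * k) ∸ (x % k + x / k * k)  ≡⟨ ≡.cong (λ ρ → (y % k + y / k * k) ∸ (ρ + x / k * k)) x≡y ⟩
      (y % k + y / k * k) ∸ (y % k + x / k * k)  ≡⟨ ℕₚ.[m+n]∸[m+o]≡n∸o (y % k) _ _ ⟩
      y / k * k ∸ x / k * k                      ≡⟨ ℕₚ.*-distribʳ-∸ k (y / k) (x / k) ⟨
      (y / k ∸ x / k) * k                        ∎
    quotients-equal : y / k ∸ x / k ≡ 0
    quotients-equal = ℕₚ.n<1⇒n≡0 (ℕₚ.*-cancelʳ-< k _ 1
      (≡.subst₂ _<_ y∸x≡ (≡.sym (ℕₚ.*-identityˡ k)) (ℕₚ.m<n+o⇒m∸n<o y x y<x+k)))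

  window-mod⇒≡ : ∀ {x y} → x % k ≡ y % k → x < y + k → y < x + k → x ≡ y
  window-mod⇒≡ {x} {y} x≡y x<y+k y<x+k with ℕₚ.≤-total x y
  ... | inj₁ x≤y = ≤-window-mod⇒≡ x≡y x≤y y<x+k
  ... | inj₂ y≤x = ≡.sym (≤-window-mod⇒≡ (≡.sym x≡y) y≤x x<y+k)

  b<a+k : b < a + k
  b<a+k = ℕₚ.≤-trans (s≤s b≤k) (ℕₚ.+-monoˡ-≤ k 1≤a)

  a≢b-mod : a % k ≢ b % k
  a≢b-mod a≡b = ℕₚ.<⇒≢ a<b (window-mod⇒≡ a≡b (ℕₚ.<-trans a<b (n<n+k b)) b<a+k)

  aPart bPart : ℕ → ℕ
  aPart s = s * k + a
  bPart s = s * k + b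

  aPart-mod : ∀ s → aPart s % k ≡ a % k
  aPart-mod s = ≡.trans (≡.cong (_% k) (ℕₚ.+-comm (s * k) a)) ([m+kn]%n≡m%n a s k)

  bPart-mod : ∀ s → bPart s % k ≡ b % k
  bPart-mod s = ≡.trans (≡.cong (_% k) (ℕₚ.+-comm (s * k) b)) ([m+kn]%n≡m%n b s k)

  aPart≢bPart : ∀ s s′ → aPart s ≢ bPart s′
  aPart≢bPart s s′ eq = a≢b-mod (≡.trans (≡.sym (aPart-mod s)) (≡.trans (≡.cong (_% k) eq) (bPart-mod s′)))

  aPart-injective : ∀ {s s′} → aPart s ≡ aPart s′ → s ≡ s′
  aPart-injective {s} {s′} eq = ℕₚ.*-cancelʳ-≡ s s′ k (ℕₚ.+-cancelʳ-≡ a (s * k) (s′ * k) eq)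

  bPart-injective : ∀ {s s′} → bPart s ≡ bPart s′ → s ≡ s′
  bPart-injective {s} {s′} eq = ℕₚ.*-cancelʳ-≡ s s′ k (ℕₚ.+-cancelʳ-≡ b (s * k) (s′ * k) eq)

  aPart<bPart : ∀ s → aPart s < bPart s
  aPart<bPart s = ℕₚ.+-monoʳ-< (s * k) a<b

  bPart<aPart+k : ∀ s → bPart s < aPart s + k
  bPart<aPart+k s = ≡.subst (bPart s <_) (≡.sym (ℕₚ.+-assoc (s * k) a k)) (ℕₚ.+-monoʳ-< (s * k) b<a+k)

  aPart-suc : ∀ s → aPart (suc s) ≡ aPart s + k
  aPart-suc s = ≡.trans (ℕₚ.+-assoc k (s * k) a) (ℕₚ.+-comm k (s * k + a))

  bPart<aPart-suc : ∀ s → bPart s < aPart (suc s)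
  bPart<aPart-suc s = ≡.subst (bPart s <_) (≡.sym (aPart-suc s)) (bPart<aPart+k s)

  aPart-suc<bPart+k : ∀ s → aPart (suc s) < bPart s + k
  aPart-suc<bPart+k s = ≡.subst (_< bPart s + k) (≡.sym (aPart-suc s)) (ℕₚ.+-monoˡ-< k (aPart<bPart s))

  bPart-mono-≤ : ∀ {s s′} → s ≤ s′ → bPart s ≤ bPart s′
  bPart-mono-≤ s≤s′ = ℕₚ.+-monoˡ-≤ b (ℕₚ.*-monoˡ-≤ k s≤s′)

  s<aPart : ∀ s → s < aPart s
  s<aPart s = ℕₚ.≤-trans (s≤s (ℕₚ.m≤m*n s k))
                (≡.subst (_≤ s * k + a) (ℕₚ.+-comm (s * k) 1) (ℕₚ.+-monoʳ-≤ (s * k) 1≤a))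

  1≤aPart : ∀ s → 1 ≤ aPart s
  1≤aPart s = ℕₚ.≤-trans 1≤a (ℕₚ.m≤n+m a (s * k))

  1≤bPart : ∀ s → 1 ≤ bPart s
  1≤bPart s = ℕₚ.≤-trans (1≤aPart s) (ℕₚ.<⇒≤ (aPart<bPart s))

  Admissible : ℕ → Set
  Admissible z = (z % k ≡ a % k) ⊎ (z % k ≡ b % k)

  IsPart : ℕ → Set
  IsPart z = ∃ λ s → (z ≡ aPart s) ⊎ (z ≡ bPart s)

  admissible⇒isPart : ∀ z → a ≤ z → Admissible z → IsPart z
  admissible⇒isPart z a≤z adm = s , part adm
    where
    s w : ℕ
    s = (z ∸ a) / k
    w = (z ∸ a) % k + a
    z≡s*k+w : z ≡ s * k + w
    z≡s*k+w = begin
      z                          ≡⟨ ℕₚ.m∸n+n≡m a≤z ⟨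
      (z ∸ a) + a                ≡⟨ ≡.cong (_+ a) (m≡m%n+[m/n]*n (z ∸ a) k) ⟩
      ((z ∸ a) % k + s * k) + a  ≡⟨ regroup ((z ∸ a) % k) (s * k) a ⟩
      s * k + w                  ∎
      where
      regroup : ∀ ρ σ α → (ρ + σ) + α ≡ σ + (ρ + α)
      regroup = ℕSolver.solve-∀
    w-mod : w % k ≡ z % k
    w-mod = ≡.sym (≡.trans (≡.cong (_% k) (≡.trans z≡s*k+w (ℕₚ.+-comm (s * k) w))) ([m+kn]%n≡m%n w s k))
    a≤w : a ≤ w
    a≤w = ℕₚ.m≤n+m a ((z ∸ a) % k)
    w<a+k : w < a + k
    w<a+k = ≡.subst (w <_) (ℕₚ.+-comm k a) (ℕₚ.+-monoˡ-< a (m%n<n (z ∸ a) k))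
    part : Admissible z → (z ≡ aPart s) ⊎ (z ≡ bPart s)
    part (inj₁ z≡a) = inj₁ (≡.trans z≡s*k+w (≡.cong (λ w → s * k + w)
      (window-mod⇒≡ (≡.trans w-mod z≡a) w<a+k (ℕₚ.≤-<-trans a≤w (n<n+k w)))))
    part (inj₂ z≡b) = inj₂ (≡.trans z≡s*k+w (≡.cong (λ w → s * k + w)
      (window-mod⇒≡ (≡.trans w-mod z≡b) (ℕₚ.<-≤-trans w<a+k (ℕₚ.+-monoˡ-≤ k (ℕₚ.<⇒≤ a<b)))
                    (ℕₚ.<-≤-trans b<a+k (ℕₚ.+-monoˡ-≤ k a≤w)))))

  below-aPart : ∀ z s → a ≤ z → Admissible z → z ≤ aPart s → aPart s < z + k →
                (z ≡ aPart s) ⊎ (∃ λ s′ → s ≡ suc s′ × z ≡ bPart s′)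
  below-aPart z s _ (inj₁ z≡a) z≤p p<z+k =
    inj₁ (window-mod⇒≡ (≡.trans z≡a (≡.sym (aPart-mod s))) (ℕₚ.≤-<-trans z≤p (n<n+k _)) p<z+k)
  below-aPart z zero a≤z (inj₂ z≡b) z≤a _ =
    ⊥-elim (a≢b-mod (≡.trans (≡.cong (_% k) (ℕₚ.≤-antisym a≤z z≤a)) z≡b))
  below-aPart z (suc s) _ (inj₂ z≡b) z≤p p<z+k =
    inj₂ (s , ≡.refl , window-mod⇒≡ (≡.trans z≡b (≡.sym (bPart-mod s)))
                         (ℕₚ.≤-<-trans z≤p (aPart-suc<bPart+k s)) (ℕₚ.<-trans (bPart<aPart-suc s) p<z+k))

  below-bPart : ∀ z s → Admissible z → z ≤ bPart s → bPart s < z + k → (z ≡ bPart s) ⊎ (z ≡ aPart s)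
  below-bPart z s (inj₂ z≡b) z≤p p<z+k =
    inj₁ (window-mod⇒≡ (≡.trans z≡b (≡.sym (bPart-mod s))) (ℕₚ.≤-<-trans z≤p (n<n+k _)) p<z+k)
  below-bPart z s (inj₁ z≡a) z≤p p<z+k =
    inj₂ (window-mod⇒≡ (≡.trans z≡a (≡.sym (aPart-mod s)))
            (ℕₚ.≤-<-trans z≤p (bPart<aPart+k s)) (ℕₚ.<-trans (aPart<bPart s) p<z+k))

T⇒≡true : ∀ {b} → T b → b ≡ true
T⇒≡true = Equivalence.to Boolₚ.T-≡

≡true⇒T : ∀ {b} → b ≡ true → T b
≡true⇒T = Equivalence.from Boolₚ.T-≡

¬T⇒≡false : ∀ {b} → ¬ T b → b ≡ false
¬T⇒≡false ¬t = Boolₚ.¬-not (¬t ∘ ≡true⇒T)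

≡false⇒¬T : ∀ {b} → b ≡ false → ¬ T b
≡false⇒¬T ≡.refl ()

module _ {m n : ℕ} where

  ≡⇒≡ᵇ-true : m ≡ n → (m ≡ᵇ n) ≡ true
  ≡⇒≡ᵇ-true = T⇒≡true ∘ ℕₚ.≡⇒≡ᵇ m n

  ≢⇒≡ᵇ-false : m ≢ n → (m ≡ᵇ n) ≡ false
  ≢⇒≡ᵇ-false m≢n = ¬T⇒≡false (m≢n ∘ ℕₚ.≡ᵇ⇒≡ m n)

  ≡ᵇ-true⇒≡ : (m ≡ᵇ n) ≡ true → m ≡ n
  ≡ᵇ-true⇒≡ = ℕₚ.≡ᵇ⇒≡ m n ∘ ≡true⇒T

  ≤⇒≤ᵇ-true : m ≤ n → (m ≤ᵇ n) ≡ true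
  ≤⇒≤ᵇ-true = T⇒≡true ∘ ℕₚ.≤⇒≤ᵇ

  >⇒≤ᵇ-false : n < m → (m ≤ᵇ n) ≡ false
  >⇒≤ᵇ-false n<m = ¬T⇒≡false (ℕₚ.<⇒≱ n<m ∘ ℕₚ.≤ᵇ⇒≤ m n)

  ≤ᵇ-true⇒≤ : (m ≤ᵇ n) ≡ true → m ≤ n
  ≤ᵇ-true⇒≤ = ℕₚ.≤ᵇ⇒≤ m n ∘ ≡true⇒T

  ≤ᵇ-false⇒> : (m ≤ᵇ n) ≡ false → n < m
  ≤ᵇ-false⇒> m≰ᵇn = ℕₚ.≰⇒> (≡false⇒¬T m≰ᵇn ∘ ℕₚ.≤⇒≤ᵇ)

  <⇒<ᵇ-true : m < n → (m <ᵇ n) ≡ true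
  <⇒<ᵇ-true = T⇒≡true ∘ ℕₚ.<⇒<ᵇ

  ≥⇒<ᵇ-false : n ≤ m → (m <ᵇ n) ≡ false
  ≥⇒<ᵇ-false n≤m = ¬T⇒≡false (ℕₚ.≤⇒≯ n≤m ∘ ℕₚ.<ᵇ⇒< m n)

  <ᵇ-true⇒< : (m <ᵇ n) ≡ true → m < n
  <ᵇ-true⇒< = ℕₚ.<ᵇ⇒< m n ∘ ≡true⇒T

≡ᵇ-refl : ∀ n → (n ≡ᵇ n) ≡ true
≡ᵇ-refl n = ≡⇒≡ᵇ-true {n} ≡.refl

∨-true⁻¹ : ∀ {x y} → x ∨ y ≡ true → (x ≡ true) ⊎ (y ≡ true)
∨-true⁻¹ {true}  _ = inj₁ ≡.refl
∨-true⁻¹ {false} e = inj₂ e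

∨-trueˡ : ∀ {x} y → x ≡ true → x ∨ y ≡ true
∨-trueˡ y ≡.refl = ≡.refl

∨-trueʳ : ∀ x {y} → y ≡ true → x ∨ y ≡ true
∨-trueʳ true  _ = ≡.refl
∨-trueʳ false e = e

∧-true : ∀ {x y} → x ≡ true → y ≡ true → x ∧ y ≡ true
∧-true ≡.refl e = e

∧-falseʳ : ∀ x {y} → y ≡ false → x ∧ y ≡ false
∧-falseʳ x ≡.refl = Boolₚ.∧-zeroʳ x

≡true⇔⇒≡ : ∀ {x y : Bool} → (x ≡ true → y ≡ true) → (y ≡ true → x ≡ true) → x ≡ y
≡true⇔⇒≡ {false} {false} _ _ = ≡.refl
≡true⇔⇒≡ {false} {true}  _ g = g ≡.refl
≡true⇔⇒≡ {true}  {false} f _ = ≡.sym (f ≡.refl)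
≡true⇔⇒≡ {true}  {true}  _ _ = ≡.refl

if-then-false≡not : ∀ c → (if c then false else true) ≡ not c
if-then-false≡not true  = ≡.refl
if-then-false≡not false = ≡.refl

not-≤ᵇ : ∀ m n → not (m ≤ᵇ n) ≡ (n <ᵇ m)
not-≤ᵇ m n = ≡true⇔⇒≡ (λ e → <⇒<ᵇ-true (≤ᵇ-false⇒> {m} {n} (Boolₚ.not-injective e)))
                      (λ e → ≡.cong not (>⇒≤ᵇ-false {m} {n} (<ᵇ-true⇒< {n} {m} e)))

<ᵇ-∧-≡ᵇ : ∀ r m n → (m <ᵇ r) ∧ (m ≡ᵇ n) ≡ (n <ᵇ r) ∧ (m ≡ᵇ n)
<ᵇ-∧-≡ᵇ r m n with m ≡ᵇ n in m≡n
... | false = ≡.trans (Boolₚ.∧-zeroʳ _) (≡.sym (Boolₚ.∧-zeroʳ _))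
... | true  rewrite ≡ᵇ-true⇒≡ {m} m≡n = ≡.refl

0≡ᵇ-comm : ∀ j → (0 ≡ᵇ j) ≡ (j ≡ᵇ 0)
0≡ᵇ-comm zero    = ≡.refl
0≡ᵇ-comm (suc j) = ≡.refl

firstPart : List ℕ → ℕ
firstPart []      = 0
firstPart (x ∷ _) = x

leading : (ℕ → Bool) → List ℕ → ℕ
leading p []       = 0
leading p (x ∷ xs) = if p x then suc (leading p xs) else 0

<ᵇ-suc : ∀ r n → (r <ᵇ suc n) ≡ (r ≤ᵇ n)
<ᵇ-suc zero    n = ≡.refl
<ᵇ-suc (suc r) n = ≡.refl

take-allB≡leading : ∀ r p l → ((r ≤ᵇ length l) ∧ allB p (take r l)) ≡ (r ≤ᵇ leading p l)
take-allB≡leading zero    p l       = ≡.refl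
take-allB≡leading (suc r) p []      = ≡.refl
take-allB≡leading (suc r) p (x ∷ l) with p x
... | true  = ≡.trans (≡.cong (_∧ allB p (take r l)) (<ᵇ-suc r (length l)))
                      (≡.trans (take-allB≡leading r p l) (≡.sym (<ᵇ-suc r (leading p l))))
... | false = Boolₚ.∧-zeroʳ _

module Partitions (k′ a b r d : ℕ) (1≤a : 1 ≤ a) (a<b : a < b) (b≤k : b ≤ suc k′) (1≤r : 1 ≤ r) where

  open import Data.Nat using (_+_)
  open Levels k′ a b 1≤a a<b b≤k public

  isAorB : ℕ → Bool
  isAorB x = congB k x a ∨ congB k x b

  valid : List ℕ → Bool
  valid t = inBP a b k r t ∧ lastIs t d

  sameB : ℕ → ℕ → Bool
  sameB y z = (z ≡ᵇ y) ∧ congB k z b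

  bRun : List ℕ → ℕ
  bRun []      = 0
  bRun (y ∷ t) = leading (sameB y) (y ∷ t)

  validHead : ℕ → ℕ → List ℕ → Bool
  validHead x z t =
    ((z ≤ᵇ x) ∧ isAorB x) ∧ ((x <ᵇ z + k) ∧ (if r ≤ᵇ bRun (z ∷ t) then congB k x a else true))

  valid-∷ : ∀ x z t → valid (x ∷ z ∷ t) ≡ valid (z ∷ t) ∧ validHead x z t
  valid-∷ x z t = ≡.trans
    (regroup (z ≤ᵇ x) (nonIncr (z ∷ t)) (isAorB x) (allB isAorB (z ∷ t))
             (lastIs (z ∷ t) a ∨ lastIs (z ∷ t) b) (x <ᵇ z + k) (gapsLt k (z ∷ t))
             (if (r ≤ᵇ length (z ∷ t)) ∧ blockB b k r (z ∷ t) then congB k x a else true)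
             (cond4 a b k r (z ∷ t)) (lastIs (z ∷ t) d))
    (≡.cong (λ w → valid (z ∷ t) ∧ (((z ≤ᵇ x) ∧ isAorB x) ∧ ((x <ᵇ z + k) ∧ (if w then congB k x a else true))))
            (take-allB≡leading r (sameB z) (z ∷ t)))
    where
    open ∨-∧-Solver using (solve; _:=_; _:*_)
    regroup : ∀ A₁ A₂ B₁ B₂ C D₁ D₂ E₁ E₂ F →
      ((A₁ ∧ A₂) ∧ ((B₁ ∧ B₂) ∧ (C ∧ ((D₁ ∧ D₂) ∧ (E₁ ∧ E₂))))) ∧ F
      ≡ ((A₂ ∧ (B₂ ∧ (C ∧ (D₂ ∧ E₂)))) ∧ F) ∧ ((A₁ ∧ B₁) ∧ (D₁ ∧ E₁))
    regroup = solve 10 (λ A₁ A₂ B₁ B₂ C D₁ D₂ E₁ E₂ F →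
      ((A₁ :* A₂) :* ((B₁ :* B₂) :* (C :* ((D₁ :* D₂) :* (E₁ :* E₂))))) :* F
      := ((A₂ :* (B₂ :* (C :* (D₂ :* E₂)))) :* F) :* ((A₁ :* B₁) :* (D₁ :* E₁))) ≡.refl

  valid-∷-false : ∀ x z t → valid (z ∷ t) ≡ false → valid (x ∷ z ∷ t) ≡ false
  valid-∷-false x z t invalid = ≡.trans (valid-∷ x z t) (≡.cong (_∧ validHead x z t) invalid)

  valid-∷⇒validHead : ∀ x z t → valid (x ∷ z ∷ t) ≡ true → validHead x z t ≡ true
  valid-∷⇒validHead x z t v = Boolₚ.∧-conicalʳ (valid (z ∷ t)) _ (≡.trans (≡.sym (valid-∷ x z t)) v)

  bRun-self : ∀ z t → bRun (z ∷ t) ≡ (if congB k z b then suc (leading (sameB z) t) else 0)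
  bRun-self z t = ≡.cong (λ w → if w ∧ congB k z b then suc (leading (sameB z) t) else 0) (≡ᵇ-refl z)

  bRun-∷ : ∀ x z t → bRun (x ∷ z ∷ t) ≡ (if congB k x b then suc (if z ≡ᵇ x then bRun (z ∷ t) else 0) else 0)
  bRun-∷ x z t = ≡.trans (bRun-self x (z ∷ t)) (≡.cong (λ w → if congB k x b then suc w else 0) leading-tail)
    where
    leading-tail : leading (sameB x) (z ∷ t) ≡ (if z ≡ᵇ x then bRun (z ∷ t) else 0)
    leading-tail with z ≡ᵇ x in z≡x
    ... | false = ≡.refl
    ... | true rewrite ≡ᵇ-true⇒≡ {z} {x} z≡x = ≡.sym (bRun-self x t)

  lastIs≤firstPart : ∀ t v → nonIncr t ≡ true → lastIs t v ≡ true → v ≤ firstPart t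
  lastIs≤firstPart (x ∷ [])    v _   last = ℕₚ.≤-reflexive (≡.sym (≡ᵇ-true⇒≡ last))
  lastIs≤firstPart (x ∷ y ∷ t) v dec last =
    ℕₚ.≤-trans (lastIs≤firstPart (y ∷ t) v (Boolₚ.∧-conicalʳ (y ≤ᵇ x) _ dec) last)
               (≤ᵇ-true⇒≤ (Boolₚ.∧-conicalˡ (y ≤ᵇ x) _ dec))

  valid⇒nonIncr : ∀ t → valid t ≡ true → nonIncr t ≡ true
  valid⇒nonIncr t v = Boolₚ.∧-conicalˡ (nonIncr t) _ (Boolₚ.∧-conicalˡ (inBP a b k r t) _ v)

  valid⇒allAorB : ∀ t → valid t ≡ true → allB isAorB t ≡ true
  valid⇒allAorB t v = Boolₚ.∧-conicalˡ (allB isAorB t) _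
    (Boolₚ.∧-conicalʳ (nonIncr t) _ (Boolₚ.∧-conicalˡ (inBP a b k r t) _ v))

  valid⇒lastIsAorB : ∀ t → valid t ≡ true → (lastIs t a ∨ lastIs t b) ≡ true
  valid⇒lastIsAorB t v = Boolₚ.∧-conicalˡ (lastIs t a ∨ lastIs t b) _
    (Boolₚ.∧-conicalʳ (allB isAorB t) _ (Boolₚ.∧-conicalʳ (nonIncr t) _ (Boolₚ.∧-conicalˡ (inBP a b k r t) _ v)))

  valid⇒a≤firstPart : ∀ t → valid t ≡ true → a ≤ firstPart t
  valid⇒a≤firstPart t v with ∨-true⁻¹ (valid⇒lastIsAorB t v)
  ... | inj₁ last≡a = lastIs≤firstPart t a (valid⇒nonIncr t v) last≡a
  ... | inj₂ last≡b = ℕₚ.≤-trans (ℕₚ.<⇒≤ a<b) (lastIs≤firstPart t b (valid⇒nonIncr t v) last≡b)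

  valid⇒admissible : ∀ z t → valid (z ∷ t) ≡ true → Admissible z
  valid⇒admissible z t v with ∨-true⁻¹ (Boolₚ.∧-conicalˡ (isAorB z) _ (valid⇒allAorB (z ∷ t) v))
  ... | inj₁ z≡a = inj₁ (≡ᵇ-true⇒≡ z≡a)
  ... | inj₂ z≡b = inj₂ (≡ᵇ-true⇒≡ z≡b)

  aPart-cong-a : ∀ s → congB k (aPart s) a ≡ true
  aPart-cong-a s = ≡⇒≡ᵇ-true (aPart-mod s)

  aPart-incong-b : ∀ s → congB k (aPart s) b ≡ false
  aPart-incong-b s = ≢⇒≡ᵇ-false (a≢b-mod ∘ ≡.trans (≡.sym (aPart-mod s)))

  bPart-incong-a : ∀ s → congB k (bPart s) a ≡ false
  bPart-incong-a s = ≢⇒≡ᵇ-false (λ b≡a → a≢b-mod (≡.trans (≡.sym b≡a) (bPart-mod s)))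

  bPart-cong-b : ∀ s → congB k (bPart s) b ≡ true
  bPart-cong-b s = ≡⇒≡ᵇ-true (bPart-mod s)

  aPart-isAorB : ∀ s → isAorB (aPart s) ≡ true
  aPart-isAorB s = ≡.cong (_∨ congB k (aPart s) b) (aPart-cong-a s)

  bPart-isAorB : ∀ s → isAorB (bPart s) ≡ true
  bPart-isAorB s = ∨-trueʳ (congB k (bPart s) a) (bPart-cong-b s)

  bRun-aPart : ∀ s t → bRun (aPart s ∷ t) ≡ 0
  bRun-aPart s t = ≡.trans (bRun-self (aPart s) t)
    (≡.cong (λ w → if w then suc (leading (sameB (aPart s)) t) else 0) (aPart-incong-b s))

  bRun-bPart-∷ : ∀ s z t → bRun (bPart s ∷ z ∷ t) ≡ suc (if z ≡ᵇ bPart s then bRun (z ∷ t) else 0)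
  bRun-bPart-∷ s z t = ≡.trans (bRun-∷ (bPart s) z t)
    (≡.cong (λ w → if w then suc (if z ≡ᵇ bPart s then bRun (z ∷ t) else 0) else 0) (bPart-cong-b s))

  bRun-bPart : ∀ s t → bRun (bPart s ∷ t) ≡ suc (leading (sameB (bPart s)) t)
  bRun-bPart s t = ≡.trans (bRun-self (bPart s) t)
    (≡.cong (λ w → if w then suc (leading (sameB (bPart s)) t) else 0) (bPart-cong-b s))

  bRun≤r : ∀ t → valid t ≡ true → bRun t ≤ r
  bRun≤r [] _ = z≤n
  bRun≤r (z ∷ []) _ rewrite bRun-self z [] with congB k z b
  ... | true  = 1≤r
  ... | false = z≤n
  bRun≤r (z ∷ y ∷ t) v = ≡.subst (_≤ r) (≡.sym (bRun-∷ z y t)) (bound (congB k z b) ≡.refl (y ≡ᵇ z))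
    where
    cond4-head : (if r ≤ᵇ bRun (y ∷ t) then congB k z a else true) ≡ true
    cond4-head = Boolₚ.∧-conicalʳ (z <ᵇ y + k) _
                   (Boolₚ.∧-conicalʳ ((y ≤ᵇ z) ∧ isAorB z) _ (valid-∷⇒validHead z y t v))
    z≡a : T (r ≤ᵇ bRun (y ∷ t)) → congB k z a ≡ true
    z≡a r≤run = ≡.subst (λ w → (if w then congB k z a else true) ≡ true) (T⇒≡true r≤run) cond4-head
    run<r : congB k z b ≡ true → bRun (y ∷ t) < r
    run<r z≡b = ≤ᵇ-false⇒> (¬T⇒≡false (λ r≤run →
      a≢b-mod (≡.trans (≡.sym (≡ᵇ-true⇒≡ {z % k} (z≡a r≤run))) (≡ᵇ-true⇒≡ {z % k} z≡b))))
    bound : ∀ zb → congB k z b ≡ zb → ∀ e → (if zb then suc (if e then bRun (y ∷ t) else 0) else 0) ≤ r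
    bound false _   _     = z≤n
    bound true  _   false = 1≤r
    bound true  z≡b true  = run<r z≡b

  validHead-aPart : ∀ s z t → validHead (aPart s) z t ≡ (z ≤ᵇ aPart s) ∧ (aPart s <ᵇ z + k)
  validHead-aPart s z t rewrite aPart-cong-a s | Boolₚ.if-eta (r ≤ᵇ bRun (z ∷ t)) {true}
                              | Boolₚ.∧-identityʳ (z ≤ᵇ aPart s) | Boolₚ.∧-identityʳ (aPart s <ᵇ z + k) = ≡.refl

  validHead-bPart : ∀ s z t →
    validHead (bPart s) z t ≡ ((z ≤ᵇ bPart s) ∧ (bPart s <ᵇ z + k)) ∧ not (r ≤ᵇ bRun (z ∷ t))
  validHead-bPart s z t rewrite bPart-incong-a s | bPart-cong-b s | if-then-false≡not (r ≤ᵇ bRun (z ∷ t))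
                              | Boolₚ.∧-identityʳ (z ≤ᵇ bPart s) =
    ≡.sym (Boolₚ.∧-assoc (z ≤ᵇ bPart s) (bPart s <ᵇ z + k) _)

  belowA : ℕ → ℕ → Bool
  belowA zero    z = false
  belowA (suc s) z = z ≡ᵇ bPart s

  window⇒≡true : ∀ {z v} → z ≤ v → v < z + k → (z ≤ᵇ v) ∧ (v <ᵇ z + k) ≡ true
  window⇒≡true z≤v v<z+k = ∧-true (≤⇒≤ᵇ-true z≤v) (<⇒<ᵇ-true v<z+k)

  window-aPart : ∀ s z → a ≤ z → Admissible z → (z ≤ᵇ aPart s) ∧ (aPart s <ᵇ z + k) ≡ (z ≡ᵇ aPart s) ∨ belowA s z
  window-aPart s z a≤z adm = ≡true⇔⇒≡ below⇒ (⇒below s)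
    where
    below⇒ : (z ≤ᵇ aPart s) ∧ (aPart s <ᵇ z + k) ≡ true → (z ≡ᵇ aPart s) ∨ belowA s z ≡ true
    below⇒ w with below-aPart z s a≤z adm (≤ᵇ-true⇒≤ (Boolₚ.∧-conicalˡ (z ≤ᵇ aPart s) _ w))
                                          (<ᵇ-true⇒< (Boolₚ.∧-conicalʳ (z ≤ᵇ aPart s) _ w))
    ... | inj₁ z≡p                 = ∨-trueˡ (belowA s z) (≡⇒≡ᵇ-true z≡p)
    ... | inj₂ (s′ , ≡.refl , z≡p) = ∨-trueʳ (z ≡ᵇ aPart s) (≡⇒≡ᵇ-true z≡p)
    window-at : ∀ {v w} → z ≡ w → z ≤ v → v < w + k → (z ≤ᵇ v) ∧ (v <ᵇ z + k) ≡ true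
    window-at ≡.refl = window⇒≡true
    ⇒below : ∀ s → (z ≡ᵇ aPart s) ∨ belowA s z ≡ true → (z ≤ᵇ aPart s) ∧ (aPart s <ᵇ z + k) ≡ true
    ⇒below s e with ∨-true⁻¹ e
    ⇒below s       e | inj₁ z≡p = window-at (≡ᵇ-true⇒≡ {z} z≡p) (ℕₚ.≤-reflexive (≡ᵇ-true⇒≡ z≡p)) (n<n+k _)
    ⇒below (suc s) e | inj₂ z≡p =
      window-at (≡ᵇ-true⇒≡ {z} z≡p) (ℕₚ.≤-trans (ℕₚ.≤-reflexive (≡ᵇ-true⇒≡ z≡p)) (ℕₚ.<⇒≤ (bPart<aPart-suc s)))
                (aPart-suc<bPart+k s)

  valid-aPart-∷ : ∀ s z t → valid (z ∷ t) ≡ true →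
    valid (aPart s ∷ z ∷ t) ∧ (bRun (aPart s ∷ z ∷ t) ≡ᵇ 0) ≡ (z ≡ᵇ aPart s) ∨ belowA s z
  valid-aPart-∷ s z t v = begin
    valid (aPart s ∷ z ∷ t) ∧ (bRun (aPart s ∷ z ∷ t) ≡ᵇ 0)
      ≡⟨ ≡.cong₂ _∧_ (valid-∷ (aPart s) z t) (≡.cong (_≡ᵇ 0) (bRun-aPart s (z ∷ t))) ⟩
    (valid (z ∷ t) ∧ validHead (aPart s) z t) ∧ true
      ≡⟨ Boolₚ.∧-identityʳ _ ⟩
    valid (z ∷ t) ∧ validHead (aPart s) z t
      ≡⟨ ≡.cong₂ _∧_ v (validHead-aPart s z t) ⟩
    (z ≤ᵇ aPart s) ∧ (aPart s <ᵇ z + k)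
      ≡⟨ window-aPart s z (valid⇒a≤firstPart (z ∷ t) v) (valid⇒admissible z t v) ⟩
    (z ≡ᵇ aPart s) ∨ belowA s z ∎
    where open ≡.≡-Reasoning

  window-bPart : ∀ s z → Admissible z → (z ≤ᵇ bPart s) ∧ (bPart s <ᵇ z + k) ≡ (z ≡ᵇ bPart s) ∨ (z ≡ᵇ aPart s)
  window-bPart s z adm = ≡true⇔⇒≡ below⇒ ⇒below
    where
    below⇒ : (z ≤ᵇ bPart s) ∧ (bPart s <ᵇ z + k) ≡ true → (z ≡ᵇ bPart s) ∨ (z ≡ᵇ aPart s) ≡ true
    below⇒ w with below-bPart z s adm (≤ᵇ-true⇒≤ (Boolₚ.∧-conicalˡ (z ≤ᵇ bPart s) _ w))
                                      (<ᵇ-true⇒< (Boolₚ.∧-conicalʳ (z ≤ᵇ bPart s) _ w))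
    ... | inj₁ z≡p = ∨-trueˡ (z ≡ᵇ aPart s) (≡⇒≡ᵇ-true z≡p)
    ... | inj₂ z≡p = ∨-trueʳ (z ≡ᵇ bPart s) (≡⇒≡ᵇ-true z≡p)
    window-at : ∀ {v w} → z ≡ w → z ≤ v → v < w + k → (z ≤ᵇ v) ∧ (v <ᵇ z + k) ≡ true
    window-at ≡.refl = window⇒≡true
    ⇒below : (z ≡ᵇ bPart s) ∨ (z ≡ᵇ aPart s) ≡ true → (z ≤ᵇ bPart s) ∧ (bPart s <ᵇ z + k) ≡ true
    ⇒below e with ∨-true⁻¹ e
    ... | inj₁ z≡p = window-at (≡ᵇ-true⇒≡ {z} z≡p) (ℕₚ.≤-reflexive (≡ᵇ-true⇒≡ z≡p)) (n<n+k _)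
    ... | inj₂ z≡p = window-at (≡ᵇ-true⇒≡ {z} z≡p)
                       (ℕₚ.≤-trans (ℕₚ.≤-reflexive (≡ᵇ-true⇒≡ z≡p)) (ℕₚ.<⇒≤ (aPart<bPart s))) (bPart<aPart+k s)

  continueB startB : ℕ → ℕ → List ℕ → ℕ → Bool
  continueB s z t j = (j <ᵇ r) ∧ ((z ≡ᵇ bPart s) ∧ (bRun (z ∷ t) ≡ᵇ j))
  startB    s z t j = (j ≡ᵇ 0) ∧ (z ≡ᵇ aPart s)

  continueB∧startB≡false : ∀ s z t j → continueB s z t j ∧ startB s z t j ≡ false
  continueB∧startB≡false s z t j with z ≡ᵇ bPart s in z≡b
  ... | false = ≡.cong (_∧ startB s z t j) (Boolₚ.∧-zeroʳ (j <ᵇ r))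
  ... | true  = ∧-falseʳ ((j <ᵇ r) ∧ (true ∧ (bRun (z ∷ t) ≡ᵇ j))) (∧-falseʳ (j ≡ᵇ 0) (≢⇒≡ᵇ-false (λ z≡a →
                  aPart≢bPart s s (≡.trans (≡.sym z≡a) (≡ᵇ-true⇒≡ {z} z≡b)))))

  valid-bPart-∷-cases : ∀ s z t j (zb : Bool) → (z ≡ᵇ bPart s) ≡ zb → (za : Bool) → (z ≡ᵇ aPart s) ≡ za →
    (((zb ∨ za) ∧ not (r ≤ᵇ bRun (z ∷ t))) ∧ ((if zb then bRun (z ∷ t) else 0) ≡ᵇ j))
      ≡ ((j <ᵇ r) ∧ (zb ∧ (bRun (z ∷ t) ≡ᵇ j))) ∨ ((j ≡ᵇ 0) ∧ za)
  valid-bPart-∷-cases s z t j true  z≡b true  z≡a =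
    ⊥-elim (aPart≢bPart s s (≡.trans (≡.sym (≡ᵇ-true⇒≡ {z} z≡a)) (≡ᵇ-true⇒≡ {z} z≡b)))
  valid-bPart-∷-cases s z t j true  _   false _   = begin
    not (r ≤ᵇ bRun (z ∷ t)) ∧ (bRun (z ∷ t) ≡ᵇ j)        ≡⟨ ≡.cong (_∧ (bRun (z ∷ t) ≡ᵇ j)) (not-≤ᵇ r (bRun (z ∷ t))) ⟩
    (bRun (z ∷ t) <ᵇ r) ∧ (bRun (z ∷ t) ≡ᵇ j)            ≡⟨ <ᵇ-∧-≡ᵇ r (bRun (z ∷ t)) j ⟩
    (j <ᵇ r) ∧ (bRun (z ∷ t) ≡ᵇ j)                       ≡⟨ Boolₚ.∨-identityʳ _ ⟨
    ((j <ᵇ r) ∧ (bRun (z ∷ t) ≡ᵇ j)) ∨ false             ≡⟨ ≡.cong (((j <ᵇ r) ∧ (bRun (z ∷ t) ≡ᵇ j)) ∨_) (Boolₚ.∧-zeroʳ (j ≡ᵇ 0)) ⟨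
    ((j <ᵇ r) ∧ (bRun (z ∷ t) ≡ᵇ j)) ∨ ((j ≡ᵇ 0) ∧ false) ∎
    where open ≡.≡-Reasoning
  valid-bPart-∷-cases s z t j false _ false _   = ≡.sym (≡.cong₂ _∨_ (Boolₚ.∧-zeroʳ (j <ᵇ r)) (Boolₚ.∧-zeroʳ (j ≡ᵇ 0)))
  valid-bPart-∷-cases s z t j false _ true  z≡a rewrite ≡ᵇ-true⇒≡ {z} z≡a | bRun-aPart s t | >⇒≤ᵇ-false {r} {0} 1≤r
                                                    | Boolₚ.∧-zeroʳ (j <ᵇ r) | Boolₚ.∧-identityʳ (j ≡ᵇ 0) = 0≡ᵇ-comm j

  valid-bPart-∷ : ∀ s z t j → valid (z ∷ t) ≡ true →
    valid (bPart s ∷ z ∷ t) ∧ (bRun (bPart s ∷ z ∷ t) ≡ᵇ suc j) ≡ continueB s z t j ∨ startB s z t j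
  valid-bPart-∷ s z t j v = begin
    valid (bPart s ∷ z ∷ t) ∧ (bRun (bPart s ∷ z ∷ t) ≡ᵇ suc j)
      ≡⟨ ≡.cong₂ _∧_ (valid-∷ (bPart s) z t) (≡.cong (_≡ᵇ suc j) (bRun-bPart-∷ s z t)) ⟩
    (valid (z ∷ t) ∧ validHead (bPart s) z t) ∧ (run ≡ᵇ j)
      ≡⟨ ≡.cong (λ w → (w ∧ validHead (bPart s) z t) ∧ (run ≡ᵇ j)) v ⟩
    validHead (bPart s) z t ∧ (run ≡ᵇ j)
      ≡⟨ ≡.cong (_∧ (run ≡ᵇ j)) (validHead-bPart s z t) ⟩
    (((z ≤ᵇ bPart s) ∧ (bPart s <ᵇ z + k)) ∧ not (r ≤ᵇ bRun (z ∷ t))) ∧ (run ≡ᵇ j)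
      ≡⟨ ≡.cong (λ w → (w ∧ not (r ≤ᵇ bRun (z ∷ t))) ∧ (run ≡ᵇ j)) (window-bPart s z (valid⇒admissible z t v)) ⟩
    (((z ≡ᵇ bPart s) ∨ (z ≡ᵇ aPart s)) ∧ not (r ≤ᵇ bRun (z ∷ t))) ∧ (run ≡ᵇ j)
      ≡⟨ valid-bPart-∷-cases s z t j (z ≡ᵇ bPart s) ≡.refl (z ≡ᵇ aPart s) ≡.refl ⟩
    continueB s z t j ∨ startB s z t j ∎
    where
    open ≡.≡-Reasoning
    run : ℕ
    run = if z ≡ᵇ bPart s then bRun (z ∷ t) else 0

module HeadSums {c ℓ} (R : CommutativeRing c ℓ) (k′ a b r d N : ℕ)
                (1≤a : 1 ≤ a) (a<b : a < b) (b≤k : b ≤ suc k′) (1≤r : 1 ≤ r) (d∈ab : (d ≡ a) ⊎ (d ≡ b))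
                (μ ν q : CommutativeRing.Carrier R) where

  open Sums R
  open Partitions k′ a b r d 1≤a a<b b≤k 1≤r

  wt : List ℕ → Carrier
  wt = weight R a b k μ ν q

  partWeight : ℕ → Carrier
  partWeight x = (if congB k x a then μ else 1#) * ((if congB k x b then ν else 1#) * pow R q x)

  weight-[] : wt [] ≈ 1#
  weight-[] = trans (*-identityˡ _) (*-identityˡ _)

  weight-∷ : ∀ x t → wt (x ∷ t) ≈ partWeight x * wt t
  weight-∷ x t = begin
    pow R μ (ell k a (x ∷ t)) * (pow R ν (ell k b (x ∷ t)) * pow R q (x ℕ.+ sum t))
      ≈⟨ *-cong (count μ a) (*-cong (count ν b) (pow-+ q x (sum t))) ⟩
    (ifA μ * pow R μ (ell k a t)) * ((ifB ν * pow R ν (ell k b t)) * (pow R q x * pow R q (sum t)))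
      ≈⟨ regroup _ _ _ _ _ _ ⟩
    partWeight x * wt t ∎
    where
    ifA ifB : Carrier → Carrier
    ifA z = if congB k x a then z else 1#
    ifB z = if congB k x b then z else 1#
    count : ∀ z e → pow R z (ell k e (x ∷ t)) ≈ (if congB k x e then z else 1#) * pow R z (ell k e t)
    count z e with congB k x e
    ... | true  = refl
    ... | false = sym (*-identityˡ _)
    regroup : ∀ x₁ x₂ y₁ y₂ z₁ z₂ → (x₁ * x₂) * ((y₁ * y₂) * (z₁ * z₂)) ≈ (x₁ * (y₁ * z₁)) * (x₂ * (y₂ * z₂))
    regroup = solve 6 (λ x₁ x₂ y₁ y₂ z₁ z₂ →
      (x₁ :* x₂) :* ((y₁ :* y₂) :* (z₁ :* z₂)) := (x₁ :* (y₁ :* z₁)) :* (x₂ :* (y₂ :* z₂))) refl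

  box : ℕ → List (List ℕ)
  box = boxLists N

  runSum : ℕ → ℕ → ℕ → Carrier
  runSum m v j = sumOver (box m) (λ t → when (valid t ∧ ((firstPart t ≡ᵇ v) ∧ (bRun t ≡ᵇ j))) (wt t))

  headSum : ℕ → ℕ → Carrier
  headSum m v = sumOver (box m) (λ t → when (valid t ∧ (firstPart t ≡ᵇ v)) (wt t))

  runSum-suc : ∀ m v j → 1 ≤ v → v ≤ N →
    runSum (suc m) v j ≈ partWeight v * sumOver (box m) (λ t → when (valid (v ∷ t) ∧ (bRun (v ∷ t) ≡ᵇ j)) (wt t))
  runSum-suc m (suc v) j _ v<N = begin
    runSum (suc m) (suc v) j
      ≈⟨ sumOver-boxLists-suc N m _ ⟩
    ∑ N (λ i → sumOver (box m) (λ t → guarded (suc i) ((i ≡ᵇ v) ∧ (bRun (suc i ∷ t) ≡ᵇ j)) t))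
      ≈⟨ ∑-single N _ v v<N other-heads ⟩
    sumOver (box m) (λ t → guarded (suc v) ((v ≡ᵇ v) ∧ (bRun (suc v ∷ t) ≡ᵇ j)) t)
      ≈⟨ sumOver-cong (box m) (λ t →
           trans (reflexive (≡.cong (λ e → guarded (suc v) (e ∧ (bRun (suc v ∷ t) ≡ᵇ j)) t) (≡ᵇ-refl v)))
                 (trans (when-cong (valid (suc v ∷ t) ∧ (bRun (suc v ∷ t) ≡ᵇ j)) (weight-∷ (suc v) t))
                        (sym (*-when (valid (suc v ∷ t) ∧ (bRun (suc v ∷ t) ≡ᵇ j)) (partWeight (suc v)) (wt t))))) ⟩
    sumOver (box m) (λ t → partWeight (suc v) * when (valid (suc v ∷ t) ∧ (bRun (suc v ∷ t) ≡ᵇ j)) (wt t))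
      ≈⟨ *-distribˡ-sumOver (box m) _ _ ⟨
    partWeight (suc v) * sumOver (box m) (λ t → when (valid (suc v ∷ t) ∧ (bRun (suc v ∷ t) ≡ᵇ j)) (wt t)) ∎
    where
    guarded : ℕ → Bool → List ℕ → Carrier
    guarded x g t = when (valid (x ∷ t) ∧ g) (wt (x ∷ t))
    other-heads : ∀ i → i < N → i ≢ v →
      sumOver (box m) (λ t → guarded (suc i) ((i ≡ᵇ v) ∧ (bRun (suc i ∷ t) ≡ᵇ j)) t) ≈ 0#
    other-heads i _ i≢v = trans (sumOver-cong (box m) (λ t → when-false _
                                  (∧-falseʳ (valid (suc i ∷ t)) (≡.cong (_∧ (bRun (suc i ∷ t) ≡ᵇ j)) (≢⇒≡ᵇ-false i≢v)))))
                                (sumOver-zero (box m))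

  headSumBelowA : ℕ → ℕ → Carrier
  headSumBelowA m zero    = 0#
  headSumBelowA m (suc s) = headSum m (bPart s)

  headSumBelowA-sumOver : ∀ m s → sumOver (box m) (λ t → when (valid t ∧ belowA s (firstPart t)) (wt t)) ≈ headSumBelowA m s
  headSumBelowA-sumOver m zero    = trans (sumOver-cong (box m) (λ t → when-false (wt t) (Boolₚ.∧-zeroʳ (valid t))))
                                          (sumOver-zero (box m))
  headSumBelowA-sumOver m (suc s) = refl

  runSum-aPart-zero : ∀ m s → aPart s ≤ N →
    runSum (suc (suc m)) (aPart s) 0 ≈ partWeight (aPart s) * (headSum (suc m) (aPart s) + headSumBelowA (suc m) s)
  runSum-aPart-zero m s p = trans (runSum-suc (suc m) (aPart s) 0 (1≤aPart s) p) (*-congˡ (begin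
    sumOver (box (suc m)) (λ t → when (valid (aPart s ∷ t) ∧ (bRun (aPart s ∷ t) ≡ᵇ 0)) (wt t))
      ≈⟨ sumOver-boxLists-cong N (suc m) split ⟩
    sumOver (box (suc m)) (λ t → when (valid t ∧ (firstPart t ≡ᵇ aPart s)) (wt t)
                                 + when (valid t ∧ belowA s (firstPart t)) (wt t))
      ≈⟨ sumOver-distrib-+ (box (suc m)) _ _ ⟩
    headSum (suc m) (aPart s) + sumOver (box (suc m)) (λ t → when (valid t ∧ belowA s (firstPart t)) (wt t))
      ≈⟨ +-congˡ (headSumBelowA-sumOver (suc m) s) ⟩
    headSum (suc m) (aPart s) + headSumBelowA (suc m) s ∎))
    where
    disjoint : ∀ s z → (z ≡ᵇ aPart s) ∧ belowA s z ≡ false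
    disjoint zero    z = Boolₚ.∧-zeroʳ _
    disjoint (suc s) z with z ≡ᵇ aPart (suc s) in z≡a
    ... | false = ≡.refl
    ... | true  = ≢⇒≡ᵇ-false (aPart≢bPart (suc s) s ∘′ ≡.trans (≡.sym (≡ᵇ-true⇒≡ {z} z≡a)))
    split : ∀ t → InBox N (suc m) t → when (valid (aPart s ∷ t) ∧ (bRun (aPart s ∷ t) ≡ᵇ 0)) (wt t)
              ≈ when (valid t ∧ (firstPart t ≡ᵇ aPart s)) (wt t) + when (valid t ∧ belowA s (firstPart t)) (wt t)
    split (z ∷ t) _ with valid (z ∷ t) in v
    ... | true  = trans (reflexive (≡.cong (λ g → when g (wt (z ∷ t))) (valid-aPart-∷ s z t v)))
                        (when-∨ (z ≡ᵇ aPart s) (belowA s z) (wt (z ∷ t)) (disjoint s z))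
    ... | false = trans (when-false (wt (z ∷ t)) (≡.cong (_∧ (bRun (aPart s ∷ z ∷ t) ≡ᵇ 0)) (valid-∷-false (aPart s) z t v)))
                        (sym (+-identityʳ 0#))

  runSum-aPart-suc : ∀ m s j → aPart s ≤ N → runSum (suc m) (aPart s) (suc j) ≈ 0#
  runSum-aPart-suc m s j p = begin
    runSum (suc m) (aPart s) (suc j)
      ≈⟨ runSum-suc m (aPart s) (suc j) (1≤aPart s) p ⟩
    partWeight (aPart s) * sumOver (box m) (λ t → when (valid (aPart s ∷ t) ∧ (bRun (aPart s ∷ t) ≡ᵇ suc j)) (wt t))
      ≈⟨ *-congˡ (sumOver-cong (box m) (λ t → when-false (wt t)
           (∧-falseʳ (valid (aPart s ∷ t)) (≡.cong (_≡ᵇ suc j) (bRun-aPart s t))))) ⟩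
    partWeight (aPart s) * sumOver (box m) (λ _ → 0#)
      ≈⟨ *-congˡ (sumOver-zero (box m)) ⟩
    partWeight (aPart s) * 0#
      ≈⟨ zeroʳ _ ⟩
    0# ∎

  runSum-bPart-zero : ∀ m s → bPart s ≤ N → runSum (suc m) (bPart s) 0 ≈ 0#
  runSum-bPart-zero m s p = begin
    runSum (suc m) (bPart s) 0
      ≈⟨ runSum-suc m (bPart s) 0 (1≤bPart s) p ⟩
    partWeight (bPart s) * sumOver (box m) (λ t → when (valid (bPart s ∷ t) ∧ (bRun (bPart s ∷ t) ≡ᵇ 0)) (wt t))
      ≈⟨ *-congˡ (sumOver-cong (box m) (λ t → when-false (wt t)
           (∧-falseʳ (valid (bPart s ∷ t)) (≡.cong (_≡ᵇ 0) (bRun-bPart s t))))) ⟩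
    partWeight (bPart s) * sumOver (box m) (λ _ → 0#)
      ≈⟨ *-congˡ (sumOver-zero (box m)) ⟩
    partWeight (bPart s) * 0#
      ≈⟨ zeroʳ _ ⟩
    0# ∎

  runSum-bPart-suc : ∀ m s j → bPart s ≤ N →
    runSum (suc (suc m)) (bPart s) (suc j)
      ≈ partWeight (bPart s) * (when (j <ᵇ r) (runSum (suc m) (bPart s) j) + when (j ≡ᵇ 0) (headSum (suc m) (aPart s)))
  runSum-bPart-suc m s j p = trans (runSum-suc (suc m) (bPart s) (suc j) (1≤bPart s) p) (*-congˡ (begin
    sumOver (box (suc m)) (λ t → when (valid (bPart s ∷ t) ∧ (bRun (bPart s ∷ t) ≡ᵇ suc j)) (wt t))
      ≈⟨ sumOver-boxLists-cong N (suc m) split ⟩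
    sumOver (box (suc m)) (λ t → when (j <ᵇ r) (when (valid t ∧ ((firstPart t ≡ᵇ bPart s) ∧ (bRun t ≡ᵇ j))) (wt t))
                               + when (j ≡ᵇ 0) (when (valid t ∧ (firstPart t ≡ᵇ aPart s)) (wt t)))
      ≈⟨ sumOver-distrib-+ (box (suc m)) _ _ ⟩
    _ + _
      ≈⟨ +-cong (sumOver-when (box (suc m)) (j <ᵇ r) _) (sumOver-when (box (suc m)) (j ≡ᵇ 0) _) ⟩
    when (j <ᵇ r) (runSum (suc m) (bPart s) j) + when (j ≡ᵇ 0) (headSum (suc m) (aPart s)) ∎))
    where
    split : ∀ t → InBox N (suc m) t → when (valid (bPart s ∷ t) ∧ (bRun (bPart s ∷ t) ≡ᵇ suc j)) (wt t)
      ≈ when (j <ᵇ r) (when (valid t ∧ ((firstPart t ≡ᵇ bPart s) ∧ (bRun t ≡ᵇ j))) (wt t))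
        + when (j ≡ᵇ 0) (when (valid t ∧ (firstPart t ≡ᵇ aPart s)) (wt t))
    split (z ∷ t) _ with valid (z ∷ t) in v
    ... | true  = begin
      when (valid (bPart s ∷ z ∷ t) ∧ (bRun (bPart s ∷ z ∷ t) ≡ᵇ suc j)) (wt (z ∷ t))
        ≡⟨ ≡.cong (λ g → when g (wt (z ∷ t))) (valid-bPart-∷ s z t j v) ⟩
      when (continueB s z t j ∨ startB s z t j) (wt (z ∷ t))
        ≈⟨ when-∨ (continueB s z t j) (startB s z t j) (wt (z ∷ t)) (continueB∧startB≡false s z t j) ⟩
      when (continueB s z t j) (wt (z ∷ t)) + when (startB s z t j) (wt (z ∷ t))
        ≈⟨ +-cong (when-∧ (j <ᵇ r) _ (wt (z ∷ t))) (when-∧ (j ≡ᵇ 0) (z ≡ᵇ aPart s) (wt (z ∷ t))) ⟩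
      when (j <ᵇ r) (when ((z ≡ᵇ bPart s) ∧ (bRun (z ∷ t) ≡ᵇ j)) (wt (z ∷ t))) + when (j ≡ᵇ 0) (when (z ≡ᵇ aPart s) (wt (z ∷ t))) ∎
    ... | false = begin
      when (valid (bPart s ∷ z ∷ t) ∧ (bRun (bPart s ∷ z ∷ t) ≡ᵇ suc j)) (wt (z ∷ t))
        ≈⟨ when-false (wt (z ∷ t)) (≡.cong (_∧ (bRun (bPart s ∷ z ∷ t) ≡ᵇ suc j)) (valid-∷-false (bPart s) z t v)) ⟩
      0#
        ≈⟨ +-identityʳ 0# ⟨
      0# + 0#
        ≈⟨ +-cong (when-0# (j <ᵇ r)) (when-0# (j ≡ᵇ 0)) ⟨
      when (j <ᵇ r) 0# + when (j ≡ᵇ 0) 0# ∎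

  headSum-runSums : ∀ m v → headSum m v ≈ ∑ (suc r) (runSum m v)
  headSum-runSums m v = trans (sumOver-cong (box m) split) (sumOver-∑ (box m) (suc r) _)
    where
    split : ∀ t → when (valid t ∧ (firstPart t ≡ᵇ v)) (wt t)
                ≈ ∑ (suc r) (λ j → when (valid t ∧ ((firstPart t ≡ᵇ v) ∧ (bRun t ≡ᵇ j))) (wt t))
    split t with valid t in v-t | firstPart t ≡ᵇ v
    ... | false | _     = sym (∑-zero (suc r) _ (λ _ _ → refl))
    ... | true  | false = sym (∑-zero (suc r) _ (λ _ _ → refl))
    ... | true  | true  = sym (trans
      (∑-single (suc r) (λ j → when (bRun t ≡ᵇ j) (wt t)) (bRun t) (s≤s (bRun≤r t v-t))
                (λ j _ j≢run → when-false (wt t) (≢⇒≡ᵇ-false (j≢run ∘′ ≡.sym))))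
      (when-true (wt t) (≡ᵇ-refl (bRun t))))

  valid-[] : ∀ v → isAorB v ≡ true → valid (v ∷ []) ≡ (v ≡ᵇ d)
  valid-[] v v-ab with v ≡ᵇ d in v≡d
  ... | false = Boolₚ.∧-zeroʳ _
  ... | true rewrite v-ab | >⇒≤ᵇ-false {r} {0} 1≤r = ∧-true (∧-true (last-ab (≡ᵇ-true⇒≡ v≡d) d∈ab) ≡.refl) ≡.refl
    where
    last-ab : v ≡ d → (d ≡ a) ⊎ (d ≡ b) → (v ≡ᵇ a) ∨ (v ≡ᵇ b) ≡ true
    last-ab v≡d (inj₁ d≡a) = ∨-trueˡ (v ≡ᵇ b) (≡⇒≡ᵇ-true (≡.trans v≡d d≡a))
    last-ab v≡d (inj₂ d≡b) = ∨-trueʳ (v ≡ᵇ a) (≡⇒≡ᵇ-true (≡.trans v≡d d≡b))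

  runSum-one : ∀ v j → 1 ≤ v → v ≤ N → isAorB v ≡ true → runSum 1 v j ≈ when ((v ≡ᵇ d) ∧ (bRun (v ∷ []) ≡ᵇ j)) (partWeight v)
  runSum-one v j 1≤v v≤N v-ab = begin
    runSum 1 v j
      ≈⟨ runSum-suc 0 v j 1≤v v≤N ⟩
    partWeight v * (when (valid (v ∷ []) ∧ (bRun (v ∷ []) ≡ᵇ j)) (wt []) + 0#)
      ≈⟨ *-congˡ (+-identityʳ _) ⟩
    partWeight v * when (valid (v ∷ []) ∧ (bRun (v ∷ []) ≡ᵇ j)) (wt [])
      ≡⟨ ≡.cong (λ g → partWeight v * when (g ∧ (bRun (v ∷ []) ≡ᵇ j)) (wt [])) (valid-[] v v-ab) ⟩
    partWeight v * when ((v ≡ᵇ d) ∧ (bRun (v ∷ []) ≡ᵇ j)) (wt [])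
      ≈⟨ *-when ((v ≡ᵇ d) ∧ (bRun (v ∷ []) ≡ᵇ j)) (partWeight v) (wt []) ⟩
    when ((v ≡ᵇ d) ∧ (bRun (v ∷ []) ≡ᵇ j)) (partWeight v * wt [])
      ≈⟨ when-cong ((v ≡ᵇ d) ∧ (bRun (v ∷ []) ≡ᵇ j)) (trans (*-congˡ weight-[]) (*-identityʳ _)) ⟩
    when ((v ≡ᵇ d) ∧ (bRun (v ∷ []) ≡ᵇ j)) (partWeight v) ∎

  validSum-headSums : ∀ m → sumOver (box m) (λ t → when (valid t) (wt t)) ≈ ∑ N (λ s → headSum m (aPart s) + headSum m (bPart s))
  validSum-headSums m = trans (sumOver-boxLists-cong N m split)
                              (trans (sumOver-∑ (box m) N _) (∑-cong-∀ N (λ s → sumOver-distrib-+ (box m) _ _)))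
    where
    split : ∀ t → InBox N m t → when (valid t) (wt t)
              ≈ ∑ N (λ s → when (valid t ∧ (firstPart t ≡ᵇ aPart s)) (wt t) + when (valid t ∧ (firstPart t ≡ᵇ bPart s)) (wt t))
    split [] _ = sym (∑-zero N _ (λ _ _ → +-identityʳ 0#))
    split (z ∷ t) (_ , (_ , z≤N) ∷ _) with valid (z ∷ t) in v
    ... | false = sym (∑-zero N _ (λ _ _ → +-identityʳ 0#))
    ... | true with admissible⇒isPart z (valid⇒a≤firstPart (z ∷ t) v) (valid⇒admissible z t v)
    ...   | s₀ , inj₁ ≡.refl = sym (trans
              (∑-single N _ s₀ (ℕₚ.<-≤-trans (s<aPart s₀) z≤N) (λ s _ s≢s₀ → trans
                 (+-cong (when-false _ (≢⇒≡ᵇ-false (s≢s₀ ∘′ ≡.sym ∘′ aPart-injective)))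
                         (when-false _ (≢⇒≡ᵇ-false (aPart≢bPart s₀ s))))
                 (+-identityʳ 0#)))
              (trans (+-cong (when-true _ (≡ᵇ-refl (aPart s₀))) (when-false _ (≢⇒≡ᵇ-false (aPart≢bPart s₀ s₀))))
                     (+-identityʳ _)))
    ...   | s₀ , inj₂ ≡.refl = sym (trans
              (∑-single N _ s₀ (ℕₚ.<-≤-trans (ℕₚ.<-trans (s<aPart s₀) (aPart<bPart s₀)) z≤N) (λ s _ s≢s₀ → trans
                 (+-cong (when-false _ (≢⇒≡ᵇ-false (aPart≢bPart s s₀ ∘′ ≡.sym)))
                         (when-false _ (≢⇒≡ᵇ-false (s≢s₀ ∘′ ≡.sym ∘′ bPart-injective))))
                 (+-identityʳ 0#)))
              (trans (+-cong (when-false _ (≢⇒≡ᵇ-false (aPart≢bPart s₀ s₀ ∘′ ≡.sym))) (when-true _ (≡ᵇ-refl (bPart s₀))))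
                     (+-identityˡ _)))

  Q : Carrier
  Q = pow R q k

  partWeight-aPart : ∀ s → partWeight (aPart s) ≈ (μ * pow R q a) * pow R Q s
  partWeight-aPart s rewrite aPart-cong-a s | aPart-incong-b s = begin
    μ * (1# * pow R q (s ℕ.* k ℕ.+ a))          ≈⟨ *-congˡ (*-identityˡ _) ⟩
    μ * pow R q (s ℕ.* k ℕ.+ a)                 ≈⟨ *-congˡ (pow-+ q (s ℕ.* k) a) ⟩
    μ * (pow R q (s ℕ.* k) * pow R q a)         ≈⟨ *-congˡ (*-congʳ (trans (pow-congʳ q (ℕₚ.*-comm s k)) (pow-* q k s))) ⟩
    μ * (pow R Q s * pow R q a)                 ≈⟨ regroup μ (pow R Q s) (pow R q a) ⟩
    (μ * pow R q a) * pow R Q s ∎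
    where
    regroup : ∀ x y z → x * (y * z) ≈ (x * z) * y
    regroup = solve 3 (λ x y z → x :* (y :* z) := (x :* z) :* y) refl

  partWeight-bPart : ∀ s → partWeight (bPart s) ≈ (ν * pow R q b) * pow R Q s
  partWeight-bPart s rewrite bPart-incong-a s | bPart-cong-b s = begin
    1# * (ν * pow R q (s ℕ.* k ℕ.+ b))          ≈⟨ *-identityˡ _ ⟩
    ν * pow R q (s ℕ.* k ℕ.+ b)                 ≈⟨ *-congˡ (pow-+ q (s ℕ.* k) b) ⟩
    ν * (pow R q (s ℕ.* k) * pow R q b)         ≈⟨ *-congˡ (*-congʳ (trans (pow-congʳ q (ℕₚ.*-comm s k)) (pow-* q k s))) ⟩
    ν * (pow R Q s * pow R q b)                 ≈⟨ regroup ν (pow R Q s) (pow R q b) ⟩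
    (ν * pow R q b) * pow R Q s ∎
    where
    regroup : ∀ x y z → x * (y * z) ≈ (x * z) * y
    regroup = solve 3 (λ x y z → x :* (y :* z) := (x :* z) :* y) refl

  headSum-beyond : ∀ m v → N < v → headSum m v ≈ 0#
  headSum-beyond m v N<v = trans (sumOver-boxLists-cong N m vanish) (sumOver-zero (box m))
    where
    vanish : ∀ t → InBox N m t → when (valid t ∧ (firstPart t ≡ᵇ v)) (wt t) ≈ 0#
    vanish []      _                 = refl
    vanish (z ∷ t) (_ , (_ , z≤N) ∷ _) =
      when-false _ (∧-falseʳ (valid (z ∷ t)) (≢⇒≡ᵇ-false (λ z≡v → ℕₚ.<⇒≱ N<v (≡.subst (_≤ N) z≡v z≤N))))

triangle : ℕ → ℕ
triangle zero    = 0
triangle (suc s) = triangle s ℕ.+ s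

module Gaussian {c ℓ} (R : CommutativeRing c ℓ) where

  open Sums R

  module _ (x : Carrier) where

    gauss-vanish : ∀ n j → n < j → gaussN R x n j ≈ 0#
    gauss-vanish zero    (suc j) _       = refl
    gauss-vanish (suc n) (suc j) (s≤s n<j) =
      trans (+-cong (gauss-vanish n j n<j) (*-congˡ (gauss-vanish n (suc j) (ℕₚ.m≤n⇒m≤1+n n<j))))
            (trans (+-identityˡ _) (zeroʳ _))

    gauss-zero : ∀ n → gaussN R x n 0 ≈ 1#
    gauss-zero zero    = refl
    gauss-zero (suc n) = refl

    gauss-diag : ∀ n → gaussN R x n n ≈ 1#
    gauss-diag zero    = refl
    gauss-diag (suc n) =
      trans (+-cong (gauss-diag n) (*-congˡ (gauss-vanish n (suc n) ℕₚ.≤-refl)))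
            (trans (+-congˡ (zeroʳ _)) (+-identityʳ _))

    gauss-one : ∀ n → gaussN R x (suc n) 1 ≈ gaussN R x n 1 + pow R x n
    gauss-one zero    = trans (+-congˡ (zeroʳ _)) (trans (+-identityʳ 1#) (sym (+-identityˡ 1#)))
    gauss-one (suc n) = begin
      1# + pow R x 1 * gaussN R x (suc n) 1                ≈⟨ +-congˡ (*-congˡ (gauss-one n)) ⟩
      1# + pow R x 1 * (gaussN R x n 1 + pow R x n)        ≈⟨ regroup 1# (pow R x 1) (gaussN R x n 1) (pow R x n) ⟩
      (1# + pow R x 1 * gaussN R x n 1) + pow R x 1 * pow R x n
        ≈⟨ +-cong (+-congʳ (sym (gauss-zero n))) (*-congʳ (*-identityʳ x)) ⟩
      gaussN R x (suc n) 1 + pow R x (suc n)               ∎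
      where
      regroup : ∀ o y g p → o + y * (g + p) ≈ (o + y * g) + y * p
      regroup = solve 4 (λ o y g p → o :+ y :* (g :+ p) := (o :+ y :* g) :+ y :* p) refl

    gauss-pascal′ : ∀ n i → gaussN R x (suc n) (suc i) ≈ gaussN R x n (suc i) + pow R x (n ∸ i) * gaussN R x n i
    gauss-pascal′ zero    zero    = trans (+-congˡ (zeroʳ _)) (trans (+-identityʳ 1#) (trans (sym (*-identityˡ 1#)) (sym (+-identityˡ _))))
    gauss-pascal′ zero    (suc i) = trans (gauss-vanish 1 (suc (suc i)) (s≤s (s≤s z≤n))) (sym (trans (+-identityˡ _) (zeroʳ _)))
    gauss-pascal′ (suc n) zero    = trans (gauss-one (suc n)) (+-congˡ (sym (*-identityʳ _)))
    gauss-pascal′ (suc n) (suc i) with ℕₚ.<-cmp i n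
    ... | tri> _ _ n<i = trans (gauss-vanish (suc (suc n)) (suc (suc i)) (s≤s (s≤s n<i)))
      (sym (trans (+-cong (gauss-vanish (suc n) (suc (suc i)) (s≤s (ℕₚ.m≤n⇒m≤1+n n<i)))
                          (*-congˡ (gauss-vanish (suc n) (suc i) (s≤s n<i))))
                  (trans (+-congˡ (zeroʳ _)) (+-identityʳ _))))
    ... | tri≈ _ ≡.refl _ = trans (gauss-diag (suc (suc i)))
      (sym (trans (+-cong (gauss-vanish (suc i) (suc (suc i)) ℕₚ.≤-refl)
                          (*-cong (pow-congʳ x (ℕₚ.n∸n≡0 i)) (gauss-diag (suc i))))
                  (trans (+-identityˡ _) (*-identityʳ _))))
    ... | tri< i<n _ _ = begin
      G (suc n) (suc i) + pow R x (suc (suc i)) * G (suc n) (suc (suc i))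
        ≈⟨ +-cong (gauss-pascal′ n i) (*-congˡ (gauss-pascal′ n (suc i))) ⟩
      (G n (suc i) + pow R x (n ∸ i) * G n i) + pow R x (suc (suc i)) * (G n (suc (suc i)) + pow R x (n ∸ suc i) * G n (suc i))
        ≈⟨ +-congʳ (+-congˡ (*-congʳ (pow-congʳ x (ℕₚ.+-∸-assoc 1 i<n)))) ⟩
      (G n (suc i) + pow R x (suc e) * G n i) + pow R x (suc (suc i)) * (G n (suc (suc i)) + pow R x e * G n (suc i))
        ≈⟨ regroup x (pow R x (suc i)) (pow R x e) (G n i) (G n (suc i)) (G n (suc (suc i))) ⟩
      (G n (suc i) + pow R x (suc (suc i)) * G n (suc (suc i))) + pow R x (suc e) * (G n i + pow R x (suc i) * G n (suc i))
        ≈⟨ +-congˡ (*-congʳ (pow-congʳ x (≡.sym (ℕₚ.+-∸-assoc 1 i<n)))) ⟩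
      G (suc n) (suc (suc i)) + pow R x (n ∸ i) * G (suc n) (suc i) ∎
      where
      G : ℕ → ℕ → Carrier
      G = gaussN R x
      e : ℕ
      e = n ∸ suc i
      regroup : ∀ y p q g₀ g₁ g₂ → (g₁ + (y * q) * g₀) + (y * p) * (g₂ + q * g₁) ≈ (g₁ + (y * p) * g₂) + (y * q) * (g₀ + p * g₁)
      regroup = solve 6 (λ y p q g₀ g₁ g₂ →
        (g₁ :+ (y :* q) :* g₀) :+ (y :* p) :* (g₂ :+ q :* g₁) := (g₁ :+ (y :* p) :* g₂) :+ (y :* q) :* (g₀ :+ p :* g₁)) refl

  -- gauss∸ x n t j is the Gaussian binomial [n - t, j]_x, and 0 when t > n.
  gauss∸ : Carrier → ℕ → ℕ → ℕ → Carrier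
  gauss∸ x n       zero    j = gaussN R x n j
  gauss∸ x zero    (suc t) j = 0#
  gauss∸ x (suc n) (suc t) j = gauss∸ x n t j

  gauss∸-pascal : ∀ x n t j → gauss∸ x (suc n) t (suc j) ≈ gauss∸ x n t j + pow R x (suc j) * gauss∸ x n t (suc j)
  gauss∸-pascal x n       zero          j = refl
  gauss∸-pascal x zero    (suc zero)    j = sym (trans (+-identityˡ _) (zeroʳ _))
  gauss∸-pascal x zero    (suc (suc t)) j = sym (trans (+-identityˡ _) (zeroʳ _))
  gauss∸-pascal x (suc n) (suc t)       j = gauss∸-pascal x n t j

  gauss∸-+ : ∀ x e n t j → gauss∸ x (e ℕ.+ n) (e ℕ.+ t) j ≈ gauss∸ x n t j
  gauss∸-+ x zero    n t j = refl
  gauss∸-+ x (suc e) n t j = gauss∸-+ x e n t j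

  gauss∸-vanish : ∀ x n t j → n < t ℕ.+ j → gauss∸ x n t j ≈ 0#
  gauss∸-vanish x n       zero    j n<j         = gauss-vanish x n j n<j
  gauss∸-vanish x zero    (suc t) j _           = refl
  gauss∸-vanish x (suc n) (suc t) j (s≤s n<t+j) = gauss∸-vanish x n t j n<t+j

  gauss∸-zero : ∀ x n t → gauss∸ x n t 0 ≈ when (t ≤ᵇ n) 1#
  gauss∸-zero x n       zero    = gauss-zero x n
  gauss∸-zero x zero    (suc t) = refl
  gauss∸-zero x (suc n) (suc t) = trans (gauss∸-zero x n t) (reflexive (≡.cong (λ c → when c 1#) (≡.sym (<ᵇ-suc t n))))

  module GFunction (Q Qr : Carrier) (r : ℕ) (Q^r≈Qr : ∀ n → pow R Q (r ℕ.* n) ≈ pow R Qr n) where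

    coeff : ℕ → Carrier
    coeff i = pow R (- 1#) i * pow R Qr (triangle i)

    -- g₊ h s is g_{k,r}(h, s + 1) of the statement, for Q = q^k and Qr = q^{rk}.
    g₊ : ℕ → ℕ → Carrier
    g₊ h s = ∑ (suc (suc s)) (λ i → coeff i * (gaussN R Qr (suc s) i * gauss∸ Q (h ℕ.+ s) (r ℕ.* i) s))

    g₊-offset : ℕ → ℕ → ℕ → Carrier
    g₊-offset h e s = ∑ (suc (suc s)) (λ i → coeff i * (gaussN R Qr (suc s) i * gauss∸ Q (h ℕ.+ s) (e ℕ.+ r ℕ.* i) s))

    g₊-offset-when : ∀ h e s → when (e ≤ᵇ h) (g₊ (h ∸ e) s) ≈ g₊-offset h e s
    g₊-offset-when h e s with e ≤ᵇ h in e≤h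
    ... | true  = ∑-cong-∀ (suc (suc s)) (λ i → *-congˡ (*-congˡ (sym (trans
                    (reflexive (≡.cong (λ n → gauss∸ Q n (e ℕ.+ r ℕ.* i) s) h+s≡))
                    (gauss∸-+ Q e _ _ s)))))
      where
      h+s≡ : h ℕ.+ s ≡ e ℕ.+ ((h ∸ e) ℕ.+ s)
      h+s≡ = ≡.trans (≡.cong (ℕ._+ s) (≡.sym (ℕₚ.m+[n∸m]≡n (≤ᵇ-true⇒≤ {e} e≤h)))) (ℕₚ.+-assoc e (h ∸ e) s)
    ... | false = sym (∑-zero (suc (suc s)) _ (λ i _ →
                    trans (*-congˡ (trans (*-congˡ (gauss∸-vanish Q (h ℕ.+ s) (e ℕ.+ r ℕ.* i) s (h+s<e+ri+s i))) (zeroʳ _)))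
                          (zeroʳ _)))
      where
      h+s<e+ri+s : ∀ i → h ℕ.+ s < (e ℕ.+ r ℕ.* i) ℕ.+ s
      h+s<e+ri+s i = ℕₚ.+-monoˡ-< s (ℕₚ.<-≤-trans (≤ᵇ-false⇒> {e} e≤h) (ℕₚ.m≤m+n e (r ℕ.* i)))

    ∑-gauss∸-telescope : ∀ h s t₀ →
      ∑ r (λ e → pow R Q (e ℕ.* suc s) * gauss∸ Q (h ℕ.+ s) (e ℕ.+ t₀) s)
        ≈ gauss∸ Q (h ℕ.+ suc s) t₀ (suc s) - pow R Qr (suc s) * gauss∸ Q (h ℕ.+ suc s) (r ℕ.+ t₀) (suc s)
    ∑-gauss∸-telescope h s t₀ = begin
      ∑ r (λ e → pow R Q (e ℕ.* suc s) * gauss∸ Q (h ℕ.+ s) (e ℕ.+ t₀) s)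
        ≈⟨ ∑-cong-∀ r (λ e → sym (difference e)) ⟩
      ∑ r (λ e → u e - u (suc e))
        ≈⟨ ∑-telescope r u ⟩
      u 0 - u r
        ≈⟨ +-cong (*-identityˡ _) (-‿cong (*-congʳ (Q^r≈Qr (suc s)))) ⟩
      gauss∸ Q (h ℕ.+ suc s) t₀ (suc s) - pow R Qr (suc s) * gauss∸ Q (h ℕ.+ suc s) (r ℕ.+ t₀) (suc s) ∎
      where
      u : ℕ → Carrier
      u e = pow R Q (e ℕ.* suc s) * gauss∸ Q (h ℕ.+ suc s) (e ℕ.+ t₀) (suc s)
      difference : ∀ e → u e - u (suc e) ≈ pow R Q (e ℕ.* suc s) * gauss∸ Q (h ℕ.+ s) (e ℕ.+ t₀) s
      difference e = begin
        P * gauss∸ Q (h ℕ.+ suc s) (e ℕ.+ t₀) (suc s) - pow R Q (suc s ℕ.+ e ℕ.* suc s) * gauss∸ Q (h ℕ.+ suc s) (suc (e ℕ.+ t₀)) (suc s)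
          ≡⟨ ≡.cong (λ n → P * gauss∸ Q n (e ℕ.+ t₀) (suc s) - pow R Q (suc s ℕ.+ e ℕ.* suc s) * gauss∸ Q n (suc (e ℕ.+ t₀)) (suc s))
                    (ℕₚ.+-suc h s) ⟩
        P * gauss∸ Q (suc (h ℕ.+ s)) (e ℕ.+ t₀) (suc s) - pow R Q (suc s ℕ.+ e ℕ.* suc s) * G (suc s)
          ≈⟨ +-cong (*-congˡ (gauss∸-pascal Q (h ℕ.+ s) (e ℕ.+ t₀) s)) (-‿cong (*-congʳ (pow-+ Q (suc s) (e ℕ.* suc s)))) ⟩
        P * (G s + pow R Q (suc s) * G (suc s)) - (pow R Q (suc s) * P) * G (suc s)
          ≈⟨ +-congʳ (expand P (G s) (pow R Q (suc s)) (G (suc s))) ⟩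
        (P * G s + (pow R Q (suc s) * P) * G (suc s)) - (pow R Q (suc s) * P) * G (suc s)
          ≈⟨ //-rightDividesʳ ((pow R Q (suc s) * P) * G (suc s)) (P * G s) ⟩
        P * G s ∎
        where
        P : Carrier
        P = pow R Q (e ℕ.* suc s)
        G : ℕ → Carrier
        G = gauss∸ Q (h ℕ.+ s) (e ℕ.+ t₀)
        expand : ∀ p x y z → p * (x + y * z) ≈ p * x + (y * p) * z
        expand = solve 4 (λ p x y z → p :* (x :+ y :* z) := p :* x :+ (y :* p) :* z) refl

    coeff-suc : ∀ i n → i ≤ n → coeff (suc i) * pow R Qr (n ∸ i) ≈ - (coeff i * pow R Qr n)
    coeff-suc i n i≤n = begin
      ((- 1#) * pow R (- 1#) i) * pow R Qr (triangle i ℕ.+ i) * pow R Qr (n ∸ i)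
        ≈⟨ *-congʳ (*-congˡ (pow-+ Qr (triangle i) i)) ⟩
      ((- 1#) * pow R (- 1#) i) * (pow R Qr (triangle i) * pow R Qr i) * pow R Qr (n ∸ i)
        ≈⟨ regroup (- 1#) (pow R (- 1#) i) (pow R Qr (triangle i)) (pow R Qr i) (pow R Qr (n ∸ i)) ⟩
      (- 1#) * (coeff i * (pow R Qr i * pow R Qr (n ∸ i)))
        ≈⟨ *-congˡ (*-congˡ (trans (sym (pow-+ Qr i (n ∸ i))) (pow-congʳ Qr (ℕₚ.m+[n∸m]≡n i≤n)))) ⟩
      (- 1#) * (coeff i * pow R Qr n)
        ≈⟨ -1*x≈-x _ ⟩
      - (coeff i * pow R Qr n) ∎
      where
      regroup : ∀ o m t x y → (o * m) * (t * x) * y ≈ o * ((m * t) * (x * y))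
      regroup = solve 5 (λ o m t x y → (o :* m) :* (t :* x) :* y := o :* ((m :* t) :* (x :* y))) refl

    module _ (h s : ℕ) where

      private
        B Z : ℕ → Carrier
        B i = gaussN R Qr (suc s) i
        Z i = gauss∸ Q (h ℕ.+ suc s) (r ℕ.* i) (suc s)

      g₊-aligned g₊-shifted : Carrier
      g₊-aligned = ∑ (suc (suc s)) (λ i → coeff i * (B i * Z i))
      g₊-shifted = ∑ (suc (suc s)) (λ i → (- (coeff i * pow R Qr (suc s))) * (B i * Z (suc i)))

      ∑-offsets-split : ∑ r (λ e → when (e ≤ᵇ h) (pow R Q (e ℕ.* suc s) * g₊ (h ∸ e) s)) ≈ g₊-aligned + g₊-shifted
      ∑-offsets-split = begin
        ∑ r (λ e → when (e ≤ᵇ h) (pow R Q (e ℕ.* suc s) * g₊ (h ∸ e) s))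
          ≈⟨ ∑-cong-∀ r (λ e → trans (sym (*-when (e ≤ᵇ h) _ _)) (*-congˡ (g₊-offset-when h e s))) ⟩
        ∑ r (λ e → pow R Q (e ℕ.* suc s) * g₊-offset h e s)
          ≈⟨ ∑-cong-∀ r (λ e → trans (*-distribˡ-∑ (suc (suc s)) _ _) (∑-cong-∀ (suc (suc s)) (λ i → regroup _ _ _ _))) ⟩
        ∑ r (λ e → ∑ (suc (suc s)) (λ i → (coeff i * B i) * (pow R Q (e ℕ.* suc s) * gauss∸ Q (h ℕ.+ s) (e ℕ.+ r ℕ.* i) s)))
          ≈⟨ ∑-comm r (suc (suc s)) _ ⟩
        ∑ (suc (suc s)) (λ i → ∑ r (λ e → (coeff i * B i) * (pow R Q (e ℕ.* suc s) * gauss∸ Q (h ℕ.+ s) (e ℕ.+ r ℕ.* i) s)))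
          ≈⟨ ∑-cong-∀ (suc (suc s)) (λ i → sym (*-distribˡ-∑ r _ _)) ⟩
        ∑ (suc (suc s)) (λ i → (coeff i * B i) * ∑ r (λ e → pow R Q (e ℕ.* suc s) * gauss∸ Q (h ℕ.+ s) (e ℕ.+ r ℕ.* i) s))
          ≈⟨ ∑-cong-∀ (suc (suc s)) (λ i → *-congˡ (trans (∑-gauss∸-telescope h s (r ℕ.* i))
               (+-congˡ (-‿cong (*-congˡ (reflexive (≡.cong (λ t → gauss∸ Q (h ℕ.+ suc s) t (suc s)) (≡.sym (ℕₚ.*-suc r i))))))))) ⟩
        ∑ (suc (suc s)) (λ i → (coeff i * B i) * (Z i - pow R Qr (suc s) * Z (suc i)))
          ≈⟨ ∑-cong-∀ (suc (suc s)) (λ i → split-neg _ _ _ _ _) ⟩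
        ∑ (suc (suc s)) (λ i → coeff i * (B i * Z i) + (- (coeff i * pow R Qr (suc s))) * (B i * Z (suc i)))
          ≈⟨ ∑-distrib-+ (suc (suc s)) _ _ ⟩
        g₊-aligned + g₊-shifted ∎
        where
        regroup : ∀ p c b t → p * (c * (b * t)) ≈ (c * b) * (p * t)
        regroup = solve 4 (λ p c b t → p :* (c :* (b :* t)) := (c :* b) :* (p :* t)) refl
        split-neg : ∀ c b z p z′ → (c * b) * (z - p * z′) ≈ c * (b * z) + (- (c * p)) * (b * z′)
        split-neg c b z p z′ = begin
          (c * b) * (z - p * z′)               ≈⟨ x[y-z]≈xy-xz (c * b) z (p * z′) ⟩
          (c * b) * z - (c * b) * (p * z′)     ≈⟨ +-cong (*-assoc c b z) (-‿cong (interchange c b p z′)) ⟩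
          c * (b * z) - (c * p) * (b * z′)     ≈⟨ +-congˡ (-‿distribˡ-* (c * p) (b * z′)) ⟩
          c * (b * z) + (- (c * p)) * (b * z′) ∎
          where
          interchange : ∀ c b p z → (c * b) * (p * z) ≈ (c * p) * (b * z)
          interchange = solve 4 (λ c b p z → (c :* b) :* (p :* z) := (c :* p) :* (b :* z)) refl

      g₊-suc-split : g₊ h (suc s) ≈ g₊-aligned + g₊-shifted
      g₊-suc-split = begin
        ∑ (suc (suc (suc s))) (λ i → coeff i * (gaussN R Qr (suc (suc s)) i * Z i))
          ≈⟨ ∑-suc (suc (suc s)) _ ⟩
        coeff 0 * (B 0 * Z 0) + ∑ (suc (suc s)) (λ i → coeff (suc i) * (gaussN R Qr (suc (suc s)) (suc i) * Z (suc i)))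
          ≈⟨ +-congˡ (∑-cong-∀ (suc (suc s)) (λ i → *-congˡ (*-congʳ (gauss-pascal′ Qr (suc s) i)))) ⟩
        coeff 0 * (B 0 * Z 0) + ∑ (suc (suc s)) (λ i → coeff (suc i) * ((B (suc i) + pow R Qr (suc s ∸ i) * B i) * Z (suc i)))
          ≈⟨ +-congˡ (trans (∑-cong-∀ (suc (suc s)) (λ i → distribute _ _ _ _ _)) (∑-distrib-+ (suc (suc s)) _ _)) ⟩
        coeff 0 * (B 0 * Z 0) + (∑ (suc (suc s)) (λ i → coeff (suc i) * (B (suc i) * Z (suc i)))
                                 + ∑ (suc (suc s)) (λ i → (coeff (suc i) * pow R Qr (suc s ∸ i)) * (B i * Z (suc i))))
          ≈⟨ +-assoc _ _ _ ⟨
        (coeff 0 * (B 0 * Z 0) + ∑ (suc (suc s)) (λ i → coeff (suc i) * (B (suc i) * Z (suc i))))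
          + ∑ (suc (suc s)) (λ i → (coeff (suc i) * pow R Qr (suc s ∸ i)) * (B i * Z (suc i)))
          ≈⟨ +-cong (∑-suc (suc (suc s)) (λ i → coeff i * (B i * Z i)))
                    (sym (∑-cong (suc (suc s)) (λ i i<2+s → *-congʳ (coeff-suc i (suc s) (ℕₚ.≤-pred i<2+s))))) ⟨
        (g₊-aligned + coeff (suc (suc s)) * (B (suc (suc s)) * Z (suc (suc s)))) + g₊-shifted
          ≈⟨ +-congʳ (trans (+-congˡ (trans (*-congˡ (trans (*-congʳ (gauss-vanish Qr (suc s) (suc (suc s)) ℕₚ.≤-refl))
                                                            (zeroˡ _)))
                                            (zeroʳ _)))
                            (+-identityʳ _)) ⟩
        g₊-aligned + g₊-shifted ∎
        where
        distribute : ∀ c b p b′ z → c * ((b + p * b′) * z) ≈ c * (b * z) + (c * p) * (b′ * z)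
        distribute = solve 5 (λ c b p b′ z → c :* ((b :+ p :* b′) :* z) := c :* (b :* z) :+ (c :* p) :* (b′ :* z)) refl

    -- Both sides split into the same two sums: the left one by the second q-Pascal rule,
    -- the right one by summing over the offset e telescopically.
    g₊-suc : ∀ h s → g₊ h (suc s) ≈ ∑ r (λ e → when (e ≤ᵇ h) (pow R Q (e ℕ.* suc s) * g₊ (h ∸ e) s))
    g₊-suc h s = trans (g₊-suc-split h s) (sym (∑-offsets-split h s))

    g₊-zero : ∀ h → g₊ h 0 ≈ when (h <ᵇ r) 1#
    g₊-zero h = trans (+-cong (trans (+-identityˡ _) term₀) term₁) (by-cases (r ≤ᵇ h) ≡.refl)
      where
      term₀ : coeff 0 * (gaussN R Qr 1 0 * gauss∸ Q (h ℕ.+ 0) (r ℕ.* 0) 0) ≈ 1#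
      term₀ = begin
        (1# * 1#) * (1# * gauss∸ Q (h ℕ.+ 0) (r ℕ.* 0) 0)  ≈⟨ trans (*-congʳ (*-identityʳ 1#)) (trans (*-identityˡ _) (*-identityˡ _)) ⟩
        gauss∸ Q (h ℕ.+ 0) (r ℕ.* 0) 0                     ≈⟨ gauss∸-zero Q (h ℕ.+ 0) (r ℕ.* 0) ⟩
        when (r ℕ.* 0 ≤ᵇ h ℕ.+ 0) 1#                       ≡⟨ ≡.cong (λ t → when (t ≤ᵇ h ℕ.+ 0) 1#) (ℕₚ.*-zeroʳ r) ⟩
        1#                                                  ∎
      term₁ : coeff 1 * (gaussN R Qr 1 1 * gauss∸ Q (h ℕ.+ 0) (r ℕ.* 1) 0) ≈ - when (r ≤ᵇ h) 1#
      term₁ = begin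
        ((- 1#) * 1#) * 1# * ((1# + pow R Qr 1 * 0#) * gauss∸ Q (h ℕ.+ 0) (r ℕ.* 1) 0)
          ≈⟨ *-cong (trans (*-identityʳ _) (*-identityʳ _))
                    (*-cong (trans (+-congˡ (zeroʳ _)) (+-identityʳ _)) (gauss∸-zero Q (h ℕ.+ 0) (r ℕ.* 1))) ⟩
        (- 1#) * (1# * when (r ℕ.* 1 ≤ᵇ h ℕ.+ 0) 1#)
          ≈⟨ trans (*-congˡ (*-identityˡ _)) (-1*x≈-x _) ⟩
        - when (r ℕ.* 1 ≤ᵇ h ℕ.+ 0) 1#
          ≡⟨ ≡.cong₂ (λ x y → - when (x ≤ᵇ y) 1#) (ℕₚ.*-identityʳ r) (ℕₚ.+-identityʳ h) ⟩
        - when (r ≤ᵇ h) 1# ∎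
      by-cases : ∀ c → (r ≤ᵇ h) ≡ c → 1# + - when c 1# ≈ when (h <ᵇ r) 1#
      by-cases true  r≤h = trans (-‿inverseʳ 1#) (sym (when-false 1# (≥⇒<ᵇ-false {h} {r} (≤ᵇ-true⇒≤ {r} {h} r≤h))))
      by-cases false r>h = trans (+-congˡ -0#≈0#) (trans (+-identityʳ 1#) (sym (when-true 1# (<⇒<ᵇ-true {h} {r} (≤ᵇ-false⇒> {r} {h} r>h)))))

module Convolution {c ℓ} (R : CommutativeRing c ℓ) where

  open Sums R

  infixl 7 _⋆_
  _⋆_ : (ℕ → Carrier) → (ℕ → Carrier) → ℕ → Carrier
  (E ⋆ O) m = ∑ (suc m) (λ n → E (m ∸ n) * O n)

  ⋆-congˡ : ∀ {E E′} O m → (∀ n → E n ≈ E′ n) → (E ⋆ O) m ≈ (E′ ⋆ O) m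
  ⋆-congˡ O m E≈E′ = ∑-cong-∀ (suc m) (λ n → *-congʳ (E≈E′ (m ∸ n)))

  ⋆-suc : ∀ E O m → (E ⋆ O) (suc m) ≈ E 0 * O (suc m) + ((E ∘ suc) ⋆ O) m
  ⋆-suc E O m = begin
    ∑ (suc m) (λ n → E (suc m ∸ n) * O n) + E (suc m ∸ suc m) * O (suc m)
      ≈⟨ +-cong (∑-cong (suc m) (λ n n<1+m → *-congʳ (reflexive (≡.cong E (ℕₚ.+-∸-assoc 1 (ℕₚ.≤-pred n<1+m))))))
                (*-congʳ (reflexive (≡.cong E (ℕₚ.n∸n≡0 m)))) ⟩
    ((E ∘ suc) ⋆ O) m + E 0 * O (suc m) ≈⟨ +-comm _ _ ⟩
    E 0 * O (suc m) + ((E ∘ suc) ⋆ O) m ∎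

  ⋆-distribʳ-+ : ∀ E₁ E₂ O m → ((λ n → E₁ n + E₂ n) ⋆ O) m ≈ (E₁ ⋆ O) m + (E₂ ⋆ O) m
  ⋆-distribʳ-+ E₁ E₂ O m = trans (∑-cong-∀ (suc m) (λ n → distribʳ _ _ _)) (∑-distrib-+ (suc m) _ _)

  ⋆-*ˡ : ∀ x E O m → ((λ n → x * E n) ⋆ O) m ≈ x * (E ⋆ O) m
  ⋆-*ˡ x E O m = trans (∑-cong-∀ (suc m) (λ n → *-assoc _ _ _)) (sym (*-distribˡ-∑ (suc m) x _))

  ⋆-∑ʳ : ∀ E r (f : ℕ → ℕ → Carrier) m → (E ⋆ (λ n → ∑ r (λ j → f j n))) m ≈ ∑ r (λ j → (E ⋆ f j) m)
  ⋆-∑ʳ E r f m = trans (∑-cong-∀ (suc m) (λ n → *-distribˡ-∑ r _ _)) (∑-comm (suc m) r _)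

  ⋆-zeroʳ : ∀ E O m → (∀ n → n ≤ m → O n ≈ 0#) → (E ⋆ O) m ≈ 0#
  ⋆-zeroʳ E O m O≈0 = ∑-zero (suc m) _ (λ n n<1+m → trans (*-congˡ (O≈0 n (ℕₚ.≤-pred n<1+m))) (zeroʳ _))

  δ : ℕ → Carrier
  δ n = when (n ≡ᵇ 0) 1#

  ⋆-δ : ∀ E m → (E ⋆ δ) m ≈ E m
  ⋆-δ E m = trans (∑-suc m _) (trans (+-congˡ (∑-zero m _ (λ _ _ → zeroʳ _))) (trans (+-identityʳ _) (*-identityʳ _)))

  ⋆-shift : ∀ E O j x m → (E ⋆ (λ n → when (j ≤ᵇ n) (x * O (n ∸ j)))) m ≈ when (j ≤ᵇ m) (x * (E ⋆ O) (m ∸ j))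
  ⋆-shift E O j x m with ℕₚ.≤-<-connex j m
  ... | inj₂ m<j = trans (∑-zero (suc m) _ (λ n n<1+m →
                            trans (*-congˡ (when-false _ (>⇒≤ᵇ-false (ℕₚ.<-≤-trans (s≤s (ℕₚ.≤-pred n<1+m)) m<j))))
                                  (zeroʳ _)))
                         (sym (when-false _ (>⇒≤ᵇ-false m<j)))
  ... | inj₁ j≤m = begin
    ∑ (suc m) F                                               ≡⟨ ≡.cong (λ l → ∑ l F) (≡.sym j+[1+m∸j]≡1+m) ⟩
    ∑ (j ℕ.+ suc (m ∸ j)) F                                   ≈⟨ ∑-split j (suc (m ∸ j)) F ⟩
    ∑ j F + ∑ (suc (m ∸ j)) (λ i → F (j ℕ.+ i))
      ≈⟨ +-cong (∑-zero j F (λ n n<j → trans (*-congˡ (when-false _ (>⇒≤ᵇ-false n<j))) (zeroʳ _)))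
                (∑-cong-∀ (suc (m ∸ j)) shifted) ⟩
    0# + ∑ (suc (m ∸ j)) (λ i → x * (E ((m ∸ j) ∸ i) * O i))  ≈⟨ +-identityˡ _ ⟩
    ∑ (suc (m ∸ j)) (λ i → x * (E ((m ∸ j) ∸ i) * O i))       ≈⟨ *-distribˡ-∑ (suc (m ∸ j)) x _ ⟨
    x * (E ⋆ O) (m ∸ j)                                       ≈⟨ when-true _ (≤⇒≤ᵇ-true j≤m) ⟨
    when (j ≤ᵇ m) (x * (E ⋆ O) (m ∸ j))                       ∎
    where
    F : ℕ → Carrier
    F n = E (m ∸ n) * when (j ≤ᵇ n) (x * O (n ∸ j))
    j+[1+m∸j]≡1+m : j ℕ.+ suc (m ∸ j) ≡ suc m
    j+[1+m∸j]≡1+m = ≡.trans (ℕₚ.+-suc j (m ∸ j)) (≡.cong suc (ℕₚ.m+[n∸m]≡n j≤m))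
    shifted : ∀ i → F (j ℕ.+ i) ≈ x * (E ((m ∸ j) ∸ i) * O i)
    shifted i = begin
      E (m ∸ (j ℕ.+ i)) * when (j ≤ᵇ j ℕ.+ i) (x * O ((j ℕ.+ i) ∸ j))
        ≈⟨ *-cong (reflexive (≡.cong E (≡.sym (ℕₚ.∸-+-assoc m j i))))
                  (trans (when-true _ (≤⇒≤ᵇ-true (ℕₚ.m≤m+n j i))) (*-congˡ (reflexive (≡.cong O (ℕₚ.m+n∸m≡n j i))))) ⟩
      E ((m ∸ j) ∸ i) * (x * O i)   ≈⟨ x*[y*z]≈y*[x*z] _ _ _ ⟩
      x * (E ((m ∸ j) ∸ i) * O i)   ∎
      where
      x*[y*z]≈y*[x*z] : ∀ e y o → e * (y * o) ≈ y * (e * o)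
      x*[y*z]≈y*[x*z] = solve 3 (λ e y o → e :* (y :* o) := y :* (e :* o)) refl

module LevelGenerating {c ℓ} (R : CommutativeRing c ℓ) where

  open Sums R
  open Convolution R
  open Gaussian R

  module LevelsA (x Q : Carrier) where

    -- levelsA σ n is the weight of n a-parts that occupy exactly the levels 0, …, σ - 1,
    -- an a-part at level i weighing x·Q^i.
    levelsA : ℕ → ℕ → Carrier
    levelsA zero    n       = δ n
    levelsA (suc s) zero    = 0#
    levelsA (suc s) (suc n) = (x * pow R Q s) * (levelsA (suc s) n + levelsA s n)

    levelsA-closed : ∀ n s → levelsA (suc s) (suc n) ≈ pow R x (suc n) * (pow R Q (triangle (suc s)) * gaussN R Q n s)
    levelsA-closed zero    zero    = trans (*-congˡ (+-identityˡ 1#)) (sym (*-congˡ (*-identityˡ 1#)))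
    levelsA-closed zero    (suc s) = trans (*-congˡ (+-identityˡ 0#)) (trans (zeroʳ _) (sym (trans (*-congˡ (zeroʳ _)) (zeroʳ _))))
    levelsA-closed (suc n) zero    = begin
      (x * 1#) * (levelsA 1 (suc n) + 0#)                ≈⟨ *-cong (*-identityʳ x) (trans (+-identityʳ _) (levelsA-closed n 0)) ⟩
      x * (pow R x (suc n) * (1# * gaussN R Q n 0))      ≈⟨ *-congˡ (*-congˡ (trans (*-identityˡ _) (gauss-zero Q n))) ⟩
      x * (pow R x (suc n) * 1#)                         ≈⟨ *-assoc _ _ _ ⟨
      pow R x (suc (suc n)) * 1#                         ≈⟨ *-congˡ (*-identityˡ 1#) ⟨
      pow R x (suc (suc n)) * (1# * 1#)                  ∎
    levelsA-closed (suc n) (suc s) = begin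
      (x * S) * (levelsA (suc (suc s)) (suc n) + levelsA (suc s) (suc n))
        ≈⟨ *-congˡ (+-cong (trans (levelsA-closed n (suc s)) (*-congˡ (*-congʳ (pow-+ Q (triangle (suc s)) (suc s)))))
                           (levelsA-closed n s)) ⟩
      (x * S) * (P * ((Δ * S) * gaussN R Q n (suc s)) + P * (Δ * gaussN R Q n s))
        ≈⟨ regroup x S P Δ (gaussN R Q n s) (gaussN R Q n (suc s)) ⟩
      (x * P) * ((Δ * S) * (gaussN R Q n s + S * gaussN R Q n (suc s)))
        ≈⟨ *-congˡ (*-congʳ (pow-+ Q (triangle (suc s)) (suc s))) ⟨
      pow R x (suc (suc n)) * (pow R Q (triangle (suc (suc s))) * gaussN R Q (suc n) (suc s)) ∎
      where
      S Δ P : Carrier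
      S = pow R Q (suc s)
      Δ = pow R Q (triangle (suc s))
      P = pow R x (suc n)
      regroup : ∀ x s p t g₀ g₁ → (x * s) * (p * ((t * s) * g₁) + p * (t * g₀)) ≈ (x * p) * ((t * s) * (g₀ + s * g₁))
      regroup = solve 6 (λ x s p t g₀ g₁ →
        (x :* s) :* (p :* ((t :* s) :* g₁) :+ p :* (t :* g₀)) := (x :* p) :* ((t :* s) :* (g₀ :+ s :* g₁))) refl

    levelsA-suc+levelsA : ∀ n s → levelsA (suc s) n + levelsA s n ≈ pow R x n * (pow R Q (triangle s) * gaussN R Q n s)
    levelsA-suc+levelsA zero    zero    = trans (+-identityˡ 1#) (sym (trans (*-identityˡ _) (*-identityˡ 1#)))
    levelsA-suc+levelsA zero    (suc s) = trans (+-identityˡ 0#) (sym (trans (*-identityˡ _) (zeroʳ _)))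
    levelsA-suc+levelsA (suc n) zero    = trans (+-identityʳ _) (trans (levelsA-closed n 0) (*-congˡ (*-congˡ (gauss-zero Q n))))
    levelsA-suc+levelsA (suc n) (suc s) = begin
      levelsA (suc (suc s)) (suc n) + levelsA (suc s) (suc n)
        ≈⟨ +-cong (trans (levelsA-closed n (suc s)) (*-congˡ (*-congʳ (pow-+ Q (triangle (suc s)) (suc s)))))
                  (levelsA-closed n s) ⟩
      P * ((Δ * S) * gaussN R Q n (suc s)) + P * (Δ * gaussN R Q n s)
        ≈⟨ factor P Δ S (gaussN R Q n s) (gaussN R Q n (suc s)) ⟩
      P * (Δ * (gaussN R Q n s + S * gaussN R Q n (suc s))) ∎
      where
      S Δ P : Carrier
      S = pow R Q (suc s)
      Δ = pow R Q (triangle (suc s))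
      P = pow R x (suc n)
      factor : ∀ p t s g₀ g₁ → p * ((t * s) * g₁) + p * (t * g₀) ≈ p * (t * (g₀ + s * g₁))
      factor = solve 5 (λ p t s g₀ g₁ → p :* ((t :* s) :* g₁) :+ p :* (t :* g₀) := p :* (t :* (g₀ :+ s :* g₁))) refl

  module LevelsB (y Q Qr : Carrier) (r : ℕ) (Q^r≈Qr : ∀ n → pow R Q (r ℕ.* n) ≈ pow R Qr n) where

    open GFunction Q Qr r Q^r≈Qr public

    -- levelsB s n is the weight of n b-parts that occupy exactly the levels 0, …, s - 1,
    -- each at most r times, a b-part at level i weighing y·Q^i.
    levelsB : ℕ → ℕ → Carrier
    levelsB zero    n = δ n
    levelsB (suc s) n = ∑ r (λ j → when (suc j ≤ᵇ n) (pow R (y * pow R Q s) (suc j) * levelsB s (n ∸ suc j)))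

    levelsB-form : ℕ → ℕ → Carrier
    levelsB-form s n = when (suc s ≤ᵇ n) (pow R y n * (pow R Q (triangle (suc s)) * g₊ (n ∸ suc s) s))

    levelsB-one-off-diagonal : ∀ n j → j ≢ n → when (suc j ≤ᵇ suc n) (pow R (y * 1#) (suc j) * δ (n ∸ j)) ≈ 0#
    levelsB-one-off-diagonal n j j≢n with ℕₚ.<-cmp j n
    ... | tri< j<n _ _ = trans (when-cong (suc j ≤ᵇ suc n)
                                 (trans (*-congˡ (when-false 1# (≢⇒≡ᵇ-false (ℕₚ.>⇒≢ (ℕₚ.m<n⇒0<n∸m j<n))))) (zeroʳ _)))
                               (when-0# (suc j ≤ᵇ suc n))
    ... | tri≈ _ j≡n _ = ⊥-elim (j≢n j≡n)
    ... | tri> _ _ n<j = when-false _ (>⇒≤ᵇ-false (s≤s n<j))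

    levelsB-one : ∀ n → levelsB 1 n ≈ levelsB-form 0 n
    levelsB-one zero    = ∑-zero r _ (λ _ _ → refl)
    levelsB-one (suc n) with ℕₚ.≤-<-connex r n
    ... | inj₁ r≤n = begin
      levelsB 1 (suc n)                   ≈⟨ ∑-zero r _ (λ j j<r → levelsB-one-off-diagonal n j (ℕₚ.<⇒≢ (ℕₚ.<-≤-trans j<r r≤n))) ⟩
      0#                                  ≈⟨ zeroʳ _ ⟨
      pow R y (suc n) * 0#                ≈⟨ *-congˡ (trans (*-identityˡ _) (trans (g₊-zero n) (when-false 1# (≥⇒<ᵇ-false r≤n)))) ⟨
      pow R y (suc n) * (1# * g₊ n 0)     ∎
    ... | inj₂ n<r = begin
      levelsB 1 (suc n)                   ≈⟨ ∑-single r _ n n<r (λ j _ → levelsB-one-off-diagonal n j) ⟩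
      when (suc n ≤ᵇ suc n) (pow R (y * 1#) (suc n) * δ (n ∸ n))
                                          ≈⟨ when-true _ (≤⇒≤ᵇ-true (ℕₚ.≤-refl {suc n})) ⟩
      pow R (y * 1#) (suc n) * δ (n ∸ n)  ≈⟨ *-cong (pow-congˡ (suc n) (*-identityʳ y)) (when-true 1# (≡.cong (_≡ᵇ 0) (ℕₚ.n∸n≡0 n))) ⟩
      pow R y (suc n) * 1#                ≈⟨ *-congˡ (trans (*-identityˡ _) (trans (g₊-zero n) (when-true 1# (<⇒<ᵇ-true n<r)))) ⟨
      pow R y (suc n) * (1# * g₊ n 0)     ∎

    module _ (s : ℕ) (closed : ∀ n → levelsB (suc s) n ≈ levelsB-form s n) where

      levelsB-suc-term-vanish : ∀ n j → n ∸ suc j < suc s →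
        when (suc j ≤ᵇ n) (pow R (y * pow R Q (suc s)) (suc j) * levelsB (suc s) (n ∸ suc j)) ≈ 0#
      levelsB-suc-term-vanish n j small =
        trans (when-cong (suc j ≤ᵇ n) (trans (*-congˡ (trans (closed (n ∸ suc j)) (when-false _ (>⇒≤ᵇ-false small))))
                                             (zeroʳ _)))
              (when-0# (suc j ≤ᵇ n))

      levelsB-suc-term : ∀ h j → j ≤ h →
        pow R (y * pow R Q (suc s)) (suc j) * levelsB (suc s) (suc (suc s) ℕ.+ h ∸ suc j)
          ≈ pow R y (suc (suc s) ℕ.+ h) * (pow R Q (triangle (suc (suc s))) * (pow R Q (j ℕ.* suc s) * g₊ (h ∸ j) s))
      levelsB-suc-term h j j≤h = begin
        pow R (y * S) (suc j) * levelsB (suc s) (suc (suc s) ℕ.+ h ∸ suc j)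
          ≡⟨ ≡.cong (λ l → pow R (y * S) (suc j) * levelsB (suc s) l) (ℕₚ.+-∸-assoc (suc s) j≤h) ⟩
        pow R (y * S) (suc j) * levelsB (suc s) (suc s ℕ.+ (h ∸ j))
          ≈⟨ *-congˡ (trans (closed (suc s ℕ.+ (h ∸ j)))
                            (trans (when-true _ (≤⇒≤ᵇ-true (ℕₚ.m≤m+n (suc s) (h ∸ j))))
                                   (*-congˡ (*-congˡ (reflexive (≡.cong (λ l → g₊ l s) (ℕₚ.m+n∸m≡n (suc s) (h ∸ j)))))))) ⟩
        pow R (y * S) (suc j) * (pow R y (suc s ℕ.+ (h ∸ j)) * (Δ * g₊ (h ∸ j) s))
          ≈⟨ *-congʳ (trans (pow-distrib-* y S (suc j))
                            (*-congˡ (*-congˡ (trans (sym (pow-* Q (suc s) j)) (pow-congʳ Q (ℕₚ.*-comm (suc s) j)))))) ⟩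
        (pow R y (suc j) * (S * pow R Q (j ℕ.* suc s))) * (pow R y (suc s ℕ.+ (h ∸ j)) * (Δ * g₊ (h ∸ j) s))
          ≈⟨ regroup _ _ _ _ _ _ ⟩
        (pow R y (suc j) * pow R y (suc s ℕ.+ (h ∸ j))) * ((Δ * S) * (pow R Q (j ℕ.* suc s) * g₊ (h ∸ j) s))
          ≈⟨ *-cong (trans (sym (pow-+ y (suc j) _)) (pow-congʳ y exponents))
                    (*-congʳ (sym (pow-+ Q (triangle (suc s)) (suc s)))) ⟩
        pow R y (suc (suc s) ℕ.+ h) * (pow R Q (triangle (suc (suc s))) * (pow R Q (j ℕ.* suc s) * g₊ (h ∸ j) s)) ∎
        where
        S Δ : Carrier
        S = pow R Q (suc s)
        Δ = pow R Q (triangle (suc s))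
        exponents : suc j ℕ.+ (suc s ℕ.+ (h ∸ j)) ≡ suc (suc s) ℕ.+ h
        exponents = ≡.cong suc (≡.trans (≡.sym (ℕₚ.+-assoc j (suc s) (h ∸ j)))
                                 (≡.trans (≡.cong (ℕ._+ (h ∸ j)) (ℕₚ.+-comm j (suc s)))
                                   (≡.trans (ℕₚ.+-assoc (suc s) j (h ∸ j)) (≡.cong (suc s ℕ.+_) (ℕₚ.m+[n∸m]≡n j≤h)))))
        regroup : ∀ yj s sj yr t g → (yj * (s * sj)) * (yr * (t * g)) ≈ (yj * yr) * ((t * s) * (sj * g))
        regroup = solve 6 (λ yj s sj yr t g → (yj :* (s :* sj)) :* (yr :* (t :* g)) := (yj :* yr) :* ((t :* s) :* (sj :* g))) refl

      levelsB-suc : ∀ n → levelsB (suc (suc s)) n ≈ levelsB-form (suc s) n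
      levelsB-suc n with ℕₚ.≤-<-connex (suc (suc s)) n
      ... | inj₂ n<2+s = trans (∑-zero r _ (λ j _ → levelsB-suc-term-vanish n j
                                 (ℕₚ.m<n+o⇒m∸n<o n (suc j) (ℕₚ.<-≤-trans n<2+s (s≤s (ℕₚ.m≤n+m (suc s) j))))))
                               (sym (when-false _ (>⇒≤ᵇ-false n<2+s)))
      ... | inj₁ 2+s≤n = begin
        levelsB (suc (suc s)) n
          ≡⟨ ≡.cong (levelsB (suc (suc s))) (≡.sym n≡) ⟩
        levelsB (suc (suc s)) n′
          ≈⟨ ∑-cong-∀ r term ⟩
        ∑ r (λ j → pow R y n′ * (Δ * when (j ≤ᵇ h) (pow R Q (j ℕ.* suc s) * g₊ (h ∸ j) s)))
          ≈⟨ ∑-cong-∀ r (λ j → sym (*-assoc _ _ _)) ⟩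
        ∑ r (λ j → (pow R y n′ * Δ) * when (j ≤ᵇ h) (pow R Q (j ℕ.* suc s) * g₊ (h ∸ j) s))
          ≈⟨ *-distribˡ-∑ r _ _ ⟨
        (pow R y n′ * Δ) * ∑ r (λ j → when (j ≤ᵇ h) (pow R Q (j ℕ.* suc s) * g₊ (h ∸ j) s))
          ≈⟨ trans (*-congˡ (sym (g₊-suc h s))) (*-assoc _ _ _) ⟩
        pow R y n′ * (Δ * g₊ h (suc s))
          ≡⟨ ≡.cong (λ l → pow R y l * (Δ * g₊ h (suc s))) n≡ ⟩
        pow R y n * (Δ * g₊ h (suc s))
          ≈⟨ when-true _ (≤⇒≤ᵇ-true 2+s≤n) ⟨
        levelsB-form (suc s) n ∎
        where
        h n′ : ℕ
        h  = n ∸ suc (suc s)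
        n′ = suc (suc s) ℕ.+ h
        n≡ : n′ ≡ n
        n≡ = ℕₚ.m+[n∸m]≡n 2+s≤n
        Δ : Carrier
        Δ = pow R Q (triangle (suc (suc s)))
        term : ∀ j → when (suc j ≤ᵇ n′) (pow R (y * pow R Q (suc s)) (suc j) * levelsB (suc s) (n′ ∸ suc j))
                       ≈ pow R y n′ * (Δ * when (j ≤ᵇ h) (pow R Q (j ℕ.* suc s) * g₊ (h ∸ j) s))
        term j with ℕₚ.≤-<-connex j h
        ... | inj₁ j≤h = trans (when-true _ (≤⇒≤ᵇ-true (s≤s (ℕₚ.≤-trans j≤h (ℕₚ.≤-trans (ℕₚ.m≤n+m h s) (ℕₚ.n≤1+n _))))))
                               (trans (levelsB-suc-term h j j≤h) (*-congˡ (*-congˡ (sym (when-true _ (≤⇒≤ᵇ-true j≤h))))))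
        ... | inj₂ h<j = trans (levelsB-suc-term-vanish n′ j
                                  (s≤s (ℕₚ.≤-trans (ℕₚ.∸-monoʳ-≤ (suc (s ℕ.+ h)) h<j) (ℕₚ.≤-reflexive (ℕₚ.m+n∸n≡m s h)))))
                               (sym (trans (*-congˡ (trans (*-congˡ (when-false _ (>⇒≤ᵇ-false h<j))) (zeroʳ _))) (zeroʳ _)))

    levelsB-closed : ∀ s n → levelsB (suc s) n ≈ levelsB-form s n
    levelsB-closed zero    = levelsB-one
    levelsB-closed (suc s) = levelsB-suc s (levelsB-closed s)

-- c is the lowest level holding an a-part: 0 when the smallest part is a, 1 when it is b.
Bottom : ℕ → ℕ → ℕ → ℕ → Set
Bottom a b d c = (d ≡ a × c ≡ 0) ⊎ (d ≡ b × c ≡ 1)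

Bottom⇒d∈ab : ∀ {a b d c} → Bottom a b d c → (d ≡ a) ⊎ (d ≡ b)
Bottom⇒d∈ab (inj₁ (d≡a , _)) = inj₁ d≡a
Bottom⇒d∈ab (inj₂ (d≡b , _)) = inj₂ d≡b

Bottom⇒c≤1 : ∀ {a b d c} → Bottom a b d c → c ≤ 1
Bottom⇒c≤1 (inj₁ (_ , ≡.refl)) = z≤n
Bottom⇒c≤1 (inj₂ (_ , ≡.refl)) = s≤s z≤n

module ClosedForms {c ℓ} (R : CommutativeRing c ℓ) (k′ a b r d N : ℕ)
                   (1≤a : 1 ≤ a) (a<b : a < b) (b≤k : b ≤ suc k′) (1≤r : 1 ≤ r)
                   (μ ν q : CommutativeRing.Carrier R) (c₀ : ℕ) (bottom : Bottom a b d c₀) where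

  d∈ab : (d ≡ a) ⊎ (d ≡ b)
  d∈ab = Bottom⇒d∈ab bottom

  c₀≤1 : c₀ ≤ 1
  c₀≤1 = Bottom⇒c≤1 bottom

  open Sums R public
  open Convolution R public
  open LevelGenerating R public
  open Gaussian R public using (gauss∸; gauss-zero; gauss-vanish)
  open HeadSums R k′ a b r d N 1≤a a<b b≤k 1≤r d∈ab μ ν q public
  open Partitions k′ a b r d 1≤a a<b b≤k 1≤r public

  X Y X₀ Qr : Carrier
  X  = μ * pow R q a
  Y  = ν * pow R q b
  X₀ = X * pow R Q c₀
  Qr = pow R q (r ℕ.* k)

  Q^r≈Qr : ∀ n → pow R Q (r ℕ.* n) ≈ pow R Qr n
  Q^r≈Qr n = begin
    pow R (pow R q k) (r ℕ.* n)   ≈⟨ pow-* q k (r ℕ.* n) ⟨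
    pow R q (k ℕ.* (r ℕ.* n))     ≡⟨ ≡.cong (pow R q) (≡.trans (≡.sym (ℕₚ.*-assoc k r n)) (≡.cong (ℕ._* n) (ℕₚ.*-comm k r))) ⟩
    pow R q (r ℕ.* k ℕ.* n)       ≈⟨ pow-* q (r ℕ.* k) n ⟩
    pow R Qr n                    ∎

  open LevelsA X₀ Q public
  open LevelsB Y Q Qr r Q^r≈Qr public

  aLevels : ℕ → ℕ
  aLevels s = suc s ∸ c₀

  aLevels-suc : ∀ s → aLevels (suc s) ≡ suc (aLevels s)
  aLevels-suc s = ℕₚ.+-∸-assoc 1 (ℕₚ.≤-trans c₀≤1 (s≤s z≤n))

  aLevels-weight : ∀ s σ → aLevels s ≡ suc σ → X₀ * pow R Q σ ≈ X * pow R Q s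
  aLevels-weight s σ eq = trans (*-assoc _ _ _) (*-congˡ (trans (sym (pow-+ Q c₀ σ)) (pow-congʳ Q c₀+σ≡s)))
    where
    c₀+σ≡s : c₀ ℕ.+ σ ≡ s
    c₀+σ≡s = ℕₚ.suc-injective (≡.trans (≡.sym (ℕₚ.+-suc c₀ σ))
               (≡.trans (≡.cong (c₀ ℕ.+_) (≡.sym eq)) (ℕₚ.m+[n∸m]≡n (ℕₚ.≤-trans c₀≤1 (s≤s z≤n)))))

  topA topB : ℕ → ℕ → Carrier
  topA m s = (levelsA (aLevels s) ⋆ levelsB s) m
  topB m s = (levelsA (aLevels s) ⋆ levelsB (suc s)) m

  runSumA runSumB : ℕ → ℕ → ℕ → Carrier
  runSumA m s j = when (j ≡ᵇ 0) (topA m s)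
  runSumB m s j = when (1 ≤ᵇ j) (when (j ≤ᵇ r) (when (j ≤ᵇ m) (pow R (Y * pow R Q s) j * topA (m ∸ j) s)))

  RunSumsClosed : ℕ → Set _
  RunSumsClosed m = (∀ s j → aPart s ≤ N → runSum m (aPart s) j ≈ runSumA m s j)
                  × (∀ s j → bPart s ≤ N → runSum m (bPart s) j ≈ runSumB m s j)

  headSum-aPart : ∀ m → RunSumsClosed m → ∀ s → aPart s ≤ N → headSum m (aPart s) ≈ topA m s
  headSum-aPart m closed s p = begin
    headSum m (aPart s)              ≈⟨ headSum-runSums m (aPart s) ⟩
    ∑ (suc r) (runSum m (aPart s))   ≈⟨ ∑-cong-∀ (suc r) (λ j → proj₁ closed s j p) ⟩
    ∑ (suc r) (runSumA m s)          ≈⟨ ∑-single (suc r) (runSumA m s) 0 (s≤s z≤n) (λ { zero _ 0≢0 → ⊥-elim (0≢0 ≡.refl) ; (suc j) _ _ → refl }) ⟩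
    topA m s                         ∎

  headSum-bPart : ∀ m → RunSumsClosed m → ∀ s → bPart s ≤ N → headSum m (bPart s) ≈ topB m s
  headSum-bPart m closed s p = begin
    headSum m (bPart s)              ≈⟨ headSum-runSums m (bPart s) ⟩
    ∑ (suc r) (runSum m (bPart s))   ≈⟨ ∑-cong-∀ (suc r) (λ j → proj₂ closed s j p) ⟩
    ∑ (suc r) (runSumB m s)          ≈⟨ trans (∑-suc r _) (+-identityˡ _) ⟩
    ∑ r (λ j → runSumB m s (suc j))  ≈⟨ ∑-cong r (λ j j<r → when-true _ (≤⇒≤ᵇ-true j<r)) ⟩
    ∑ r (λ j → when (suc j ≤ᵇ m) (pow R (Y * pow R Q s) (suc j) * topA (m ∸ suc j) s))
      ≈⟨ ∑-cong-∀ r (λ j → ⋆-shift (levelsA (aLevels s)) (levelsB s) (suc j) _ m) ⟨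
    ∑ r (λ j → (levelsA (aLevels s) ⋆ (λ n → when (suc j ≤ᵇ n) (pow R (Y * pow R Q s) (suc j) * levelsB s (n ∸ suc j)))) m)
      ≈⟨ ⋆-∑ʳ (levelsA (aLevels s)) r _ m ⟨
    topB m s                         ∎

  aPart-zero-is-d : (aPart 0 ≡ᵇ d) ≡ (c₀ ≡ᵇ 0)
  aPart-zero-is-d = go bottom
    where
    go : Bottom a b d c₀ → (aPart 0 ≡ᵇ d) ≡ (c₀ ≡ᵇ 0)
    go (inj₁ (d≡a , c₀≡0)) rewrite d≡a | c₀≡0 = ≡ᵇ-refl a
    go (inj₂ (d≡b , c₀≡1)) rewrite d≡b | c₀≡1 = ≢⇒≡ᵇ-false (ℕₚ.<⇒≢ a<b)

  bPart-zero-is-d : (bPart 0 ≡ᵇ d) ≡ (c₀ ≡ᵇ 1)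
  bPart-zero-is-d = go bottom
    where
    go : Bottom a b d c₀ → (bPart 0 ≡ᵇ d) ≡ (c₀ ≡ᵇ 1)
    go (inj₁ (d≡a , c₀≡0)) rewrite d≡a | c₀≡0 = ≢⇒≡ᵇ-false (ℕₚ.>⇒≢ a<b)
    go (inj₂ (d≡b , c₀≡1)) rewrite d≡b | c₀≡1 = ≡ᵇ-refl b

  aPart-suc-is-not-d : ∀ s → (aPart (suc s) ≡ᵇ d) ≡ false
  aPart-suc-is-not-d s with d∈ab
  ... | inj₁ ≡.refl = ≢⇒≡ᵇ-false (ℕₚ.0≢1+n ∘ ≡.sym ∘ aPart-injective {suc s} {0})
  ... | inj₂ ≡.refl = ≢⇒≡ᵇ-false (aPart≢bPart (suc s) 0)

  bPart-suc-is-not-d : ∀ s → (bPart (suc s) ≡ᵇ d) ≡ false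
  bPart-suc-is-not-d s with d∈ab
  ... | inj₁ ≡.refl = ≢⇒≡ᵇ-false (aPart≢bPart 0 (suc s) ∘ ≡.sym)
  ... | inj₂ ≡.refl = ≢⇒≡ᵇ-false (ℕₚ.0≢1+n ∘ ≡.sym ∘ bPart-injective {suc s} {0})

  topA-zero : ∀ m → topA m 0 ≈ levelsA (1 ∸ c₀) m
  topA-zero = ⋆-δ (levelsA (1 ∸ c₀))

  lowest-aPart-alone : when (c₀ ≡ᵇ 0) (partWeight (aPart 0)) ≈ topA 1 0
  lowest-aPart-alone = go bottom
    where
    go : Bottom a b d c₀ → when (c₀ ≡ᵇ 0) (partWeight (aPart 0)) ≈ topA 1 0
    go (inj₁ (_ , c₀≡0)) = begin
      when (c₀ ≡ᵇ 0) (partWeight (aPart 0))   ≈⟨ when-true _ (≡.cong (_≡ᵇ 0) c₀≡0) ⟩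
      partWeight (aPart 0)                    ≈⟨ partWeight-aPart 0 ⟩
      X * pow R Q 0                           ≈⟨ *-congˡ (pow-congʳ Q c₀≡0) ⟨
      X₀                                      ≈⟨ trans (*-identityʳ _) (*-identityʳ _) ⟨
      (X₀ * 1#) * 1#                          ≈⟨ *-congˡ (+-identityˡ 1#) ⟨
      (X₀ * 1#) * (0# + 1#)                   ≡⟨ ≡.cong (λ c → levelsA (1 ∸ c) 1) c₀≡0 ⟨
      levelsA (1 ∸ c₀) 1                      ≈⟨ topA-zero 1 ⟨
      topA 1 0                                ∎
    go (inj₂ (_ , c₀≡1)) = begin
      when (c₀ ≡ᵇ 0) (partWeight (aPart 0))   ≈⟨ when-false _ (≡.cong (_≡ᵇ 0) c₀≡1) ⟩
      0#                                      ≡⟨ ≡.cong (λ c → levelsA (1 ∸ c) 1) c₀≡1 ⟨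
      levelsA (1 ∸ c₀) 1                      ≈⟨ topA-zero 1 ⟨
      topA 1 0                                ∎

  lowest-bPart-alone : when (c₀ ≡ᵇ 1) (partWeight (bPart 0)) ≈ runSumB 1 0 1
  lowest-bPart-alone = go bottom
    where
    go : Bottom a b d c₀ → when (c₀ ≡ᵇ 1) (partWeight (bPart 0)) ≈ runSumB 1 0 1
    go (inj₁ (_ , c₀≡0)) = begin
      when (c₀ ≡ᵇ 1) (partWeight (bPart 0))       ≈⟨ when-false _ (≡.cong (_≡ᵇ 1) c₀≡0) ⟩
      0#                                          ≈⟨ trans (*-congˡ (zeroˡ 1#)) (zeroʳ _) ⟨
      pow R (Y * pow R Q 0) 1 * (levelsA 1 0 * 1#)  ≡⟨ ≡.cong (λ c → pow R (Y * pow R Q 0) 1 * (levelsA (1 ∸ c) 0 * 1#)) c₀≡0 ⟨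
      pow R (Y * pow R Q 0) 1 * (levelsA (1 ∸ c₀) 0 * 1#)
                                                  ≈⟨ *-congˡ (+-identityˡ _) ⟨
      pow R (Y * pow R Q 0) 1 * topA 0 0          ≈⟨ when-true _ (≤⇒≤ᵇ-true 1≤r) ⟨
      runSumB 1 0 1                               ∎
    go (inj₂ (_ , c₀≡1)) = begin
      when (c₀ ≡ᵇ 1) (partWeight (bPart 0))       ≈⟨ when-true _ (≡.cong (_≡ᵇ 1) c₀≡1) ⟩
      partWeight (bPart 0)                        ≈⟨ partWeight-bPart 0 ⟩
      Y * pow R Q 0                               ≈⟨ trans (*-identityʳ _) (*-identityʳ _) ⟨
      pow R (Y * pow R Q 0) 1 * 1#                ≈⟨ *-congˡ (*-identityˡ 1#) ⟨
      pow R (Y * pow R Q 0) 1 * (levelsA 0 0 * 1#)  ≡⟨ ≡.cong (λ c → pow R (Y * pow R Q 0) 1 * (levelsA (1 ∸ c) 0 * 1#)) c₀≡1 ⟨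
      pow R (Y * pow R Q 0) 1 * (levelsA (1 ∸ c₀) 0 * 1#)
                                                  ≈⟨ *-congˡ (+-identityˡ _) ⟨
      pow R (Y * pow R Q 0) 1 * topA 0 0          ≈⟨ when-true _ (≤⇒≤ᵇ-true 1≤r) ⟨
      runSumB 1 0 1                               ∎

  levelsA-aLevels-suc-zero : ∀ s → levelsA (aLevels (suc s)) 0 ≈ 0#
  levelsA-aLevels-suc-zero s rewrite aLevels-suc s = refl

  topA-one-suc : ∀ s → topA 1 (suc s) ≈ 0#
  topA-one-suc s = begin
    (0# + levelsA (aLevels (suc s)) 1 * levelsB (suc s) 0) + levelsA (aLevels (suc s)) 0 * levelsB (suc s) 1
      ≈⟨ +-cong (+-congˡ (trans (*-congˡ (levelsB-closed s 0)) (zeroʳ _)))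
                (trans (*-congʳ (levelsA-aLevels-suc-zero s)) (zeroˡ _)) ⟩
    (0# + 0#) + 0#
      ≈⟨ trans (+-identityʳ _) (+-identityʳ 0#) ⟩
    0# ∎

  base-aPart : ∀ s j → aPart s ≤ N → runSum 1 (aPart s) j ≈ runSumA 1 s j
  base-aPart s j p = begin
    runSum 1 (aPart s) j
      ≈⟨ runSum-one (aPart s) j (1≤aPart s) p (aPart-isAorB s) ⟩
    when ((aPart s ≡ᵇ d) ∧ (bRun (aPart s ∷ []) ≡ᵇ j)) (partWeight (aPart s))
      ≡⟨ ≡.cong (λ l → when ((aPart s ≡ᵇ d) ∧ (l ≡ᵇ j)) (partWeight (aPart s))) (bRun-aPart s []) ⟩
    when ((aPart s ≡ᵇ d) ∧ (0 ≡ᵇ j)) (partWeight (aPart s))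
      ≈⟨ by-cases s j ⟩
    runSumA 1 s j ∎
    where
    by-cases : ∀ s j → when ((aPart s ≡ᵇ d) ∧ (0 ≡ᵇ j)) (partWeight (aPart s)) ≈ runSumA 1 s j
    by-cases (suc s) j = trans (when-false _ (≡.cong (_∧ (0 ≡ᵇ j)) (aPart-suc-is-not-d s)))
                               (sym (trans (when-cong (j ≡ᵇ 0) (topA-one-suc s)) (when-0# (j ≡ᵇ 0))))
    by-cases zero (suc j) = when-false _ (Boolₚ.∧-zeroʳ (aPart 0 ≡ᵇ d))
    by-cases zero zero    = trans (reflexive (≡.cong (λ g → when g (partWeight (aPart 0)))
                                                         (≡.trans (Boolₚ.∧-identityʳ (aPart 0 ≡ᵇ d)) aPart-zero-is-d)))
                                  lowest-aPart-alone

  base-bPart : ∀ s j → bPart s ≤ N → runSum 1 (bPart s) j ≈ runSumB 1 s j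
  base-bPart s j p = begin
    runSum 1 (bPart s) j
      ≈⟨ runSum-one (bPart s) j (1≤bPart s) p (bPart-isAorB s) ⟩
    when ((bPart s ≡ᵇ d) ∧ (bRun (bPart s ∷ []) ≡ᵇ j)) (partWeight (bPart s))
      ≡⟨ ≡.cong (λ l → when ((bPart s ≡ᵇ d) ∧ (l ≡ᵇ j)) (partWeight (bPart s))) (bRun-bPart s []) ⟩
    when ((bPart s ≡ᵇ d) ∧ (1 ≡ᵇ j)) (partWeight (bPart s))
      ≈⟨ by-cases s j ⟩
    runSumB 1 s j ∎
    where
    by-cases : ∀ s j → when ((bPart s ≡ᵇ d) ∧ (1 ≡ᵇ j)) (partWeight (bPart s)) ≈ runSumB 1 s j
    by-cases s zero = when-false _ (Boolₚ.∧-zeroʳ (bPart s ≡ᵇ d))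
    by-cases s (suc (suc j)) = trans (when-false _ (Boolₚ.∧-zeroʳ (bPart s ≡ᵇ d))) (sym (when-0# (suc (suc j) ≤ᵇ r)))
    by-cases (suc s) 1 = begin
      when ((bPart (suc s) ≡ᵇ d) ∧ true) (partWeight (bPart (suc s)))
        ≈⟨ when-false _ (≡.cong (_∧ true) (bPart-suc-is-not-d s)) ⟩
      0#
        ≈⟨ trans (*-congˡ (zeroʳ _)) (zeroʳ _) ⟨
      pow R (Y * pow R Q (suc s)) 1 * (levelsA (aLevels (suc s)) 0 * 0#)
        ≈⟨ *-congˡ (trans (+-identityˡ _) (*-congˡ (levelsB-closed s 0))) ⟨
      pow R (Y * pow R Q (suc s)) 1 * topA 0 (suc s)
        ≈⟨ when-true _ (≤⇒≤ᵇ-true 1≤r) ⟨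
      runSumB 1 (suc s) 1 ∎
    by-cases zero 1 = trans (reflexive (≡.cong (λ g → when g (partWeight (bPart 0)))
                                               (≡.trans (Boolₚ.∧-identityʳ (bPart 0 ≡ᵇ d)) bPart-zero-is-d)))
                            lowest-bPart-alone

  levelsA-⋆-suc : ∀ σ O m → (levelsA (suc σ) ⋆ O) (suc m) ≈ (X₀ * pow R Q σ) * ((levelsA (suc σ) ⋆ O) m + (levelsA σ ⋆ O) m)
  levelsA-⋆-suc σ O m = begin
    (levelsA (suc σ) ⋆ O) (suc m)                                 ≈⟨ ⋆-suc (levelsA (suc σ)) O m ⟩
    0# * O (suc m) + ((λ n → levelsA (suc σ) (suc n)) ⋆ O) m      ≈⟨ trans (+-congʳ (zeroˡ _)) (+-identityˡ _) ⟩
    ((λ n → (X₀ * pow R Q σ) * (levelsA (suc σ) n + levelsA σ n)) ⋆ O) m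
                                                                  ≈⟨ ⋆-*ˡ (X₀ * pow R Q σ) (λ n → levelsA (suc σ) n + levelsA σ n) O m ⟩
    (X₀ * pow R Q σ) * ((λ n → levelsA (suc σ) n + levelsA σ n) ⋆ O) m
                                                                  ≈⟨ *-congˡ (⋆-distribʳ-+ (levelsA (suc σ)) (levelsA σ) O m) ⟩
    (X₀ * pow R Q σ) * ((levelsA (suc σ) ⋆ O) m + (levelsA σ ⋆ O) m) ∎

  topBBelow : ℕ → ℕ → Carrier
  topBBelow m zero    = 0#
  topBBelow m (suc s) = topB m s

  topA-suc : ∀ m s → (X * pow R Q s) * (topA (suc m) s + topBBelow (suc m) s) ≈ topA (suc (suc m)) s
  topA-suc m (suc s) = sym (begin
    (levelsA (aLevels (suc s)) ⋆ levelsB (suc s)) (suc (suc m))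
      ≡⟨ ≡.cong (λ l → (levelsA l ⋆ levelsB (suc s)) (suc (suc m))) (aLevels-suc s) ⟩
    (levelsA (suc (aLevels s)) ⋆ levelsB (suc s)) (suc (suc m))
      ≈⟨ levelsA-⋆-suc (aLevels s) (levelsB (suc s)) (suc m) ⟩
    (X₀ * pow R Q (aLevels s)) * ((levelsA (suc (aLevels s)) ⋆ levelsB (suc s)) (suc m) + topB (suc m) s)
      ≈⟨ *-cong (aLevels-weight (suc s) (aLevels s) (aLevels-suc s))
                (+-congʳ (reflexive (≡.cong (λ l → (levelsA l ⋆ levelsB (suc s)) (suc m)) (≡.sym (aLevels-suc s))))) ⟩
    (X * pow R Q (suc s)) * (topA (suc m) (suc s) + topB (suc m) s) ∎)
  topA-suc m zero = go bottom
    where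
    go : Bottom a b d c₀ → (X * pow R Q 0) * (topA (suc m) 0 + 0#) ≈ topA (suc (suc m)) 0
    go (inj₁ (_ , c₀≡0)) = sym (begin
      (levelsA (1 ∸ c₀) ⋆ δ) (suc (suc m))
        ≡⟨ ≡.cong (λ c → (levelsA (1 ∸ c) ⋆ δ) (suc (suc m))) c₀≡0 ⟩
      (levelsA 1 ⋆ δ) (suc (suc m))
        ≈⟨ levelsA-⋆-suc 0 δ (suc m) ⟩
      (X₀ * pow R Q 0) * ((levelsA 1 ⋆ δ) (suc m) + (δ ⋆ δ) (suc m))
        ≈⟨ *-cong (aLevels-weight 0 0 (≡.cong (1 ∸_) c₀≡0))
                  (+-cong (reflexive (≡.cong (λ c → (levelsA (1 ∸ c) ⋆ δ) (suc m)) (≡.sym c₀≡0))) (⋆-δ δ (suc m))) ⟩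
      (X * pow R Q 0) * (topA (suc m) 0 + 0#) ∎)
    go (inj₂ (_ , c₀≡1)) = begin
      (X * pow R Q 0) * (topA (suc m) 0 + 0#)
        ≈⟨ *-congˡ (trans (+-identityʳ _) (trans (topA-zero (suc m)) (reflexive (≡.cong (λ c → levelsA (1 ∸ c) (suc m)) c₀≡1)))) ⟩
      (X * pow R Q 0) * 0#
        ≈⟨ zeroʳ _ ⟩
      0#
        ≡⟨ ≡.cong (λ c → levelsA (1 ∸ c) (suc (suc m))) c₀≡1 ⟨
      levelsA (1 ∸ c₀) (suc (suc m))
        ≈⟨ topA-zero (suc (suc m)) ⟨
      topA (suc (suc m)) 0 ∎

  step-aPart : ∀ m → RunSumsClosed (suc m) → ∀ s j → aPart s ≤ N → runSum (suc (suc m)) (aPart s) j ≈ runSumA (suc (suc m)) s j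
  step-aPart m closed s (suc j) p = runSum-aPart-suc (suc m) s j p
  step-aPart m closed s zero    p = begin
    runSum (suc (suc m)) (aPart s) 0
      ≈⟨ runSum-aPart-zero m s p ⟩
    partWeight (aPart s) * (headSum (suc m) (aPart s) + headSumBelowA (suc m) s)
      ≈⟨ *-cong (partWeight-aPart s) (+-cong (headSum-aPart (suc m) closed s p) (below s p)) ⟩
    (X * pow R Q s) * (topA (suc m) s + topBBelow (suc m) s)
      ≈⟨ topA-suc m s ⟩
    topA (suc (suc m)) s ∎
    where
    below : ∀ s → aPart s ≤ N → headSumBelowA (suc m) s ≈ topBBelow (suc m) s
    below zero    _ = refl
    below (suc s) p = headSum-bPart (suc m) closed s (ℕₚ.≤-trans (ℕₚ.<⇒≤ (bPart<aPart-suc s)) p)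

  step-bPart : ∀ m → RunSumsClosed (suc m) → ∀ s j → bPart s ≤ N → runSum (suc (suc m)) (bPart s) j ≈ runSumB (suc (suc m)) s j
  step-bPart m closed s zero p = runSum-bPart-zero (suc m) s p
  step-bPart m closed s (suc zero) p = begin
    runSum (suc (suc m)) (bPart s) 1
      ≈⟨ runSum-bPart-suc m s 0 p ⟩
    partWeight (bPart s) * (when (0 <ᵇ r) (runSum (suc m) (bPart s) 0) + headSum (suc m) (aPart s))
      ≈⟨ *-cong (partWeight-bPart s)
                (+-cong (trans (when-cong (0 <ᵇ r) (proj₂ closed s 0 p)) (when-0# (0 <ᵇ r)))
                        (headSum-aPart (suc m) closed s (ℕₚ.≤-trans (ℕₚ.<⇒≤ (aPart<bPart s)) p))) ⟩
    (Y * pow R Q s) * (0# + topA (suc m) s)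
      ≈⟨ *-cong (sym (*-identityʳ _)) (+-identityˡ _) ⟩
    pow R (Y * pow R Q s) 1 * topA (suc m) s
      ≈⟨ when-true _ (≤⇒≤ᵇ-true 1≤r) ⟨
    runSumB (suc (suc m)) s 1 ∎
  step-bPart m closed s (suc (suc j)) p = begin
    runSum (suc (suc m)) (bPart s) (suc (suc j))
      ≈⟨ runSum-bPart-suc m s (suc j) p ⟩
    partWeight (bPart s) * (when (suc j <ᵇ r) (runSum (suc m) (bPart s) (suc j)) + 0#)
      ≈⟨ *-cong (partWeight-bPart s) (trans (+-identityʳ _) (when-cong (suc j <ᵇ r) (proj₂ closed s (suc j) p))) ⟩
    y′ * when (suc j <ᵇ r) (when (suc j ≤ᵇ r) (when (suc j ≤ᵇ suc m) (pow R y′ (suc j) * topA (m ∸ j) s)))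
      ≈⟨ by-cases (suc j <ᵇ r) ≡.refl ⟩
    runSumB (suc (suc m)) s (suc (suc j)) ∎
    where
    y′ : Carrier
    y′ = Y * pow R Q s
    by-cases : ∀ c → (suc j <ᵇ r) ≡ c →
      y′ * when c (when (suc j ≤ᵇ r) (when (suc j ≤ᵇ suc m) (pow R y′ (suc j) * topA (m ∸ j) s)))
        ≈ when c (when (suc j ≤ᵇ suc m) (pow R y′ (suc (suc j)) * topA (m ∸ j) s))
    by-cases false _     = zeroʳ _
    by-cases true  j+1<r = begin
      y′ * when (suc j ≤ᵇ r) (when (suc j ≤ᵇ suc m) (pow R y′ (suc j) * topA (m ∸ j) s))
        ≈⟨ *-congˡ (when-true _ (≤⇒≤ᵇ-true (ℕₚ.<⇒≤ (<ᵇ-true⇒< {suc j} {r} j+1<r)))) ⟩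
      y′ * when (suc j ≤ᵇ suc m) (pow R y′ (suc j) * topA (m ∸ j) s)
        ≈⟨ *-when (suc j ≤ᵇ suc m) y′ _ ⟩
      when (suc j ≤ᵇ suc m) (y′ * (pow R y′ (suc j) * topA (m ∸ j) s))
        ≈⟨ when-cong (suc j ≤ᵇ suc m) (*-assoc _ _ _) ⟨
      when (suc j ≤ᵇ suc m) (pow R y′ (suc (suc j)) * topA (m ∸ j) s) ∎

  runSums-closed : ∀ m → RunSumsClosed (suc m)
  runSums-closed zero    = base-aPart , base-bPart
  runSums-closed (suc m) = step-aPart m (runSums-closed m) , step-bPart m (runSums-closed m)

  levelsB-below : ∀ s n → n < s → levelsB s n ≈ 0#
  levelsB-below (suc s) n n<s = trans (levelsB-closed s n) (when-false _ (>⇒≤ᵇ-false n<s))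

  topA-vanish : ∀ m s → m < s → topA m s ≈ 0#
  topA-vanish m s m<s = ⋆-zeroʳ (levelsA (aLevels s)) (levelsB s) m (λ n n≤m → levelsB-below s n (ℕₚ.≤-<-trans n≤m m<s))

  topB-vanish : ∀ m s → m ≤ s → topB m s ≈ 0#
  topB-vanish m s m≤s = ⋆-zeroʳ (levelsA (aLevels s)) (levelsB (suc s)) m (λ n n≤m → levelsB-below (suc s) n (s≤s (ℕₚ.≤-trans n≤m m≤s)))

  headSums-level : ∀ m s → b ℕ.+ suc m ℕ.* k ≤ N →
    headSum (suc m) (aPart s) + headSum (suc m) (bPart s) ≈ topA (suc m) s + topB (suc m) s
  headSums-level m s bound with ℕₚ.≤-<-connex (bPart s) N
  ... | inj₁ bPart≤N = +-cong (headSum-aPart (suc m) (runSums-closed m) s (ℕₚ.≤-trans (ℕₚ.<⇒≤ (aPart<bPart s)) bPart≤N))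
                              (headSum-bPart (suc m) (runSums-closed m) s bPart≤N)
  ... | inj₂ N<bPart = +-cong aPart-case (trans (headSum-beyond (suc m) (bPart s) N<bPart) (sym (topB-vanish (suc m) s (ℕₚ.<⇒≤ 1+m<s))))
    where
    1+m<s : suc m < s
    1+m<s = ℕₚ.≰⇒> (λ s≤1+m → ℕₚ.<⇒≱ N<bPart
              (ℕₚ.≤-trans (bPart-mono-≤ s≤1+m) (ℕₚ.≤-trans (ℕₚ.≤-reflexive (ℕₚ.+-comm (suc m ℕ.* k) b)) bound)))
    aPart-case : headSum (suc m) (aPart s) ≈ topA (suc m) s
    aPart-case with ℕₚ.≤-<-connex (aPart s) N
    ... | inj₁ aPart≤N = headSum-aPart (suc m) (runSums-closed m) s aPart≤N
    ... | inj₂ N<aPart = trans (headSum-beyond (suc m) (aPart s) N<aPart) (sym (topA-vanish (suc m) s 1+m<s))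

  aPair : ℕ → ℕ → Carrier
  aPair s n = pow R X₀ n * (pow R Q (triangle (aLevels s)) * gaussN R Q n (aLevels s))

  topB+topA : ∀ m s → topB m s + topA m (suc s) ≈ (aPair s ⋆ levelsB (suc s)) m
  topB+topA m s = begin
    (levelsA (aLevels s) ⋆ levelsB (suc s)) m + (levelsA (aLevels (suc s)) ⋆ levelsB (suc s)) m
      ≡⟨ ≡.cong (λ l → (levelsA (aLevels s) ⋆ levelsB (suc s)) m + (levelsA l ⋆ levelsB (suc s)) m) (aLevels-suc s) ⟩
    (levelsA (aLevels s) ⋆ levelsB (suc s)) m + (levelsA (suc (aLevels s)) ⋆ levelsB (suc s)) m
      ≈⟨ +-comm _ _ ⟩
    (levelsA (suc (aLevels s)) ⋆ levelsB (suc s)) m + (levelsA (aLevels s) ⋆ levelsB (suc s)) m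
      ≈⟨ ⋆-distribʳ-+ (levelsA (suc (aLevels s))) (levelsA (aLevels s)) (levelsB (suc s)) m ⟨
    ((λ n → levelsA (suc (aLevels s)) n + levelsA (aLevels s) n) ⋆ levelsB (suc s)) m
      ≈⟨ ⋆-congˡ (levelsB (suc s)) m (λ n → levelsA-suc+levelsA n (aLevels s)) ⟩
    (aPair s ⋆ levelsB (suc s)) m ∎

  validSum-closed : ∀ m → b ℕ.+ suc m ℕ.* k ≤ N →
    LHS R a b k r (suc m) d N μ ν q ≈ topA (suc m) 0 + ∑ (suc m) (λ s → (aPair s ⋆ levelsB (suc s)) (suc m))
  validSum-closed m bound = begin
    LHS R a b k r (suc m) d N μ ν q
      ≈⟨ sumOver-filterB valid wt (box (suc m)) ⟩
    sumOver (box (suc m)) (λ t → when (valid t) (wt t))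
      ≈⟨ validSum-headSums (suc m) ⟩
    ∑ N (λ s → headSum (suc m) (aPart s) + headSum (suc m) (bPart s))
      ≈⟨ ∑-cong-∀ N (λ s → headSums-level m s bound) ⟩
    ∑ N (λ s → topA (suc m) s + topB (suc m) s)
      ≡⟨ ≡.cong (λ l → ∑ l (λ s → topA (suc m) s + topB (suc m) s)) (≡.sym (ℕₚ.m+[n∸m]≡n 2+m≤N)) ⟩
    ∑ (suc (suc m) ℕ.+ (N ∸ suc (suc m))) (λ s → topA (suc m) s + topB (suc m) s)
      ≈⟨ ∑-truncate (suc (suc m)) (N ∸ suc (suc m)) _ (λ s 2+m≤s →
           trans (+-cong (topA-vanish (suc m) s 2+m≤s) (topB-vanish (suc m) s (ℕₚ.<⇒≤ 2+m≤s))) (+-identityʳ 0#)) ⟩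
    ∑ (suc (suc m)) (λ s → topA (suc m) s + topB (suc m) s)
      ≈⟨ ∑-interleave (suc m) (topA (suc m)) (topB (suc m)) ⟩
    topA (suc m) 0 + (∑ (suc m) (λ s → topB (suc m) s + topA (suc m) (suc s)) + topB (suc m) (suc m))
      ≈⟨ +-congˡ (trans (+-cong (∑-cong-∀ (suc m) (topB+topA (suc m))) (topB-vanish (suc m) (suc m) ℕₚ.≤-refl))
                        (+-identityʳ _)) ⟩
    topA (suc m) 0 + ∑ (suc m) (λ s → (aPair s ⋆ levelsB (suc s)) (suc m)) ∎
    where
    2+m≤N : suc (suc m) ≤ N
    2+m≤N = ℕₚ.≤-trans (ℕₚ.+-mono-≤ (ℕₚ.≤-trans 1≤a (ℕₚ.<⇒≤ a<b)) (ℕₚ.m≤m*n (suc m) k)) bound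

triangle-suc-*2 : ∀ j → triangle (suc j) ℕ.* 2 ≡ suc j ℕ.* j
triangle-suc-*2 zero    = ≡.refl
triangle-suc-*2 (suc j) = ≡.trans (distrib (triangle (suc j)) j) (≡.trans (≡.cong (ℕ._+ 2 ℕ.* suc j) (triangle-suc-*2 j)) (collect j))
  where
  distrib : ∀ t j → (t ℕ.+ suc j) ℕ.* 2 ≡ t ℕ.* 2 ℕ.+ 2 ℕ.* suc j
  distrib = ℕSolver.solve-∀
  collect : ∀ j → suc j ℕ.* j ℕ.+ 2 ℕ.* suc j ≡ suc (suc j) ℕ.* suc j
  collect = ℕSolver.solve-∀

triangle-div : ∀ i → (i ℕ.* (i ∸ 1)) ℕ./ 2 ≡ triangle i
triangle-div zero    = ≡.refl
triangle-div (suc j) = ≡.trans (≡.cong (ℕ._/ 2) (≡.sym (triangle-suc-*2 j))) (m*n/n≡m (triangle (suc j)) 2)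

triangle-double : ∀ s → triangle s ℕ.+ triangle s ≡ s ℕ.* s ∸ s
triangle-double zero    = ≡.refl
triangle-double (suc j) = begin
  triangle (suc j) ℕ.+ triangle (suc j)        ≡⟨ double (triangle (suc j)) ⟩
  triangle (suc j) ℕ.* 2                       ≡⟨ triangle-suc-*2 j ⟩
  suc j ℕ.* j                                  ≡⟨ ℕₚ.m+n∸m≡n (suc j) (suc j ℕ.* j) ⟨
  suc j ℕ.+ suc j ℕ.* j ∸ suc j                ≡⟨ ≡.cong (_∸ suc j) (ℕₚ.*-suc (suc j) j) ⟨
  suc j ℕ.* suc j ∸ suc j                      ∎
  where
  open ≡.≡-Reasoning
  double : ∀ t → t ℕ.+ t ≡ t ℕ.* 2
  double = ℕSolver.solve-∀

gfun-top : ∀ h t s → ((+ h ℤ.- + t) ℤ.+ + suc s) ℤ.- + 1 ≡ (h ℕ.+ s) ⊖ t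
gfun-top h t s = begin
  ((+ h ℤ.- + t) ℤ.+ + suc s) ℤ.- + 1         ≡⟨ ≡.cong (λ w → ((+ h ℤ.- + t) ℤ.+ w) ℤ.- + 1) (≡.trans (≡.cong +_ (ℕₚ.+-comm 1 s)) (ℤₚ.pos-+ s 1)) ⟩
  ((+ h ℤ.- + t) ℤ.+ (+ s ℤ.+ + 1)) ℤ.- + 1   ≡⟨ cancel (+ h) (+ t) (+ s) ⟩
  (+ h ℤ.+ + s) ℤ.- + t                       ≡⟨ ≡.cong (ℤ._- + t) (ℤₚ.pos-+ h s) ⟨
  + (h ℕ.+ s) ℤ.- + t                         ≡⟨ ℤₚ.m-n≡m⊖n (h ℕ.+ s) t ⟩
  (h ℕ.+ s) ⊖ t                               ∎
  where
  open ≡.≡-Reasoning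
  cancel : ∀ (x y z : ℤ) → ((x ℤ.- y) ℤ.+ (z ℤ.+ + 1)) ℤ.- + 1 ≡ (x ℤ.+ z) ℤ.- y
  cancel = ℤSolver.solve-∀

module RightHandSide {c ℓ} (R : CommutativeRing c ℓ) (k′ a b r d N : ℕ)
                     (1≤a : 1 ≤ a) (a<b : a < b) (b≤k : b ≤ suc k′) (1≤r : 1 ≤ r)
                     (μ ν q : CommutativeRing.Carrier R) (c₀ : ℕ) (bottom : Bottom a b d c₀) where

  open ClosedForms R k′ a b r d N 1≤a a<b b≤k 1≤r μ ν q c₀ bottom public

  ⋆-levelsB-suc : ∀ F m s → s < m →
    (F ⋆ levelsB (suc s)) m ≈ ∑ (suc (m ∸ suc s)) (λ h → F (m ∸ (suc s ℕ.+ h)) * (pow R Y (suc s ℕ.+ h) * (pow R Q (triangle (suc s)) * g₊ h s)))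
  ⋆-levelsB-suc F m s s<m = begin
    ∑ (suc m) G                                          ≡⟨ ≡.cong (λ l → ∑ l G) (≡.sym 1+s+[m∸s]≡1+m) ⟩
    ∑ (suc s ℕ.+ suc (m ∸ suc s)) G                      ≈⟨ ∑-split (suc s) (suc (m ∸ suc s)) G ⟩
    ∑ (suc s) G + ∑ (suc (m ∸ suc s)) (λ h → G (suc s ℕ.+ h))
      ≈⟨ +-cong (∑-zero (suc s) G (λ n n<1+s → trans (*-congˡ (levelsB-below (suc s) n n<1+s)) (zeroʳ _)))
                (∑-cong-∀ (suc (m ∸ suc s)) (λ h → *-congˡ (levelsB-at h))) ⟩
    0# + ∑ (suc (m ∸ suc s)) (λ h → F (m ∸ (suc s ℕ.+ h)) * (pow R Y (suc s ℕ.+ h) * (pow R Q (triangle (suc s)) * g₊ h s)))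
      ≈⟨ +-identityˡ _ ⟩
    ∑ (suc (m ∸ suc s)) (λ h → F (m ∸ (suc s ℕ.+ h)) * (pow R Y (suc s ℕ.+ h) * (pow R Q (triangle (suc s)) * g₊ h s))) ∎
    where
    G : ℕ → Carrier
    G n = F (m ∸ n) * levelsB (suc s) n
    1+s+[m∸s]≡1+m : suc s ℕ.+ suc (m ∸ suc s) ≡ suc m
    1+s+[m∸s]≡1+m = ≡.trans (ℕₚ.+-suc (suc s) (m ∸ suc s)) (≡.cong suc (ℕₚ.m+[n∸m]≡n s<m))
    levelsB-at : ∀ h → levelsB (suc s) (suc s ℕ.+ h) ≈ pow R Y (suc s ℕ.+ h) * (pow R Q (triangle (suc s)) * g₊ h s)
    levelsB-at h = trans (levelsB-closed s (suc s ℕ.+ h))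
      (trans (when-true _ (≤⇒≤ᵇ-true (ℕₚ.m≤m+n (suc s) h)))
             (*-congˡ (*-congˡ (reflexive (≡.cong (λ l → g₊ l s) (ℕₚ.m+n∸m≡n (suc s) h))))))

  doubleSum-∑ : ∀ m (f : ℕ → ℕ → Carrier) → doubleSum R m f ≈ ∑ m (λ s → ∑ (suc (m ∸ suc s)) (λ h → f h (suc s)))
  doubleSum-∑ m f = begin
    sumR R (map (λ s → sumR R (map (λ h → f h s) (upTo (suc (m ∸ s))))) (map suc (upTo m)))
      ≡⟨ ≡.cong (sumR R) (≡.sym (Listₚ.map-∘ (upTo m))) ⟩
    sumR R (map (λ s → sumR R (map (λ h → f h (suc s)) (upTo (suc (m ∸ suc s))))) (upTo m))
      ≈⟨ sumR-upTo m _ ⟩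
    ∑ m (λ s → sumR R (map (λ h → f h (suc s)) (upTo (suc (m ∸ suc s)))))
      ≈⟨ ∑-cong-∀ m (λ s → sumR-upTo (suc (m ∸ suc s)) _) ⟩
    ∑ m (λ s → ∑ (suc (m ∸ suc s)) (λ h → f h (suc s))) ∎

  qbin⊖≈gauss∸ : ∀ n t j → qbin R q k (n ⊖ t) (+ j) ≈ gauss∸ Q n t j
  qbin⊖≈gauss∸ n       zero    j = refl
  qbin⊖≈gauss∸ zero    (suc t) j = refl
  qbin⊖≈gauss∸ (suc n) (suc t) j =
    trans (reflexive (≡.cong (λ z → qbin R q k z (+ j)) (ℤₚ.[1+m]⊖[1+n]≡m⊖n n t))) (qbin⊖≈gauss∸ n t j)

  gfun≈g₊ : ∀ h s → gfun R k r q h (suc s) ≈ g₊ h s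
  gfun≈g₊ h s = trans (sumR-upTo (suc (suc s)) _) (∑-cong-∀ (suc (suc s)) term)
    where
    term : ∀ i → pow R (- 1#) i * (pow R q (r ℕ.* k ℕ.* ((i ℕ.* (i ∸ 1)) ℕ./ 2))
                   * (qbin R q (r ℕ.* k) (+ suc s) (+ i) * qbin R q k (((+ h ℤ.- + (r ℕ.* i)) ℤ.+ + suc s) ℤ.- + 1) (+ suc s ℤ.- + 1)))
                 ≈ coeff i * (gaussN R Qr (suc s) i * gauss∸ Q (h ℕ.+ s) (r ℕ.* i) s)
    term i = trans (*-congˡ (*-cong (trans (pow-* q (r ℕ.* k) _) (pow-congʳ Qr (triangle-div i)))
                                    (*-congˡ (trans (reflexive (≡.cong (λ z → qbin R q k z (+ s)) (gfun-top h (r ℕ.* i) s)))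
                                                    (qbin⊖≈gauss∸ (h ℕ.+ s) (r ℕ.* i) s)))))
                   (sym (*-assoc _ _ _))

  ∑-aPair≈doubleSum : ∀ m (f : ℕ → ℕ → Carrier) →
    (∀ s h → suc s ℕ.+ h ≤ m → aPair s (m ∸ (suc s ℕ.+ h)) * (pow R Y (suc s ℕ.+ h) * (pow R Q (triangle (suc s)) * g₊ h s)) ≈ f h (suc s)) →
    ∑ m (λ s → (aPair s ⋆ levelsB (suc s)) m) ≈ doubleSum R m f
  ∑-aPair≈doubleSum m f summands = begin
    ∑ m (λ s → (aPair s ⋆ levelsB (suc s)) m)
      ≈⟨ ∑-cong m (λ s s<m → trans (⋆-levelsB-suc (aPair s) m s s<m) (∑-cong (suc (m ∸ suc s)) (λ h h<1+m∸s → summands s h (bound s h s<m h<1+m∸s)))) ⟩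
    ∑ m (λ s → ∑ (suc (m ∸ suc s)) (λ h → f h (suc s)))
      ≈⟨ doubleSum-∑ m f ⟨
    doubleSum R m f ∎
    where
    bound : ∀ s h → s < m → h < suc (m ∸ suc s) → suc s ℕ.+ h ≤ m
    bound s h s<m h<1+m∸s = ℕₚ.≤-trans (ℕₚ.+-monoʳ-≤ (suc s) (ℕₚ.≤-pred h<1+m∸s)) (ℕₚ.≤-reflexive (ℕₚ.m+[n∸m]≡n s<m))

  pow-X : ∀ n → pow R X n ≈ pow R μ n * pow R q (n ℕ.* a)
  pow-X n = trans (pow-distrib-* μ (pow R q a) n) (*-congˡ (trans (sym (pow-* q a n)) (pow-congʳ q (ℕₚ.*-comm a n))))

  pow-Y : ∀ n → pow R Y n ≈ pow R ν n * pow R q (n ℕ.* b)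
  pow-Y n = trans (pow-distrib-* ν (pow R q b) n) (*-congˡ (trans (sym (pow-* q b n)) (pow-congʳ q (ℕₚ.*-comm b n))))

module SmallestPartA {c ℓ} (R : CommutativeRing c ℓ) (k′ a b r N : ℕ)
                     (1≤a : 1 ≤ a) (a<b : a < b) (b≤k : b ≤ suc k′) (1≤r : 1 ≤ r)
                     (μ ν q : CommutativeRing.Carrier R) where

  open RightHandSide R k′ a b r a N 1≤a a<b b≤k 1≤r μ ν q 0 (inj₁ (≡.refl , ≡.refl))

  topA-zero-closed : ∀ m → topA (suc m) 0 ≈ pow R μ (suc m) * pow R q (suc m ℕ.* a)
  topA-zero-closed m = begin
    topA (suc m) 0                                   ≈⟨ topA-zero (suc m) ⟩
    levelsA 1 (suc m)                                ≈⟨ levelsA-closed m 0 ⟩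
    pow R X₀ (suc m) * (1# * gaussN R Q m 0)         ≈⟨ *-cong (pow-congˡ (suc m) (*-identityʳ X)) (trans (*-identityˡ _) (gauss-zero Q m)) ⟩
    pow R X (suc m) * 1#                             ≈⟨ trans (*-identityʳ _) (pow-X (suc m)) ⟩
    pow R μ (suc m) * pow R q (suc m ℕ.* a)          ∎

  summand : ∀ m s h → suc s ℕ.+ h ≤ m →
    aPair s (m ∸ (suc s ℕ.+ h)) * (pow R Y (suc s ℕ.+ h) * (pow R Q (triangle (suc s)) * g₊ h s))
      ≈ pow R μ (m ∸ (h ℕ.+ suc s)) * (pow R ν (h ℕ.+ suc s)
          * (pow R q ((m ∸ (h ℕ.+ suc s)) ℕ.* a ℕ.+ (h ℕ.+ suc s) ℕ.* b ℕ.+ k ℕ.* (suc s ℕ.* suc s ∸ suc s))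
          * (gfun R k r q h (suc s) * qbin R q k (+ (m ∸ (h ℕ.+ suc s))) (+ suc s))))
  summand m s h _ = begin
    (pow R X₀ (m ∸ (S ℕ.+ h)) * (Δ * gaussN R Q (m ∸ (S ℕ.+ h)) S)) * (pow R Y (S ℕ.+ h) * (Δ * g₊ h s))
      ≡⟨ ≡.cong (λ l → (pow R X₀ (m ∸ l) * (Δ * gaussN R Q (m ∸ l) S)) * (pow R Y l * (Δ * g₊ h s))) (ℕₚ.+-comm S h) ⟩
    (pow R X₀ n * (Δ * G)) * (pow R Y (h ℕ.+ S) * (Δ * g₊ h s))
      ≈⟨ *-cong (*-congʳ (trans (pow-congˡ n (*-identityʳ X)) (pow-X n))) (*-congʳ (pow-Y (h ℕ.+ S))) ⟩
    ((pow R μ n * qa) * (Δ * G)) * ((pow R ν (h ℕ.+ S) * qb) * (Δ * g₊ h s))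
      ≈⟨ regroup (pow R μ n) qa Δ G (pow R ν (h ℕ.+ S)) qb (g₊ h s) ⟩
    pow R μ n * (pow R ν (h ℕ.+ S) * (((qa * qb) * (Δ * Δ)) * (g₊ h s * G)))
      ≈⟨ *-congˡ (*-congˡ (*-cong (sym q-exponent) (*-congʳ (sym (gfun≈g₊ h s))))) ⟩
    pow R μ n * (pow R ν (h ℕ.+ S) * (pow R q (n ℕ.* a ℕ.+ (h ℕ.+ S) ℕ.* b ℕ.+ k ℕ.* (S ℕ.* S ∸ S)) * (gfun R k r q h S * G))) ∎
    where
    S n : ℕ
    S = suc s
    n = m ∸ (h ℕ.+ S)
    Δ G qa qb : Carrier
    Δ  = pow R Q (triangle S)
    G  = gaussN R Q n S
    qa = pow R q (n ℕ.* a)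
    qb = pow R q ((h ℕ.+ S) ℕ.* b)
    regroup : ∀ m qa t g n qb g₊ → ((m * qa) * (t * g)) * ((n * qb) * (t * g₊)) ≈ m * (n * (((qa * qb) * (t * t)) * (g₊ * g)))
    regroup = solve 7 (λ m qa t g n qb g₊ →
      ((m :* qa) :* (t :* g)) :* ((n :* qb) :* (t :* g₊)) := m :* (n :* (((qa :* qb) :* (t :* t)) :* (g₊ :* g)))) refl
    q-exponent : pow R q (n ℕ.* a ℕ.+ (h ℕ.+ S) ℕ.* b ℕ.+ k ℕ.* (S ℕ.* S ∸ S)) ≈ (qa * qb) * (Δ * Δ)
    q-exponent = begin
      pow R q (n ℕ.* a ℕ.+ (h ℕ.+ S) ℕ.* b ℕ.+ k ℕ.* (S ℕ.* S ∸ S))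
        ≈⟨ pow-+ q (n ℕ.* a ℕ.+ (h ℕ.+ S) ℕ.* b) _ ⟩
      pow R q (n ℕ.* a ℕ.+ (h ℕ.+ S) ℕ.* b) * pow R q (k ℕ.* (S ℕ.* S ∸ S))
        ≈⟨ *-cong (pow-+ q (n ℕ.* a) _) (pow-congʳ q (≡.cong (k ℕ.*_) (≡.sym (triangle-double S)))) ⟩
      (qa * qb) * pow R q (k ℕ.* (triangle S ℕ.+ triangle S))
        ≈⟨ *-congˡ (trans (pow-* q k (triangle S ℕ.+ triangle S)) (pow-+ Q (triangle S) (triangle S))) ⟩
      (qa * qb) * (Δ * Δ) ∎

  LHS≈RHSa : ∀ m → b ℕ.+ suc m ℕ.* k ≤ N → LHS R a b k r (suc m) a N μ ν q ≈ RHSa R a b k r (suc m) μ ν q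
  LHS≈RHSa m bound = begin
    LHS R a b k r (suc m) a N μ ν q
      ≈⟨ validSum-closed m bound ⟩
    topA (suc m) 0 + ∑ (suc m) (λ s → (aPair s ⋆ levelsB (suc s)) (suc m))
      ≈⟨ +-cong (topA-zero-closed m) (∑-aPair≈doubleSum (suc m) _ (summand (suc m))) ⟩
    RHSa R a b k r (suc m) μ ν q ∎

Q-exponent : ∀ m s h → suc s ℕ.+ h ≤ m → s ≤ m ∸ (h ℕ.+ suc s) →
  (suc s ℕ.* suc s ∸ suc s) ℕ.+ ((m ℕ.+ 1) ∸ (h ℕ.+ 2 ℕ.* suc s)) ≡ (m ∸ (h ℕ.+ suc s)) ℕ.+ (triangle s ℕ.+ triangle (suc s))
Q-exponent m s h 1+s+h≤m s≤n = begin
  (S ℕ.* S ∸ S) ℕ.+ ((m ℕ.+ 1) ∸ (h ℕ.+ 2 ℕ.* S))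
    ≡⟨ ≡.cong (λ l → (S ℕ.* S ∸ S) ℕ.+ ((l ℕ.+ 1) ∸ (h ℕ.+ 2 ℕ.* S))) m≡ ⟨
  (S ℕ.* S ∸ S) ℕ.+ ((((s ℕ.+ e) ℕ.+ (h ℕ.+ S)) ℕ.+ 1) ∸ (h ℕ.+ 2 ℕ.* S))
    ≡⟨ ≡.cong₂ ℕ._+_ (≡.sym (triangle-double S)) (≡.trans (≡.cong (_∸ (h ℕ.+ 2 ℕ.* S)) (reorder s e h)) (ℕₚ.m+n∸n≡m e (h ℕ.+ 2 ℕ.* S))) ⟩
  (triangle s ℕ.+ s ℕ.+ (triangle s ℕ.+ s)) ℕ.+ e
    ≡⟨ regroup (triangle s) s e ⟩
  (s ℕ.+ e) ℕ.+ (triangle s ℕ.+ triangle S)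
    ≡⟨ ≡.cong (ℕ._+ (triangle s ℕ.+ triangle S)) s+e≡n ⟩
  n ℕ.+ (triangle s ℕ.+ triangle S) ∎
  where
  open ≡.≡-Reasoning
  S n e : ℕ
  S = suc s
  n = m ∸ (h ℕ.+ S)
  e = n ∸ s
  s+e≡n : s ℕ.+ e ≡ n
  s+e≡n = ℕₚ.m+[n∸m]≡n s≤n
  m≡ : (s ℕ.+ e) ℕ.+ (h ℕ.+ S) ≡ m
  m≡ = ≡.trans (≡.cong (ℕ._+ (h ℕ.+ S)) s+e≡n) (ℕₚ.m∸n+n≡m (ℕₚ.≤-trans (ℕₚ.≤-reflexive (ℕₚ.+-comm h S)) 1+s+h≤m))
  reorder : ∀ s e h → ((s ℕ.+ e) ℕ.+ (h ℕ.+ suc s)) ℕ.+ 1 ≡ e ℕ.+ (h ℕ.+ 2 ℕ.* suc s)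
  reorder = ℕSolver.solve-∀
  regroup : ∀ t s e → (t ℕ.+ s ℕ.+ (t ℕ.+ s)) ℕ.+ e ≡ (s ℕ.+ e) ℕ.+ (t ℕ.+ (t ℕ.+ s))
  regroup = ℕSolver.solve-∀

module SmallestPartB {c ℓ} (R : CommutativeRing c ℓ) (k′ a b r N : ℕ)
                     (1≤a : 1 ≤ a) (a<b : a < b) (b≤k : b ≤ suc k′) (1≤r : 1 ≤ r)
                     (μ ν q : CommutativeRing.Carrier R) where

  open RightHandSide R k′ a b r b N 1≤a a<b b≤k 1≤r μ ν q 1 (inj₂ (≡.refl , ≡.refl))

  topA-zero-vanishes : ∀ m → topA (suc m) 0 ≈ 0#
  topA-zero-vanishes = topA-zero ∘ suc

  q-power : ∀ m s h → suc s ℕ.+ h ≤ m → s ≤ m ∸ (h ℕ.+ suc s) →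
    let n = m ∸ (h ℕ.+ suc s) in
    pow R q (n ℕ.* a ℕ.+ (h ℕ.+ suc s) ℕ.* b ℕ.+ k ℕ.* (suc s ℕ.* suc s ∸ suc s) ℕ.+ k ℕ.* ((m ℕ.+ 1) ∸ (h ℕ.+ 2 ℕ.* suc s)))
      ≈ (pow R q (n ℕ.* a) * pow R q ((h ℕ.+ suc s) ℕ.* b)) * (pow R Q n * (pow R Q (triangle s) * pow R Q (triangle (suc s))))
  q-power m s h 1+s+h≤m s≤n = begin
    pow R q (n ℕ.* a ℕ.+ (h ℕ.+ S) ℕ.* b ℕ.+ k ℕ.* (S ℕ.* S ∸ S) ℕ.+ k ℕ.* ((m ℕ.+ 1) ∸ (h ℕ.+ 2 ℕ.* S)))
      ≡⟨ ≡.cong (pow R q) (≡.trans (ℕₚ.+-assoc (n ℕ.* a ℕ.+ (h ℕ.+ S) ℕ.* b) (k ℕ.* (S ℕ.* S ∸ S)) _)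
                                   (≡.cong (n ℕ.* a ℕ.+ (h ℕ.+ S) ℕ.* b ℕ.+_) (≡.sym (ℕₚ.*-distribˡ-+ k (S ℕ.* S ∸ S) _)))) ⟩
    pow R q (n ℕ.* a ℕ.+ (h ℕ.+ S) ℕ.* b ℕ.+ k ℕ.* ((S ℕ.* S ∸ S) ℕ.+ ((m ℕ.+ 1) ∸ (h ℕ.+ 2 ℕ.* S))))
      ≡⟨ ≡.cong (λ l → pow R q (n ℕ.* a ℕ.+ (h ℕ.+ S) ℕ.* b ℕ.+ k ℕ.* l)) (Q-exponent m s h 1+s+h≤m s≤n) ⟩
    pow R q (n ℕ.* a ℕ.+ (h ℕ.+ S) ℕ.* b ℕ.+ k ℕ.* (n ℕ.+ (triangle s ℕ.+ triangle S)))
      ≈⟨ trans (pow-+ q (n ℕ.* a ℕ.+ (h ℕ.+ S) ℕ.* b) _)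
               (*-cong (pow-+ q (n ℕ.* a) ((h ℕ.+ S) ℕ.* b)) (pow-* q k (n ℕ.+ (triangle s ℕ.+ triangle S)))) ⟩
    (pow R q (n ℕ.* a) * pow R q ((h ℕ.+ S) ℕ.* b)) * pow R Q (n ℕ.+ (triangle s ℕ.+ triangle S))
      ≈⟨ *-congˡ (trans (pow-+ Q n _) (*-congˡ (pow-+ Q (triangle s) (triangle S)))) ⟩
    (pow R q (n ℕ.* a) * pow R q ((h ℕ.+ S) ℕ.* b)) * (pow R Q n * (pow R Q (triangle s) * pow R Q (triangle S))) ∎
    where
    S n : ℕ
    S = suc s
    n = m ∸ (h ℕ.+ S)

  summand : ∀ m s h → suc s ℕ.+ h ≤ m →
    aPair s (m ∸ (suc s ℕ.+ h)) * (pow R Y (suc s ℕ.+ h) * (pow R Q (triangle (suc s)) * g₊ h s))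
      ≈ pow R μ (m ∸ (h ℕ.+ suc s)) * (pow R ν (h ℕ.+ suc s)
          * (pow R q ((m ∸ (h ℕ.+ suc s)) ℕ.* a ℕ.+ (h ℕ.+ suc s) ℕ.* b ℕ.+ k ℕ.* (suc s ℕ.* suc s ∸ suc s)
                        ℕ.+ k ℕ.* ((m ℕ.+ 1) ∸ (h ℕ.+ 2 ℕ.* suc s)))
          * (gfun R k r q h (suc s) * qbin R q k (+ (m ∸ (h ℕ.+ suc s))) (+ suc s ℤ.- + 1))))
  summand m s h 1+s+h≤m = begin
    (pow R X₀ (m ∸ (S ℕ.+ h)) * (Δₛ * gaussN R Q (m ∸ (S ℕ.+ h)) s)) * (pow R Y (S ℕ.+ h) * (Δ * g₊ h s))
      ≡⟨ ≡.cong (λ l → (pow R X₀ (m ∸ l) * (Δₛ * gaussN R Q (m ∸ l) s)) * (pow R Y l * (Δ * g₊ h s))) (ℕₚ.+-comm S h) ⟩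
    (pow R X₀ n * (Δₛ * G)) * (pow R Y (h ℕ.+ S) * (Δ * g₊ h s))
      ≈⟨ *-cong (*-congʳ (trans pow-X₀ (*-congʳ (pow-X n)))) (*-congʳ (pow-Y (h ℕ.+ S))) ⟩
    (((pow R μ n * qa) * pow R Q n) * (Δₛ * G)) * ((pow R ν (h ℕ.+ S) * qb) * (Δ * g₊ h s))
      ≈⟨ regroup (pow R μ n) qa (pow R Q n) Δₛ G (pow R ν (h ℕ.+ S)) qb Δ (g₊ h s) ⟩
    pow R μ n * (pow R ν (h ℕ.+ S) * (((qa * qb) * (pow R Q n * (Δₛ * Δ))) * (g₊ h s * G)))
      ≈⟨ *-congˡ (*-congˡ (by-cases (ℕₚ.≤-<-connex s n))) ⟩
    pow R μ n * (pow R ν (h ℕ.+ S) * (pow R q E * (gfun R k r q h S * G))) ∎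
    where
    S n E : ℕ
    S = suc s
    n = m ∸ (h ℕ.+ S)
    E = n ℕ.* a ℕ.+ (h ℕ.+ S) ℕ.* b ℕ.+ k ℕ.* (S ℕ.* S ∸ S) ℕ.+ k ℕ.* ((m ℕ.+ 1) ∸ (h ℕ.+ 2 ℕ.* S))
    Δₛ Δ G qa qb : Carrier
    Δₛ = pow R Q (triangle s)
    Δ  = pow R Q (triangle S)
    G  = gaussN R Q n s
    qa = pow R q (n ℕ.* a)
    qb = pow R q ((h ℕ.+ S) ℕ.* b)
    pow-X₀ : pow R X₀ n ≈ pow R X n * pow R Q n
    pow-X₀ = trans (pow-distrib-* X (Q * 1#) n) (*-congˡ (pow-congˡ n (*-identityʳ Q)))
    regroup : ∀ mu qa qn ts g nu qb t g₊ → (((mu * qa) * qn) * (ts * g)) * ((nu * qb) * (t * g₊))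
                                          ≈ mu * (nu * (((qa * qb) * (qn * (ts * t))) * (g₊ * g)))
    regroup = solve 9 (λ mu qa qn ts g nu qb t g₊ → (((mu :* qa) :* qn) :* (ts :* g)) :* ((nu :* qb) :* (t :* g₊))
                                                   := mu :* (nu :* (((qa :* qb) :* (qn :* (ts :* t))) :* (g₊ :* g)))) refl
    by-cases : (s ≤ n) ⊎ (n < s) → ((qa * qb) * (pow R Q n * (Δₛ * Δ))) * (g₊ h s * G) ≈ pow R q E * (gfun R k r q h S * G)
    by-cases (inj₂ n<s) = trans (*-congˡ (trans (*-congˡ (gauss-vanish Q n s n<s)) (zeroʳ _)))
                                (trans (zeroʳ _) (sym (trans (*-congˡ (trans (*-congˡ (gauss-vanish Q n s n<s)) (zeroʳ _))) (zeroʳ _))))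
    by-cases (inj₁ s≤n) = *-cong (sym (q-power m s h 1+s+h≤m s≤n)) (*-congʳ (sym (gfun≈g₊ h s)))

  LHS≈RHSb : ∀ m → b ℕ.+ suc m ℕ.* k ≤ N → LHS R a b k r (suc m) b N μ ν q ≈ RHSb R a b k r (suc m) μ ν q
  LHS≈RHSb m bound = begin
    LHS R a b k r (suc m) b N μ ν q
      ≈⟨ validSum-closed m bound ⟩
    topA (suc m) 0 + ∑ (suc m) (λ s → (aPair s ⋆ levelsB (suc s)) (suc m))
      ≈⟨ trans (+-congʳ (topA-zero-vanishes m)) (+-identityˡ _) ⟩
    ∑ (suc m) (λ s → (aPair s ⋆ levelsB (suc s)) (suc m))
      ≈⟨ ∑-aPair≈doubleSum (suc m) _ (summand (suc m)) ⟩
    RHSb R a b k r (suc m) μ ν q ∎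

open import Data.Nat using (_+_; _*_)

lemma3p4 : ∀ {c ℓ} (R : CommutativeRing c ℓ) (k a b r : ℕ)
    → 1 ≤ a → a < b → b ≤ k → 1 ≤ r
    → (m : ℕ) → 1 ≤ m
    → (N : ℕ) → b + m * k ≤ N
    → (μ ν q : CommutativeRing.Carrier R)
    → (CommutativeRing._≈_ R (LHS R a b k r m a N μ ν q) (RHSa R a b k r m μ ν q))
      × (CommutativeRing._≈_ R (LHS R a b k r m b N μ ν q) (RHSb R a b k r m μ ν q))
lemma3p4 R zero     a b r _   a<b b≤0 _   m       _  N _     μ ν q = ⊥-elim (ℕₚ.n≮0 (ℕₚ.<-≤-trans a<b b≤0))
lemma3p4 R (suc k′) a b r 1≤a a<b b≤k 1≤r (suc m) _  N bound μ ν q =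
  SmallestPartA.LHS≈RHSa R k′ a b r N 1≤a a<b b≤k 1≤r μ ν q m bound ,
  SmallestPartB.LHS≈RHSb R k′ a b r N 1≤a a<b b≤k 1≤r μ ν q m bound
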